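{- Let $q$ be a prime power, $k\ge 1$, $n=q^k-1$, and let $X=\mathcal{C}\subseteq\mathbb{F}_q^n$ be a $k$-dimensional dual Hamming code with generator polynomial $g(x)$, and let $w\in\mathbb{F}_q^n$ be the word corresponding to $g(x)$. Fix any linear order on $\mathbb{F}_q$. Then: (i) $(X,X^{\mathrm{maj}}(t),C)$ exhibits the cyclic sieving phenomenon if and only if $\gcd(n,\mathrm{cdes}(w))=1$; (ii) if $q=2$ (with order $0<1$), $(X,X^{\mathrm{inv}}(t),C)$ exhibits the cyclic sieving phenomenon if and only if $\gcd(n,\mathrm{wt}(w))=1$.
   Context: Words are identified with polynomials via $(w_1,\ldots,w_n)\mapsto w_1+w_2x+\cdots+w_nx^{n-1}\in\mathbb{F}_q[x]/(x^n-1)$. A polynomial $f\in\mathbb{F}_q[x]$ of degree $k$ is primitive if it is irreducible and the image of $x$ has multiplicative order $q^k-1$ in $\mathbb{F}_q[x]/(f)$. A $k$-dimensional dual Hamming code of length $n=q^k-1$ is the ideal of $\mathbb{F}_q[x]/(x^n-1)$ generated by $g(x)=(x^n-1)/g^\perp(x)$ with $g^\perp$ primitive of degree $k$. $C=\langle c\rangle\cong\mathbb{Z}/n\mathbb{Z}$ acts by cyclic shift $c(w_1,\ldots,w_n)=(w_2,\ldots,w_n,w_1)$. Statistics: $\mathrm{maj}(w)=\sum_{1\le i\le n-1,\ w_i>w_{i+1}}i$; $\mathrm{inv}(w)=\#\{(i,j):i<j,\ w_i>w_j\}$; $\mathrm{cdes}(w)=\#\{1\le i\le n: w_i>w_{i+1}\}$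 with $w_{n+1}:=w_1$; $\mathrm{wt}(w)$ = number of ones. $X^{\mathrm{stat}}(t)=\sum_{x\in X}t^{\mathrm{stat}(x)}$. A triple $(X,X(t),C)$ exhibits the cyclic sieving phenomenon if for all integers $d$, $\#\{x\in X:c^d(x)=x\}=X(e^{2\pi i d/n})$. -}

module Defs where

open import Level using (0ℓ)
open import Data.Nat as ℕ using (ℕ; zero; suc; _∸_; _^_; _≤_; _<_)
open import Data.Nat.Primality using (Prime)
open import Data.Integer as ℤ using (ℤ)
open import Data.Integer.DivMod using (_%ℕ_)
open import Data.Fin as Fin using (Fin)
open import Data.List as L using (List; []; _∷_; _++_; [_]; map; filterᵇ; length; take; drop; replicate; allFin; concatMap; foldr; reverse)
open import Data.List.Properties using (≡-dec)
open import Data.Bool using (Bool; true; false; if_then_else_)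
open import Data.Bool.ListAction using (any)
open import Data.Product using (Σ; ∃; _×_; _,_)
open import Data.Sum using (_⊎_)
open import Relation.Nullary using (¬_; ⌊_⌋; yes; no)
open import Relation.Binary using (Rel; Tri; tri<; tri≈; tri>; IsStrictTotalOrder)
open import Relation.Binary.PropositionalEquality using (_≡_; _≢_)
open import Algebra.Core using (Op₁; Op₂)
open import Algebra.Structures using (IsCommutativeRing)
open import Algebra.Bundles using (CommutativeRing)

IsPrimePower : ℕ → Set
IsPrimePower q = Σ ℕ λ p → Σ ℕ λ e → Prime p × 1 ≤ e × q ≡ p ^ e

-- A finite field with q elements, realised on the carrier Fin q
-- (every finite field of order q is isomorphic to one of these).

record FiniteField (q : ℕ) : Set where
  infixl 6 _+_
  infixl 7 _*_
  field
    _+_ _*_ : Op₂ (Fin q)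
    -_      : Op₁ (Fin q)
    0# 1#   : Fin q
    isCommutativeRing : IsCommutativeRing _≡_ _+_ _*_ -_ 0# 1#
    0≢1     : 0# ≢ 1#
    inverse : ∀ x → x ≢ 0# → Σ (Fin q) λ y → x * y ≡ 1#

-- A stand-in for (ℂ, e^{2πi/n}): a characteristic-zero integral domain
-- together with a primitive n-th root of unity in it.  Evaluating an
-- integer polynomial at ζ^d gives a given integer in every such pair iff
-- it does so in ℂ at e^{2πi d/n} (both mean: Φ_n(t) divides P(t^d) - m).

module _ (R : CommutativeRing 0ℓ 0ℓ) where
  open CommutativeRing R
  powR : Carrier → ℕ → Carrier
  powR x zero    = 1#
  powR x (suc m) = x * powR x m

  natR : ℕ → Carrier
  natR zero    = 0#
  natR (suc m) = 1# + natR m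

  sumR : List Carrier → Carrier
  sumR = foldr _+_ 0#

record RootData (n : ℕ) : Set₁ where
  field
    𝕂 : CommutativeRing 0ℓ 0ℓ
  open CommutativeRing 𝕂
  field
    ζ        : Carrier
    domain   : ∀ x y → x * y ≈ 0# → x ≈ 0# ⊎ y ≈ 0#
    char0    : ∀ m → m ≢ 0 → ¬ (natR 𝕂 m ≈ 0#)
    root     : powR 𝕂 ζ n ≈ 1#
    isPrimitiveRoot : ∀ j → 1 ≤ j → j < n → ¬ (powR 𝕂 ζ j ≈ 1#)

allWords : (q n : ℕ) → List (List (Fin q))
allWords q zero    = [] ∷ []
allWords q (suc n) = concatMap (λ x → map (x ∷_) (allWords q n)) (allFin q)

shift : ∀ {A : Set} → List A → List A
shift []       = []
shift (x ∷ xs) = xs ++ [ x ]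

shiftPow : ∀ {A : Set} → ℕ → List A → List A
shiftPow zero    w = w
shiftPow (suc m) w = shift (shiftPow m w)

-- d mod n for an integer d (n = 0 never occurs in our use)
zmod : ℤ → ℕ → ℕ
zmod d zero    = 0
zmod d (suc m) = d %ℕ suc m

-- c^d for an integer d, using c^n = id
shiftZ : ∀ {A : Set} → ℕ → ℤ → List A → List A
shiftZ n d = shiftPow (zmod d n)

-- (X, X^stat(t), C) exhibits the CSP, C = Z/nZ acting by cyclic shift,
-- X given as a duplicate-free list of words of length n.
CSP : ∀ {q} → (n : ℕ) → List (List (Fin q)) → (List (Fin q) → ℕ) → Set₁
CSP {q} n X stat = (D : RootData n) → (d : ℤ) →
  let open RootData D
      open CommutativeRing 𝕂 using (_≈_)
  in natR 𝕂 (length (filterᵇ (λ v → ⌊ ≡-dec Fin._≟_ (shiftZ n d v) v ⌋) X))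
       ≈ sumR 𝕂 (map (λ v → powR 𝕂 (powR 𝕂 ζ (zmod d n)) (stat v)) X)

module FF {q : ℕ} (F : FiniteField q) where
  open FiniteField F

  -- polynomials as coefficient lists, constant term first
  Poly : Set
  Poly = List (Fin q)

  isZero : Fin q → Bool
  isZero a = ⌊ a Fin.≟ 0# ⌋

  dropZeros : List (Fin q) → List (Fin q)
  dropZeros []       = []
  dropZeros (a ∷ as) = if isZero a then dropZeros as else a ∷ as

  normalize : Poly → Poly
  normalize f = reverse (dropZeros (reverse f))

  _≈p_ : Poly → Poly → Set
  f ≈p g = normalize f ≡ normalize g

  -- degree (the zero polynomial gets degree 0; never relevant below)
  deg : Poly → ℕ
  deg f = length (normalize f) ∸ 1

  _+p_ : Poly → Poly → Poly
  []       +p g        = g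
  (a ∷ as) +p []       = a ∷ as
  (a ∷ as) +p (b ∷ bs) = (a + b) ∷ (as +p bs)

  negp : Poly → Poly
  negp = map -_

  _*p_ : Poly → Poly → Poly
  []       *p g = []
  (a ∷ as) *p g = map (a *_) g +p (0# ∷ (as *p g))

  xpowMinus1 : ℕ → Poly
  xpowMinus1 j = (replicate j 0# ++ [ 1# ]) +p negp [ 1# ]

  _∣p_ : Poly → Poly → Set
  f ∣p h = Σ Poly λ a → (a *p f) ≈p h

  Irreducible : Poly → Set
  Irreducible f = 1 ≤ deg f × (∀ a b → (a *p b) ≈p f → deg a ≡ 0 ⊎ deg b ≡ 0)

  -- f primitive of degree k: irreducible, and x has multiplicative
  -- order q^k - 1 in F_q[x]/(f)
  Primitive : ℕ → Poly → Set
  Primitive k f = deg f ≡ k × Irreducible f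
    × f ∣p xpowMinus1 (q ^ k ∸ 1)
    × (∀ j → 1 ≤ j → j < q ^ k ∸ 1 → ¬ (f ∣p xpowMinus1 j))

  toWord : ℕ → Poly → List (Fin q)
  toWord n f = take n (f ++ replicate n 0#)

  -- reduction modulo x^n - 1 (fuel = length of the list)
  wrap : ℕ → ℕ → Poly → Poly
  wrap n zero    f = f
  wrap n (suc m) f = take n f +p wrap n m (drop n f)

  -- multiplication in F_q[x]/(x^n - 1), on words of length n
  cmul : ℕ → List (Fin q) → List (Fin q) → List (Fin q)
  cmul n a b = toWord n (wrap n (length (a *p b)) (a *p b))

  -- the ideal generated by (the word of) g in F_q[x]/(x^n - 1)
  inIdeal : ℕ → List (Fin q) → List (Fin q) → Bool
  inIdeal n gw v = any (λ a → ⌊ ≡-dec Fin._≟_ (cmul n a gw) v ⌋) (allWords q n)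

  code : ℕ → List (Fin q) → List (List (Fin q))
  code n gw = filterᵇ (inIdeal n gw) (allWords q n)

  wt : List (Fin q) → ℕ
  wt w = length (filterᵇ (λ a → ⌊ a Fin.≟ 1# ⌋) w)

  module Stats {_<F_ : Rel (Fin q) 0ℓ} (O : IsStrictTotalOrder _≡_ _<F_) where
    _>b_ : Fin q → Fin q → Bool
    a >b b with IsStrictTotalOrder.compare O a b
    ... | tri< _ _ _ = false
    ... | tri≈ _ _ _ = false
    ... | tri> _ _ _ = true

    -- maj, positions counted from i
    majFrom : ℕ → List (Fin q) → ℕ
    majFrom i []           = 0
    majFrom i (a ∷ [])     = 0
    majFrom i (a ∷ b ∷ w)  = (if a >b b then i else 0) ℕ.+ majFrom (suc i) (b ∷ w)

    maj : List (Fin q) → ℕ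
    maj = majFrom 1

    des : List (Fin q) → ℕ
    des []          = 0
    des (a ∷ [])    = 0
    des (a ∷ b ∷ w) = (if a >b b then 1 else 0) ℕ.+ des (b ∷ w)

    cdes : List (Fin q) → ℕ
    cdes []      = 0
    cdes (a ∷ w) = des ((a ∷ w) ++ [ a ])

    inv : List (Fin q) → ℕ
    inv []      = 0
    inv (a ∷ w) = length (filterᵇ (a >b_) w) ℕ.+ inv w

module Submission where

module Congruences where
  open import Level using (_⊔_)
  open import Data.Product using (_,_)
  open import Algebra.Bundles using (CommutativeRing)
  open import Algebra.Structures using (IsCommutativeRing)

  module Congruence {c ℓ} (R : CommutativeRing c ℓ) where
    open CommutativeRing R
    open import Algebra.Properties.Ring ring
    open import Algebra.Definitions.RawMagma *-rawMagma using (_∣_; _,_) public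
    open import Algebra.Properties.Semiring.Divisibility semiring public
      using (∣ʳ-refl; ∣ʳ-reflexive; ∣ʳ-trans; ∣ʳ-respʳ-≈; ∣ʳ-respˡ-≈; _∣0; x∣ʳyx; x∣ʳy⇒x∣ʳzy)
    open import Relation.Binary.Reasoning.Setoid setoid
    import Relation.Binary.Reasoning.Setoid

    ∣-+ : ∀ {m x y} → m ∣ x → m ∣ y → m ∣ x + y
    ∣-+ {m} (s , sm≈x) (t , tm≈y) = s + t , trans (distribʳ m s t) (+-cong sm≈x tm≈y)

    ∣‿- : ∀ {m x} → m ∣ x → m ∣ - x
    ∣‿- {m} (s , sm≈x) = - s , trans (sym (-‿distribˡ-* s m)) (-‿cong sm≈x)

    x∣y⇒x∣yz : ∀ {x y} z → x ∣ y → x ∣ y * z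
    x∣y⇒x∣yz z x∣y = ∣ʳ-respʳ-≈ (*-comm z _) (x∣ʳy⇒x∣ʳzy z x∣y)

    ∣-*-∣ : ∀ {x y u v} → x ∣ y → u ∣ v → x * u ∣ y * v
    ∣-*-∣ {x} {y} {u} {v} (s , sx≈y) (t , tu≈v) = s * t , (begin
      (s * t) * (x * u)   ≈⟨ interchange s t x u ⟩
      (s * x) * (t * u)   ≈⟨ *-cong sx≈y tu≈v ⟩
      y * v               ∎)
      where open import Algebra.Properties.CommutativeSemigroup *-commutativeSemigroup using (interchange)

    infix 4 _≈[_]_
    record _≈[_]_ (x m y : Carrier) : Set (c ⊔ ℓ) where
      constructor mod
      field divides : m ∣ x - y
    open _≈[_]_ public

    ≈⇒mod : ∀ {x y} m → x ≈ y → x ≈[ m ] y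
    ≈⇒mod m x≈y = mod (∣ʳ-respʳ-≈ (sym (x≈y⇒x∙y⁻¹≈ε x≈y)) (m ∣0))

    mod-refl : ∀ {x} m → x ≈[ m ] x
    mod-refl m = ≈⇒mod m refl

    mod-sym : ∀ {x y m} → x ≈[ m ] y → y ≈[ m ] x
    mod-sym (mod m∣x-y) = mod (∣ʳ-respʳ-≈ (⁻¹-anti-homo‿- _ _) (∣‿- m∣x-y))

    mod-trans : ∀ {x y z m} → x ≈[ m ] y → y ≈[ m ] z → x ≈[ m ] z
    mod-trans {x} {y} {z} (mod m∣x-y) (mod m∣y-z) = mod (∣ʳ-respʳ-≈ telescope (∣-+ m∣x-y m∣y-z))
      where
      telescope : (x - y) + (y - z) ≈ x - z
      telescope = begin
        (x - y) + (y - z)   ≈⟨ +-assoc x (- y) (y - z) ⟩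
        x + (- y + (y - z)) ≈⟨ +-congˡ (+-assoc (- y) y (- z)) ⟨
        x + ((- y + y) - z) ≈⟨ +-congˡ (+-congʳ (-‿inverseˡ y)) ⟩
        x + (0# - z)        ≈⟨ +-congˡ (+-identityˡ (- z)) ⟩
        x - z               ∎

    +-cong-mod : ∀ {x x′ y y′ m} → x ≈[ m ] y → x′ ≈[ m ] y′ → x + x′ ≈[ m ] y + y′
    +-cong-mod {x} {x′} {y} {y′} (mod d) (mod d′) = mod (∣ʳ-respʳ-≈ regroup (∣-+ d d′))
      where
      regroup : (x - y) + (x′ - y′) ≈ (x + x′) - (y + y′)
      regroup = begin
        (x - y) + (x′ - y′)     ≈⟨ +-assoc x (- y) (x′ - y′) ⟩
        x + (- y + (x′ - y′))   ≈⟨ +-congˡ (+-assoc (- y) x′ (- y′)) ⟨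
        x + ((- y + x′) - y′)   ≈⟨ +-congˡ (+-congʳ (+-comm (- y) x′)) ⟩
        x + ((x′ - y) - y′)     ≈⟨ +-congˡ (+-assoc x′ (- y) (- y′)) ⟩
        x + (x′ + (- y - y′))   ≈⟨ +-assoc x x′ (- y - y′) ⟨
        (x + x′) + (- y - y′)   ≈⟨ +-congˡ (-‿+-comm y y′) ⟩
        (x + x′) - (y + y′)     ∎

    +-congˡ-mod : ∀ {x y m} z → x ≈[ m ] y → z + x ≈[ m ] z + y
    +-congˡ-mod {m = m} z = +-cong-mod (mod-refl {z} m)

    -‿cong-mod : ∀ {x y m} → x ≈[ m ] y → - x ≈[ m ] - y
    -‿cong-mod {x} {y} (mod d) = mod (∣ʳ-respʳ-≈ (trans (sym (-‿+-comm x (- y))) (+-congˡ (-‿cong (refl {x = - y})))) (∣‿- d))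

    *-congˡ-mod : ∀ {x y m} z → x ≈[ m ] y → z * x ≈[ m ] z * y
    *-congˡ-mod {x} {y} z (mod d) = mod (∣ʳ-respʳ-≈ (x[y-z]≈xy-xz z x y) (x∣ʳy⇒x∣ʳzy z d))

    *-cong-mod : ∀ {x x′ y y′ m} → x ≈[ m ] y → x′ ≈[ m ] y′ → x * x′ ≈[ m ] y * y′
    *-cong-mod {x} {x′} {y} {y′} {m} x≈y x′≈y′ = mod-trans
      (mod-trans (≈⇒mod m (*-comm x x′)) (mod-trans (*-congˡ-mod x′ x≈y) (≈⇒mod m (*-comm x′ y))))
      (*-congˡ-mod y x′≈y′)

    *-congʳ-mod : ∀ {x y m} z → x ≈[ m ] y → x * z ≈[ m ] y * z
    *-congʳ-mod {m = m} z x≈y = *-cong-mod x≈y (mod-refl {z} m)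

    ∣⇒mod0 : ∀ {m x} → m ∣ x → x ≈[ m ] 0#
    ∣⇒mod0 m∣x = mod (∣ʳ-respʳ-≈ (sym (trans (+-congˡ -0#≈0#) (+-identityʳ _))) m∣x)

    mod0⇒∣ : ∀ {m x} → x ≈[ m ] 0# → m ∣ x
    mod0⇒∣ (mod d) = ∣ʳ-respʳ-≈ (trans (+-congˡ -0#≈0#) (+-identityʳ _)) d

    mod-divisor : ∀ {m n x y} → m ∣ n → x ≈[ n ] y → x ≈[ m ] y
    mod-divisor m∣n (mod d) = mod (∣ʳ-trans m∣n d)

    quotientRing : Carrier → CommutativeRing c (c ⊔ ℓ)
    quotientRing m = record { isCommutativeRing = isQuotient }
      where
      lift : ∀ {x y} → x ≈ y → x ≈[ m ] y
      lift = ≈⇒mod m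
      isQuotient : IsCommutativeRing _≈[ m ]_ _+_ _*_ -_ 0# 1#
      isQuotient = record
        { isRing = record
          { +-isAbelianGroup = record
            { isGroup = record
              { isMonoid = record
                { isSemigroup = record
                  { isMagma = record
                    { isEquivalence = record { refl = mod-refl m ; sym = mod-sym ; trans = mod-trans }
                    ; ∙-cong = +-cong-mod }
                  ; assoc = λ x y z → lift (+-assoc x y z) }
                ; identity = (λ x → lift (+-identityˡ x)) , (λ x → lift (+-identityʳ x)) }
              ; inverse = (λ x → lift (-‿inverseˡ x)) , (λ x → lift (-‿inverseʳ x))
              ; ⁻¹-cong = -‿cong-mod }
            ; comm = λ x y → lift (+-comm x y) }
          ; *-cong = *-cong-mod
          ; *-assoc = λ x y z → lift (*-assoc x y z)
          ; *-identity = (λ x → lift (*-identityˡ x)) , (λ x → lift (*-identityʳ x))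
          ; distrib = (λ x y z → lift (distribˡ x y z)) , (λ x y z → lift (distribʳ x y z)) }
        ; *-comm = λ x y → lift (*-comm x y) }

    module ≈[]-Reasoning (m : Carrier) =
      Relation.Binary.Reasoning.Setoid (CommutativeRing.setoid (quotientRing m))

open Congruences

module Words where
  open import Data.Nat as ℕ using (ℕ; zero; suc; _≤_; _^_)
  import Data.Nat.Properties as ℕ
  open import Data.Fin using (Fin)
  open import Data.List using (List; []; _∷_; _++_; [_]; map; length; replicate; allFin; concatMap; cartesianProductWith)
  import Data.List.Properties as List
  open import Data.List.Membership.Propositional using (_∈_)
  open import Data.List.Membership.Propositional.Properties
    using (∈-cartesianProductWith⁺; ∈-allFin)
  open import Data.List.Relation.Unary.Any using (here; there)
  open import Data.List.Relation.Unary.All as All using (All; []; _∷_)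
  open import Data.List.Relation.Unary.AllPairs using ([]; _∷_)
  open import Data.List.Relation.Unary.Unique.Propositional using (Unique)
  import Data.List.Relation.Unary.Unique.Propositional.Properties as Unique
  open import Data.List.Relation.Binary.Permutation.Propositional using (_↭_)
  open import Data.List.Relation.Binary.BagAndSetEquality using (∼bag⇒↭)
  open import Data.List.Membership.Propositional.Properties.WithK using (unique∧set⇒bag)
  open import Data.Product using (_×_; _,_)
  open import Data.Empty using (⊥-elim)
  open import Function using (id)
  open import Function.Bundles using (mk⇔)
  open import Relation.Nullary using (yes; no)
  open import Relation.Binary.Definitions using (DecidableEquality)
  open import Relation.Binary.PropositionalEquality using (_≡_; _≢_; refl; sym; trans; cong; cong₂; subst)
  import Relation.Binary.PropositionalEquality
  open import Defs using (allWords; shift; shiftPow)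

  module _ {A : Set} where

    length-shift : ∀ (v : List A) → length (shift v) ≡ length v
    length-shift []      = refl
    length-shift (a ∷ v) = trans (List.length-++ v) (ℕ.+-comm (length v) 1)

    length-shiftPow : ∀ j (v : List A) → length (shiftPow j v) ≡ length v
    length-shiftPow zero    v = refl
    length-shiftPow (suc j) v = trans (length-shift (shiftPow j v)) (length-shiftPow j v)

    shiftPow-+ : ∀ i j (v : List A) → shiftPow i (shiftPow j v) ≡ shiftPow (i ℕ.+ j) v
    shiftPow-+ zero    j v = refl
    shiftPow-+ (suc i) j v = cong shift (shiftPow-+ i j v)

    shiftPow-suc : ∀ j (v : List A) → shiftPow (suc j) v ≡ shiftPow j (shift v)
    shiftPow-suc zero    v = refl
    shiftPow-suc (suc j) v = cong shift (shiftPow-suc j v)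

    shiftPow-++ : ∀ (xs ys : List A) → shiftPow (length xs) (xs ++ ys) ≡ ys ++ xs
    shiftPow-++ []       ys = sym (List.++-identityʳ ys)
    shiftPow-++ (x ∷ xs) ys = begin
      shiftPow (suc (length xs)) (x ∷ xs ++ ys)     ≡⟨ shiftPow-suc (length xs) (x ∷ xs ++ ys) ⟩
      shiftPow (length xs) (shift (x ∷ xs ++ ys))   ≡⟨ cong (shiftPow (length xs)) (List.++-assoc xs ys [ x ]) ⟩
      shiftPow (length xs) (xs ++ ys ++ [ x ])       ≡⟨ shiftPow-++ xs (ys ++ [ x ]) ⟩
      (ys ++ [ x ]) ++ xs                            ≡⟨ List.++-assoc ys [ x ] xs ⟩
      ys ++ x ∷ xs                                   ∎
      where open Relation.Binary.PropositionalEquality.≡-Reasoning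

    shiftPow-length : ∀ (v : List A) → shiftPow (length v) v ≡ v
    shiftPow-length v = trans (cong (shiftPow (length v)) (sym (List.++-identityʳ v))) (shiftPow-++ v [])

    shiftPow-replicate : ∀ j n (a : A) → shiftPow j (replicate n a) ≡ replicate n a
    shiftPow-replicate zero    n a = refl
    shiftPow-replicate (suc j) n a = trans (cong shift (shiftPow-replicate j n a)) (shift-replicate n)
      where
      shift-replicate : ∀ n → shift (replicate n a) ≡ replicate n a
      shift-replicate zero    = refl
      shift-replicate (suc n) = snoc-replicate n
        where
        snoc-replicate : ∀ n → replicate n a ++ [ a ] ≡ a ∷ replicate n a
        snoc-replicate zero    = refl
        snoc-replicate (suc n) = cong (a ∷_) (snoc-replicate n)

  module _ {A : Set} (_≟_ : DecidableEquality A) where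

    private
      remove : ∀ {x : A} {ys} → x ∈ ys → List A
      remove {ys = _ ∷ ys} (here _)  = ys
      remove {ys = y ∷ _}  (there p) = y ∷ remove p

      length-remove : ∀ {x : A} {ys} (p : x ∈ ys) → suc (length (remove p)) ≡ length ys
      length-remove (here _)  = refl
      length-remove (there p) = cong suc (length-remove p)

      ∈-remove : ∀ {x y : A} {ys} (p : x ∈ ys) → y ∈ ys → y ≢ x → y ∈ remove p
      ∈-remove (here refl) (here refl) y≢x = ⊥-elim (y≢x refl)
      ∈-remove (here refl) (there q)   y≢x = q
      ∈-remove (there p)   (here refl) y≢x = here refl
      ∈-remove (there p)   (there q)   y≢x = there (∈-remove p q y≢x)

    pigeonhole : ∀ {xs ys : List A} → Unique xs → All (_∈ ys) xs → length ys ≤ length xs → ∀ {y} → y ∈ ys → y ∈ xs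
    pigeonhole {[]}     {[]}    _ _ _ ()
    pigeonhole {x ∷ xs} {ys} (x∉xs ∷ uxs) (x∈ys ∷ xs⊆ys) |ys|≤ {y} y∈ys with y ≟ x
    ... | yes refl = here refl
    ... | no  y≢x  = there (pigeonhole uxs xs⊆remove |remove|≤ (∈-remove x∈ys y∈ys y≢x))
      where
      xs⊆remove : All (_∈ remove x∈ys) xs
      xs⊆remove = All.zipWith (λ (z∈ys , x≢z) → ∈-remove x∈ys z∈ys (λ z≡x → x≢z (sym z≡x))) (xs⊆ys , x∉xs)
      |remove|≤ : length (remove x∈ys) ≤ length xs
      |remove|≤ = ℕ.≤-pred (subst (_≤ suc (length xs)) (sym (length-remove x∈ys)) |ys|≤)

  unique-⇔⇒↭ : ∀ {A : Set} {xs ys : List A} → Unique xs → Unique ys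
              → (∀ {v} → v ∈ xs → v ∈ ys) → (∀ {v} → v ∈ ys → v ∈ xs) → xs ↭ ys
  unique-⇔⇒↭ uxs uys to from = ∼bag⇒↭ (unique∧set⇒bag uxs uys (mk⇔ to from))

  length-cartesianProductWith : ∀ {A B C : Set} (f : A → B → C) xs ys
                              → length (cartesianProductWith f xs ys) ≡ length xs ℕ.* length ys
  length-cartesianProductWith f []       ys = refl
  length-cartesianProductWith f (x ∷ xs) ys = trans (List.length-++ (map (f x) ys))
    (cong₂ ℕ._+_ (List.length-map (f x) ys) (length-cartesianProductWith f xs ys))

  module _ (q : ℕ) where

    private
      allWords-suc : ∀ n → allWords q (suc n) ≡ cartesianProductWith _∷_ (allFin q) (allWords q n)
      allWords-suc n = concatMap≡ (allFin q)
        where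
        concatMap≡ : ∀ xs → concatMap (λ x → map (x ∷_) (allWords q n)) xs ≡ cartesianProductWith _∷_ xs (allWords q n)
        concatMap≡ []       = refl
        concatMap≡ (x ∷ xs) = cong (map (x ∷_) (allWords q n) ++_) (concatMap≡ xs)

    length-allWords : ∀ n → length (allWords q n) ≡ q ^ n
    length-allWords zero    = refl
    length-allWords (suc n) = begin
      length (allWords q (suc n))                                  ≡⟨ cong length (allWords-suc n) ⟩
      length (cartesianProductWith _∷_ (allFin q) (allWords q n))  ≡⟨ length-cartesianProductWith _∷_ (allFin q) _ ⟩
      length (allFin q) ℕ.* length (allWords q n)                  ≡⟨ cong₂ ℕ._*_ (List.length-tabulate {n = q} id) (length-allWords n) ⟩
      q ℕ.* q ^ n                                                  ∎
      where open Relation.Binary.PropositionalEquality.≡-Reasoning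

    ∈-allWords : ∀ n {v} → length v ≡ n → v ∈ allWords q n
    ∈-allWords zero    {[]}    _     = here refl
    ∈-allWords (suc n) {x ∷ v} |v|≡n = subst (x ∷ v ∈_) (sym (allWords-suc n))
      (∈-cartesianProductWith⁺ _∷_ (∈-allFin x) (∈-allWords n (ℕ.suc-injective |v|≡n)))

    allWords-unique : ∀ n → Unique (allWords q n)
    allWords-unique zero    = [] ∷ []
    allWords-unique (suc n) = subst Unique (sym (allWords-suc n))
      (Unique.cartesianProductWith⁺ _∷_ List.∷-injective (Unique.allFin⁺ q) (allWords-unique n))

open Words

module Polynomials where
  open import Level using (0ℓ)
  open import Data.Nat as ℕ using (ℕ; zero; suc; _≤_; _<_; s≤s)
  import Data.Nat.Properties as ℕ
  open import Data.List using (List; []; _∷_; _++_; [_]; map; replicate; length; take; drop)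
  import Data.List.Properties as List
  open import Data.Product using (_×_; _,_)
  open import Data.Sum using (inj₁; inj₂)
  open import Relation.Nullary using (yes; no)
  open import Relation.Binary.Bundles using (Setoid)
  import Relation.Binary.Reasoning.Setoid
  open import Relation.Binary.PropositionalEquality as ≡ using (_≡_; refl; cong; cong₂; subst)
  open import Algebra.Core using (Op₁; Op₂)
  open import Algebra.Structures using (IsCommutativeRing)
  open import Algebra.Bundles using (CommutativeRing)
  open import Defs using (shift; shiftPow)

  record CommRing : Set₁ where
    infix  8 -_
    infixl 7 _*_
    infixl 6 _+_ _-_
    field
      Carrier : Set
      _+_ _*_ : Op₂ Carrier
      -_      : Op₁ Carrier
      0# 1#   : Carrier
      isCommutativeRing : IsCommutativeRing _≡_ _+_ _*_ -_ 0# 1#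

    _-_ : Op₂ Carrier
    x - y = x + - y

    commutativeRing : CommutativeRing 0ℓ 0ℓ
    commutativeRing = record { isCommutativeRing = isCommutativeRing }

  module Polynomial (R : CommRing) where
    open CommRing R
    open CommutativeRing commutativeRing
      using (+-assoc; +-comm; +-identityˡ; +-identityʳ; -‿inverseˡ; -‿inverseʳ; +-commutativeSemigroup;
             *-assoc; *-comm; *-identityˡ; distribˡ; distribʳ; zeroˡ; zeroʳ; ring)
    open import Algebra.Properties.Ring ring using (-0#≈0#)
    open import Algebra.Properties.CommutativeSemigroup +-commutativeSemigroup using (interchange)

    Poly : Set
    Poly = List Carrier

    infix  8 -ₚ_
    infixl 7 _*ₚ_
    infixl 6 _+ₚ_ _-ₚ_

    _+ₚ_ : Op₂ Poly
    []      +ₚ g       = g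
    (a ∷ f) +ₚ []      = a ∷ f
    (a ∷ f) +ₚ (b ∷ g) = a + b ∷ f +ₚ g

    -ₚ_ : Op₁ Poly
    -ₚ_ = map (-_)

    _-ₚ_ : Op₂ Poly
    f -ₚ g = f +ₚ -ₚ g

    scale : Carrier → Poly → Poly
    scale a = map (a *_)

    _*ₚ_ : Op₂ Poly
    []      *ₚ g = []
    (a ∷ f) *ₚ g = scale a g +ₚ (0# ∷ f *ₚ g)

    1ₚ : Poly
    1ₚ = 1# ∷ []

    constant : Carrier → Poly
    constant a = a ∷ []

    coeff : Poly → ℕ → Carrier
    coeff []      i       = 0#
    coeff (a ∷ f) zero    = a
    coeff (a ∷ f) (suc i) = coeff f i

    infix 4 _≋_
    record _≋_ (f g : Poly) : Set where
      constructor mk≋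
      field coeff-≡ : ∀ i → coeff f i ≡ coeff g i
    open _≋_ public

    ≋-refl : ∀ {f} → f ≋ f
    ≋-refl = mk≋ λ _ → refl

    ≋-sym : ∀ {f g} → f ≋ g → g ≋ f
    ≋-sym f≋g = mk≋ λ i → ≡.sym (coeff-≡ f≋g i)

    ≋-trans : ∀ {f g h} → f ≋ g → g ≋ h → f ≋ h
    ≋-trans f≋g g≋h = mk≋ λ i → ≡.trans (coeff-≡ f≋g i) (coeff-≡ g≋h i)

    ≡⇒≋ : ∀ {f g} → f ≡ g → f ≋ g
    ≡⇒≋ refl = ≋-refl

    ≋-setoid : Setoid 0ℓ 0ℓ
    ≋-setoid = record
      { Carrier = Poly ; _≈_ = _≋_
      ; isEquivalence = record { refl = ≋-refl ; sym = ≋-sym ; trans = ≋-trans } }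

    ∷-cong : ∀ {a b f g} → a ≡ b → f ≋ g → a ∷ f ≋ b ∷ g
    ∷-cong a≡b f≋g = mk≋ λ { zero → a≡b ; (suc i) → coeff-≡ f≋g i }

    ∷-injective : ∀ {a b f g} → a ∷ f ≋ b ∷ g → a ≡ b × f ≋ g
    ∷-injective e = coeff-≡ e 0 , mk≋ (λ i → coeff-≡ e (suc i))

    []≋0∷[] : [] ≋ constant 0#
    []≋0∷[] = mk≋ λ { zero → refl ; (suc i) → refl }

    ∷≋[]⁻ : ∀ {a f} → a ∷ f ≋ [] → a ≡ 0# × f ≋ []
    ∷≋[]⁻ e = ∷-injective (≋-trans e []≋0∷[])

    0∷-≋[] : ∀ {f} → f ≋ [] → 0# ∷ f ≋ []
    0∷-≋[] f≋[] = ≋-trans (∷-cong refl f≋[]) (≋-sym []≋0∷[])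

    coeff-+ₚ : ∀ f g i → coeff (f +ₚ g) i ≡ coeff f i + coeff g i
    coeff-+ₚ []      g       i       = ≡.sym (+-identityˡ _)
    coeff-+ₚ (a ∷ f) []      i       = ≡.sym (+-identityʳ _)
    coeff-+ₚ (a ∷ f) (b ∷ g) zero    = refl
    coeff-+ₚ (a ∷ f) (b ∷ g) (suc i) = coeff-+ₚ f g i

    coeff-map : ∀ (φ : Carrier → Carrier) → φ 0# ≡ 0# → ∀ f i → coeff (map φ f) i ≡ φ (coeff f i)
    coeff-map φ φ0 []      i       = ≡.sym φ0
    coeff-map φ φ0 (a ∷ f) zero    = refl
    coeff-map φ φ0 (a ∷ f) (suc i) = coeff-map φ φ0 f i

    coeff--ₚ : ∀ f i → coeff (-ₚ f) i ≡ - coeff f i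
    coeff--ₚ = coeff-map (-_) -0#≈0#

    coeff-scale : ∀ a f i → coeff (scale a f) i ≡ a * coeff f i
    coeff-scale a = coeff-map (a *_) (zeroʳ a)

    +ₚ-cong : ∀ {f f′ g g′} → f ≋ f′ → g ≋ g′ → f +ₚ g ≋ f′ +ₚ g′
    +ₚ-cong {f} {f′} {g} {g′} f≋f′ g≋g′ = mk≋ λ i → begin
      coeff (f +ₚ g) i         ≡⟨ coeff-+ₚ f g i ⟩
      coeff f i + coeff g i    ≡⟨ cong₂ _+_ (coeff-≡ f≋f′ i) (coeff-≡ g≋g′ i) ⟩
      coeff f′ i + coeff g′ i  ≡⟨ coeff-+ₚ f′ g′ i ⟨
      coeff (f′ +ₚ g′) i       ∎
      where open ≡.≡-Reasoning

    +ₚ-congˡ : ∀ f {g g′} → g ≋ g′ → f +ₚ g ≋ f +ₚ g′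
    +ₚ-congˡ f = +ₚ-cong (≋-refl {f})

    +ₚ-congʳ : ∀ {f f′} g → f ≋ f′ → f +ₚ g ≋ f′ +ₚ g
    +ₚ-congʳ g f≋f′ = +ₚ-cong f≋f′ (≋-refl {g})

    +ₚ-comm : ∀ f g → f +ₚ g ≋ g +ₚ f
    +ₚ-comm f g = mk≋ λ i → begin
      coeff (f +ₚ g) i       ≡⟨ coeff-+ₚ f g i ⟩
      coeff f i + coeff g i  ≡⟨ +-comm _ _ ⟩
      coeff g i + coeff f i  ≡⟨ coeff-+ₚ g f i ⟨
      coeff (g +ₚ f) i       ∎
      where open ≡.≡-Reasoning

    +ₚ-assoc : ∀ f g h → (f +ₚ g) +ₚ h ≋ f +ₚ (g +ₚ h)
    +ₚ-assoc f g h = mk≋ λ i → begin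
      coeff ((f +ₚ g) +ₚ h) i                  ≡⟨ coeff-+ₚ (f +ₚ g) h i ⟩
      coeff (f +ₚ g) i + coeff h i             ≡⟨ cong (_+ coeff h i) (coeff-+ₚ f g i) ⟩
      (coeff f i + coeff g i) + coeff h i      ≡⟨ +-assoc _ _ _ ⟩
      coeff f i + (coeff g i + coeff h i)      ≡⟨ cong (coeff f i +_) (coeff-+ₚ g h i) ⟨
      coeff f i + coeff (g +ₚ h) i             ≡⟨ coeff-+ₚ f (g +ₚ h) i ⟨
      coeff (f +ₚ (g +ₚ h)) i                  ∎
      where open ≡.≡-Reasoning

    +ₚ-interchange : ∀ f g h k → (f +ₚ g) +ₚ (h +ₚ k) ≋ (f +ₚ h) +ₚ (g +ₚ k)
    +ₚ-interchange f g h k = mk≋ λ i → begin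
      coeff ((f +ₚ g) +ₚ (h +ₚ k)) i                               ≡⟨ coeff-+ₚ (f +ₚ g) (h +ₚ k) i ⟩
      coeff (f +ₚ g) i + coeff (h +ₚ k) i                          ≡⟨ cong₂ _+_ (coeff-+ₚ f g i) (coeff-+ₚ h k i) ⟩
      (coeff f i + coeff g i) + (coeff h i + coeff k i)            ≡⟨ interchange _ _ _ _ ⟩
      (coeff f i + coeff h i) + (coeff g i + coeff k i)            ≡⟨ cong₂ _+_ (coeff-+ₚ f h i) (coeff-+ₚ g k i) ⟨
      coeff (f +ₚ h) i + coeff (g +ₚ k) i                          ≡⟨ coeff-+ₚ (f +ₚ h) (g +ₚ k) i ⟨
      coeff ((f +ₚ h) +ₚ (g +ₚ k)) i                               ∎
      where open ≡.≡-Reasoning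

    +ₚ-leftComm : ∀ f g h → f +ₚ (g +ₚ h) ≋ g +ₚ (f +ₚ h)
    +ₚ-leftComm f g h = ≋-trans (≋-sym (+ₚ-assoc f g h))
      (≋-trans (+ₚ-congʳ h (+ₚ-comm f g)) (+ₚ-assoc g f h))

    +ₚ-identityʳ : ∀ f → f +ₚ [] ≋ f
    +ₚ-identityʳ []      = ≋-refl
    +ₚ-identityʳ (a ∷ f) = ≋-refl

    -ₚ-inverseʳ : ∀ f → f -ₚ f ≋ []
    -ₚ-inverseʳ f = mk≋ λ i → begin
      coeff (f -ₚ f) i                 ≡⟨ coeff-+ₚ f (-ₚ f) i ⟩
      coeff f i + coeff (-ₚ f) i       ≡⟨ cong (coeff f i +_) (coeff--ₚ f i) ⟩
      coeff f i - coeff f i            ≡⟨ -‿inverseʳ _ ⟩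
      0#                               ∎
      where open ≡.≡-Reasoning

    -ₚ-inverseˡ : ∀ f → -ₚ f +ₚ f ≋ []
    -ₚ-inverseˡ f = ≋-trans (+ₚ-comm (-ₚ f) f) (-ₚ-inverseʳ f)

    -ₚ-cong : ∀ {f g} → f ≋ g → -ₚ f ≋ -ₚ g
    -ₚ-cong {f} {g} f≋g = mk≋ λ i →
      ≡.trans (coeff--ₚ f i) (≡.trans (cong -_ (coeff-≡ f≋g i)) (≡.sym (coeff--ₚ g i)))

    scale-cong : ∀ a {f g} → f ≋ g → scale a f ≋ scale a g
    scale-cong a {f} {g} f≋g = mk≋ λ i →
      ≡.trans (coeff-scale a f i) (≡.trans (cong (a *_) (coeff-≡ f≋g i)) (≡.sym (coeff-scale a g i)))

    scale-distribˡ : ∀ a f g → scale a (f +ₚ g) ≋ scale a f +ₚ scale a g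
    scale-distribˡ a f g = mk≋ λ i → begin
      coeff (scale a (f +ₚ g)) i                  ≡⟨ coeff-scale a (f +ₚ g) i ⟩
      a * coeff (f +ₚ g) i                        ≡⟨ cong (a *_) (coeff-+ₚ f g i) ⟩
      a * (coeff f i + coeff g i)                 ≡⟨ distribˡ a _ _ ⟩
      a * coeff f i + a * coeff g i               ≡⟨ cong₂ _+_ (coeff-scale a f i) (coeff-scale a g i) ⟨
      coeff (scale a f) i + coeff (scale a g) i   ≡⟨ coeff-+ₚ (scale a f) (scale a g) i ⟨
      coeff (scale a f +ₚ scale a g) i            ∎
      where open ≡.≡-Reasoning

    scale-distribʳ : ∀ a b f → scale (a + b) f ≋ scale a f +ₚ scale b f
    scale-distribʳ a b f = mk≋ λ i → begin
      coeff (scale (a + b) f) i                   ≡⟨ coeff-scale (a + b) f i ⟩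
      (a + b) * coeff f i                         ≡⟨ distribʳ _ a b ⟩
      a * coeff f i + b * coeff f i               ≡⟨ cong₂ _+_ (coeff-scale a f i) (coeff-scale b f i) ⟨
      coeff (scale a f) i + coeff (scale b f) i   ≡⟨ coeff-+ₚ (scale a f) (scale b f) i ⟨
      coeff (scale a f +ₚ scale b f) i            ∎
      where open ≡.≡-Reasoning

    scale-assoc : ∀ a b f → scale a (scale b f) ≋ scale (a * b) f
    scale-assoc a b f = mk≋ λ i → begin
      coeff (scale a (scale b f)) i   ≡⟨ coeff-scale a (scale b f) i ⟩
      a * coeff (scale b f) i         ≡⟨ cong (a *_) (coeff-scale b f i) ⟩
      a * (b * coeff f i)             ≡⟨ *-assoc a b _ ⟨
      a * b * coeff f i               ≡⟨ coeff-scale (a * b) f i ⟨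
      coeff (scale (a * b) f) i       ∎
      where open ≡.≡-Reasoning

    scale-zero : ∀ {a} f → a ≡ 0# → scale a f ≋ []
    scale-zero f refl = mk≋ λ i → ≡.trans (coeff-scale 0# f i) (zeroˡ _)

    scale-one : ∀ f → scale 1# f ≋ f
    scale-one f = mk≋ λ i → ≡.trans (coeff-scale 1# f i) (*-identityˡ _)

    0∷-+ₚ : ∀ f g → 0# ∷ f +ₚ g ≋ (0# ∷ f) +ₚ (0# ∷ g)
    0∷-+ₚ f g = ∷-cong (≡.sym (+-identityˡ 0#)) ≋-refl

    *ₚ-zeroˡ : ∀ {f} g → f ≋ [] → f *ₚ g ≋ []
    *ₚ-zeroˡ {[]}    g f≋[] = ≋-refl
    *ₚ-zeroˡ {a ∷ f} g a∷f≋[] with ∷≋[]⁻ a∷f≋[]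
    ... | a≡0 , f≋[] = +ₚ-cong (scale-zero g a≡0) (0∷-≋[] (*ₚ-zeroˡ g f≋[]))

    *ₚ-congʳ : ∀ {f f′} g → f ≋ f′ → f *ₚ g ≋ f′ *ₚ g
    *ₚ-congʳ {[]}    {f′}     g f≋f′ = ≋-sym (*ₚ-zeroˡ g (≋-sym f≋f′))
    *ₚ-congʳ {a ∷ f} {[]}     g f≋f′ = *ₚ-zeroˡ g f≋f′
    *ₚ-congʳ {a ∷ f} {b ∷ f′} g e with ∷-injective e
    ... | refl , f≋f′ = +ₚ-congˡ (scale a g) (∷-cong refl (*ₚ-congʳ g f≋f′))

    *ₚ-congˡ : ∀ f {g g′} → g ≋ g′ → f *ₚ g ≋ f *ₚ g′
    *ₚ-congˡ []      g≋g′ = ≋-refl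
    *ₚ-congˡ (a ∷ f) g≋g′ = +ₚ-cong (scale-cong a g≋g′) (∷-cong refl (*ₚ-congˡ f g≋g′))

    *ₚ-cong : ∀ {f f′ g g′} → f ≋ f′ → g ≋ g′ → f *ₚ g ≋ f′ *ₚ g′
    *ₚ-cong {f′ = f′} {g} f≋f′ g≋g′ = ≋-trans (*ₚ-congʳ g f≋f′) (*ₚ-congˡ f′ g≋g′)

    0∷-*ₚ : ∀ f g → (0# ∷ f) *ₚ g ≋ 0# ∷ f *ₚ g
    0∷-*ₚ f g = +ₚ-congʳ (0# ∷ f *ₚ g) (scale-zero g refl)

    *ₚ-distribʳ : ∀ h f g → (f +ₚ g) *ₚ h ≋ f *ₚ h +ₚ g *ₚ h
    *ₚ-distribʳ h []      g       = ≋-refl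
    *ₚ-distribʳ h (a ∷ f) []      = ≋-sym (+ₚ-identityʳ _)
    *ₚ-distribʳ h (a ∷ f) (b ∷ g) = ≋-trans
      (+ₚ-cong (scale-distribʳ a b h) (≋-trans (∷-cong refl (*ₚ-distribʳ h f g)) (0∷-+ₚ (f *ₚ h) (g *ₚ h))))
      (+ₚ-interchange (scale a h) (scale b h) (0# ∷ f *ₚ h) (0# ∷ g *ₚ h))

    *ₚ-distribˡ : ∀ h f g → h *ₚ (f +ₚ g) ≋ h *ₚ f +ₚ h *ₚ g
    *ₚ-distribˡ []      f g = ≋-refl
    *ₚ-distribˡ (a ∷ h) f g = ≋-trans
      (+ₚ-cong (scale-distribˡ a f g) (≋-trans (∷-cong refl (*ₚ-distribˡ h f g)) (0∷-+ₚ (h *ₚ f) (h *ₚ g))))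
      (+ₚ-interchange (scale a f) (scale a g) (0# ∷ h *ₚ f) (0# ∷ h *ₚ g))

    scale-*ₚ : ∀ a f g → scale a (f *ₚ g) ≋ scale a f *ₚ g
    scale-*ₚ a []      g = ≋-refl
    scale-*ₚ a (b ∷ f) g = ≋-trans (scale-distribˡ a (scale b g) (0# ∷ f *ₚ g))
      (+ₚ-cong (scale-assoc a b g) (∷-cong (zeroʳ a) (scale-*ₚ a f g)))

    *ₚ-assoc : ∀ f g h → (f *ₚ g) *ₚ h ≋ f *ₚ (g *ₚ h)
    *ₚ-assoc []      g h = ≋-refl
    *ₚ-assoc (a ∷ f) g h = ≋-trans (*ₚ-distribʳ h (scale a g) (0# ∷ f *ₚ g))
      (+ₚ-cong (≋-sym (scale-*ₚ a g h)) (≋-trans (0∷-*ₚ (f *ₚ g) h) (∷-cong refl (*ₚ-assoc f g h))))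

    *ₚ-zeroʳ : ∀ f → f *ₚ [] ≋ []
    *ₚ-zeroʳ []      = ≋-refl
    *ₚ-zeroʳ (a ∷ f) = 0∷-≋[] (*ₚ-zeroʳ f)

    *ₚ-∷ʳ : ∀ f a g → f *ₚ (a ∷ g) ≋ scale a f +ₚ (0# ∷ f *ₚ g)
    *ₚ-∷ʳ []      a g = ≋-sym (0∷-≋[] ≋-refl)
    *ₚ-∷ʳ (b ∷ f) a g = ≋-trans (+ₚ-congˡ (scale b (a ∷ g)) (∷-cong refl (*ₚ-∷ʳ f a g)))
      (∷-cong (cong (_+ 0#) (*-comm b a)) (+ₚ-leftComm (scale b g) (scale a f) (0# ∷ f *ₚ g)))

    *ₚ-comm : ∀ f g → f *ₚ g ≋ g *ₚ f
    *ₚ-comm []      g = ≋-sym (*ₚ-zeroʳ g)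
    *ₚ-comm (a ∷ f) g = ≋-trans (+ₚ-congˡ (scale a g) (∷-cong refl (*ₚ-comm f g))) (≋-sym (*ₚ-∷ʳ g a f))

    *ₚ-identityˡ : ∀ f → 1ₚ *ₚ f ≋ f
    *ₚ-identityˡ f = ≋-trans (+ₚ-cong (scale-one f) (0∷-≋[] ≋-refl)) (+ₚ-identityʳ f)

    *ₚ-identityʳ : ∀ f → f *ₚ 1ₚ ≋ f
    *ₚ-identityʳ f = ≋-trans (*ₚ-comm f 1ₚ) (*ₚ-identityˡ f)

    polyRing : CommutativeRing 0ℓ 0ℓ
    polyRing = record
      { Carrier = Poly ; _≈_ = _≋_ ; _+_ = _+ₚ_ ; _*_ = _*ₚ_ ; -_ = -ₚ_ ; 0# = [] ; 1# = 1ₚ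
      ; isCommutativeRing = record
        { isRing = record
          { +-isAbelianGroup = record
            { isGroup = record
              { isMonoid = record
                { isSemigroup = record
                  { isMagma = record
                    { isEquivalence = Setoid.isEquivalence ≋-setoid
                    ; ∙-cong = +ₚ-cong }
                  ; assoc = +ₚ-assoc }
                ; identity = (λ _ → ≋-refl) , +ₚ-identityʳ }
              ; inverse = -ₚ-inverseˡ , -ₚ-inverseʳ
              ; ⁻¹-cong = -ₚ-cong }
            ; comm = +ₚ-comm }
          ; *-cong = *ₚ-cong
          ; *-assoc = *ₚ-assoc
          ; *-identity = *ₚ-identityˡ , *ₚ-identityʳ
          ; distrib = *ₚ-distribˡ , *ₚ-distribʳ }
        ; *-comm = *ₚ-comm } }

    open Congruence polyRing public
    open import Algebra.Properties.Ring (CommutativeRing.ring polyRing) public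
      using (-‿distribˡ-*; x[y-z]≈xy-xz; x∙y⁻¹≈ε⇒x≈y)
    open import Algebra.Properties.Semiring.Exp (CommutativeRing.semiring polyRing) public
      using (_^_; ^-homo-*; ^-congˡ)
    module ≋-Reasoning = Relation.Binary.Reasoning.Setoid ≋-setoid

    replicate-0≋[] : ∀ m → replicate m 0# ≋ []
    replicate-0≋[] zero    = ≋-refl
    replicate-0≋[] (suc m) = 0∷-≋[] (replicate-0≋[] m)

    x^_ : ℕ → Poly
    x^ j = replicate j 0# ++ [ 1# ]

    x^_−1 : ℕ → Poly
    x^ j −1 = x^ j -ₚ 1ₚ

    x^-+ : ∀ i j → x^ i *ₚ x^ j ≋ x^ (i ℕ.+ j)
    x^-+ zero    j = *ₚ-identityˡ (x^ j)
    x^-+ (suc i) j = ≋-trans (0∷-*ₚ (x^ i) (x^ j)) (∷-cong refl (x^-+ i j))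

    x*ₚ : ∀ f → x^ 1 *ₚ f ≋ 0# ∷ f
    x*ₚ f = ≋-trans (0∷-*ₚ 1ₚ f) (∷-cong refl (*ₚ-identityˡ f))

    ∷-split : ∀ a f → a ∷ f ≋ constant a +ₚ x^ 1 *ₚ f
    ∷-split a f = ≋-sym (≋-trans (+ₚ-congˡ (constant a) (x*ₚ f)) (∷-cong (+-identityʳ a) ≋-refl))

    ++-split : ∀ f a → f ++ [ a ] ≋ f +ₚ x^ (length f) *ₚ constant a
    ++-split []      a = ≋-sym (*ₚ-identityˡ (constant a))
    ++-split (b ∷ f) a = ≋-sym (≋-trans (+ₚ-congˡ (b ∷ f) (0∷-*ₚ (x^ length f) (constant a)))
      (∷-cong (+-identityʳ b) (≋-sym (++-split f a))))

    take-drop-split : ∀ n f → f ≋ take n f +ₚ x^ n *ₚ drop n f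
    take-drop-split zero    f       = ≋-sym (*ₚ-identityˡ f)
    take-drop-split (suc n) []      = ≋-sym (*ₚ-zeroʳ (x^ suc n))
    take-drop-split (suc n) (a ∷ f) = ≋-sym (≋-trans (+ₚ-congˡ (a ∷ take n f) (0∷-*ₚ (x^ n) (drop n f)))
      (∷-cong (+-identityʳ a) (≋-sym (take-drop-split n f))))

    x^n≈1 : ∀ n → x^ n ≈[ x^ n −1 ] 1ₚ
    x^n≈1 n = mod ∣ʳ-refl

    -- reduction modulo x^n - 1 by folding blocks of n coefficients onto each other (fuel m)
    wrap : ℕ → ℕ → Poly → Poly
    wrap n zero    f = f
    wrap n (suc m) f = take n f +ₚ wrap n m (drop n f)

    wrap≈ : ∀ n m f → wrap n m f ≈[ x^ n −1 ] f
    wrap≈ n zero    f = mod-refl (x^ n −1)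
    wrap≈ n (suc m) f = begin
      take n f +ₚ wrap n m (drop n f)      ≈⟨ +-congˡ-mod (take n f) (wrap≈ n m (drop n f)) ⟩
      take n f +ₚ drop n f                 ≈⟨ +-congˡ-mod (take n f) (mod-sym (≈⇒mod _ (*ₚ-identityˡ (drop n f)))) ⟩
      take n f +ₚ 1ₚ *ₚ drop n f           ≈⟨ +-congˡ-mod (take n f) (*-congʳ-mod (drop n f) (mod-sym (x^n≈1 n))) ⟩
      take n f +ₚ x^ n *ₚ drop n f         ≈⟨ ≈⇒mod _ (≋-sym (take-drop-split n f)) ⟩
      f                                    ∎
      where open ≈[]-Reasoning (x^ n −1)

    shift≈ : ∀ u → x^ 1 *ₚ shift u ≈[ x^ length u −1 ] u
    shift≈ []      = ≈⇒mod (x^ 0 −1) (*ₚ-zeroʳ (x^ 1))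
    shift≈ (a ∷ v) = begin
      x^ 1 *ₚ (v ++ [ a ])                              ≈⟨ lift (*ₚ-congˡ (x^ 1) (++-split v a)) ⟩
      x^ 1 *ₚ (v +ₚ x^ length v *ₚ constant a)          ≈⟨ lift (*ₚ-distribˡ (x^ 1) v _) ⟩
      x^ 1 *ₚ v +ₚ x^ 1 *ₚ (x^ length v *ₚ constant a)  ≈⟨ lift (+ₚ-congˡ (x^ 1 *ₚ v) (≋-sym (*ₚ-assoc (x^ 1) (x^ length v) (constant a)))) ⟩
      x^ 1 *ₚ v +ₚ (x^ 1 *ₚ x^ length v) *ₚ constant a  ≈⟨ lift (+ₚ-congˡ _ (*ₚ-congʳ (constant a) (x^-+ 1 (length v)))) ⟩
      x^ 1 *ₚ v +ₚ x^ n *ₚ constant a                   ≈⟨ +-congˡ-mod (x^ 1 *ₚ v) (*-congʳ-mod (constant a) (x^n≈1 n)) ⟩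
      x^ 1 *ₚ v +ₚ 1ₚ *ₚ constant a                     ≈⟨ lift (+ₚ-congˡ _ (*ₚ-identityˡ (constant a))) ⟩
      x^ 1 *ₚ v +ₚ constant a                           ≈⟨ lift (+ₚ-comm _ (constant a)) ⟩
      constant a +ₚ x^ 1 *ₚ v                           ≈⟨ lift (≋-sym (∷-split a v)) ⟩
      a ∷ v                                             ∎
      where
      n = suc (length v)
      lift : ∀ {f g} → f ≋ g → f ≈[ x^ n −1 ] g
      lift = ≈⇒mod (x^ n −1)
      open ≈[]-Reasoning (x^ n −1)

    shiftPow≈ : ∀ j v → x^ j *ₚ shiftPow j v ≈[ x^ length v −1 ] v
    shiftPow≈ zero    v = ≈⇒mod (x^ length v −1) (*ₚ-identityˡ v)
    shiftPow≈ (suc j) v = begin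
      x^ suc j *ₚ shift u          ≈⟨ lift (*ₚ-congʳ (shift u) (≋-sym (x^-+ 1 j))) ⟩
      (x^ 1 *ₚ x^ j) *ₚ shift u    ≈⟨ lift (*ₚ-congʳ (shift u) (*ₚ-comm (x^ 1) (x^ j))) ⟩
      (x^ j *ₚ x^ 1) *ₚ shift u    ≈⟨ lift (*ₚ-assoc (x^ j) (x^ 1) (shift u)) ⟩
      x^ j *ₚ (x^ 1 *ₚ shift u)    ≈⟨ *-congˡ-mod (x^ j) (subst (λ n → x^ 1 *ₚ shift u ≈[ x^ n −1 ] u) (length-shiftPow j v) (shift≈ u)) ⟩
      x^ j *ₚ u                    ≈⟨ shiftPow≈ j v ⟩
      v                            ∎
      where
      u = shiftPow j v
      lift : ∀ {f g} → f ≋ g → f ≈[ x^ length v −1 ] g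
      lift = ≈⇒mod (x^ length v −1)
      open ≈[]-Reasoning (x^ length v −1)

    ∏x^i−1 : ℕ → Poly
    ∏x^i−1 zero    = 1ₚ
    ∏x^i−1 (suc m) = x^ suc m −1 *ₚ ∏x^i−1 m

    x^j−1∣∏x^i−1 : ∀ {j m} → 1 ≤ j → j ≤ m → x^ j −1 ∣ ∏x^i−1 m
    x^j−1∣∏x^i−1 {suc j} {zero}  _   ()
    x^j−1∣∏x^i−1 {j}     {suc m} 1≤j j≤1+m with ℕ.m≤n⇒m<n∨m≡n j≤1+m
    ... | inj₁ j<1+m = x∣ʳy⇒x∣ʳzy (x^ suc m −1) (x^j−1∣∏x^i−1 1≤j (ℕ.≤-pred j<1+m))
    ... | inj₂ refl  = x∣y⇒x∣yz (∏x^i−1 m) ∣ʳ-refl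

    record DegBelow (k : ℕ) (f : Poly) : Set where
      constructor degBelow
      field coeff-0 : ∀ i → k ≤ i → coeff f i ≡ 0#
    open DegBelow public

    DegBelow-resp-≋ : ∀ {k f g} → f ≋ g → DegBelow k f → DegBelow k g
    DegBelow-resp-≋ f≋g (degBelow f<k) = degBelow λ i k≤i → ≡.trans (≡.sym (coeff-≡ f≋g i)) (f<k i k≤i)

    DegBelow-mono : ∀ {k k′ f} → k ≤ k′ → DegBelow k f → DegBelow k′ f
    DegBelow-mono k≤k′ (degBelow f<k) = degBelow λ i k′≤i → f<k i (ℕ.≤-trans k≤k′ k′≤i)

    DegBelow-0 : ∀ {f} → DegBelow 0 f → f ≋ []
    DegBelow-0 (degBelow f<0) = mk≋ λ i → f<0 i ℕ.z≤n

    ≋[]⇒DegBelow : ∀ {k f} → f ≋ [] → DegBelow k f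
    ≋[]⇒DegBelow f≋[] = degBelow λ i _ → coeff-≡ f≋[] i

    DegBelow-length : ∀ f → DegBelow (length f) f
    DegBelow-length f = degBelow (beyond f)
      where
      beyond : ∀ f i → length f ≤ i → coeff f i ≡ 0#
      beyond []      i       _           = refl
      beyond (a ∷ f) (suc i) (s≤s |f|≤i) = beyond f i |f|≤i

    DegBelow-∷ : ∀ {k a f} → DegBelow k f → DegBelow (suc k) (a ∷ f)
    DegBelow-∷ (degBelow f<k) = degBelow λ { (suc i) (s≤s k≤i) → f<k i k≤i }

    DegBelow-tail : ∀ {k a f} → DegBelow (suc k) (a ∷ f) → DegBelow k f
    DegBelow-tail (degBelow a∷f<1+k) = degBelow λ i k≤i → a∷f<1+k (suc i) (s≤s k≤i)

    DegBelow-+ₚ : ∀ {k f g} → DegBelow k f → DegBelow k g → DegBelow k (f +ₚ g)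
    DegBelow-+ₚ {f = f} {g} (degBelow f<k) (degBelow g<k) = degBelow λ i k≤i →
      ≡.trans (coeff-+ₚ f g i) (≡.trans (cong₂ _+_ (f<k i k≤i) (g<k i k≤i)) (+-identityˡ 0#))

    DegBelow--ₚ : ∀ {k f} → DegBelow k f → DegBelow k (-ₚ f)
    DegBelow--ₚ {f = f} (degBelow f<k) = degBelow λ i k≤i →
      ≡.trans (coeff--ₚ f i) (≡.trans (cong -_ (f<k i k≤i)) -0#≈0#)

    DegBelow-scale : ∀ {k} a {f} → DegBelow k f → DegBelow k (scale a f)
    DegBelow-scale a {f} (degBelow f<k) = degBelow λ i k≤i →
      ≡.trans (coeff-scale a f i) (≡.trans (cong (a *_) (f<k i k≤i)) (zeroʳ a))

    DegBelow-take : ∀ n f → DegBelow n (take n f)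
    DegBelow-take n f = DegBelow-mono |take|≤n (DegBelow-length (take n f))
      where
      |take|≤n = ℕ.≤-trans (ℕ.≤-reflexive (List.length-take n f)) (ℕ.m⊓n≤m n (length f))

    DegBelow-wrap : ∀ n m f → 1 ≤ n → length f ≤ m → DegBelow n (wrap n m f)
    DegBelow-wrap n zero    [] _ _ = degBelow λ _ _ → refl
    DegBelow-wrap n (suc m) f 1≤n |f|≤1+m = DegBelow-+ₚ (DegBelow-take n f) (DegBelow-wrap n m (drop n f) 1≤n |drop|≤m)
      where
      |drop|≤m : length (drop n f) ≤ m
      |drop|≤m = ℕ.≤-trans (ℕ.≤-reflexive (List.length-drop n f))
                   (ℕ.≤-trans (ℕ.∸-monoˡ-≤ n |f|≤1+m) (ℕ.∸-monoʳ-≤ (suc m) 1≤n))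

    toWord : ℕ → Poly → List Carrier
    toWord n f = take n (f ++ replicate n 0#)

    length-toWord : ∀ n f → length (toWord n f) ≡ n
    length-toWord n f = go n f n (ℕ.m≤n+m n (length f))
      where
      go : ∀ n f m → n ≤ length f ℕ.+ m → length (take n (f ++ replicate m 0#)) ≡ n
      go zero    f       m       _            = refl
      go (suc n) []      (suc m) (s≤s n≤m)    = cong suc (go n [] m n≤m)
      go (suc n) (a ∷ f) m       (s≤s n≤|f|+m) = cong suc (go n f m n≤|f|+m)

    DegBelow-toWord : ∀ n f → DegBelow n (toWord n f)
    DegBelow-toWord n f = subst (λ k → DegBelow k (toWord n f)) (length-toWord n f) (DegBelow-length (toWord n f))

    toWord-≋ : ∀ n f → DegBelow n f → toWord n f ≋ f
    toWord-≋ n f f<n = mk≋ coeff-toWord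
      where
      coeff-take : ∀ n xs i → i < n → coeff (take n xs) i ≡ coeff xs i
      coeff-take (suc n) []       i       _         = refl
      coeff-take (suc n) (x ∷ xs) zero    _         = refl
      coeff-take (suc n) (x ∷ xs) (suc i) (s≤s i<n) = coeff-take n xs i i<n
      coeff-padded : ∀ f m i → coeff (f ++ replicate m 0#) i ≡ coeff f i
      coeff-padded []      zero    i       = refl
      coeff-padded []      (suc m) zero    = refl
      coeff-padded []      (suc m) (suc i) = coeff-padded [] m i
      coeff-padded (a ∷ f) m       zero    = refl
      coeff-padded (a ∷ f) m       (suc i) = coeff-padded f m i
      coeff-toWord : ∀ i → coeff (toWord n f) i ≡ coeff f i
      coeff-toWord i with i ℕ.<? n
      ... | yes i<n = ≡.trans (coeff-take n (f ++ replicate n 0#) i i<n) (coeff-padded f n i)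
      ... | no  i≮n = ≡.trans (coeff-0 (DegBelow-toWord n f) i (ℕ.≮⇒≥ i≮n)) (≡.sym (coeff-0 f<n i (ℕ.≮⇒≥ i≮n)))

    ≋∧length⇒≡ : ∀ {u v} → u ≋ v → length u ≡ length v → u ≡ v
    ≋∧length⇒≡ {[]}    {[]}    _   _     = refl
    ≋∧length⇒≡ {a ∷ u} {b ∷ v} a∷u≋b∷v |u|≡|v| with ∷-injective a∷u≋b∷v
    ... | a≡b , u≋v = cong₂ _∷_ a≡b (≋∧length⇒≡ u≋v (ℕ.suc-injective |u|≡|v|))

    wrap≋[]⇒∣ : ∀ n f → wrap n (length f) f ≋ [] → x^ n −1 ∣ f
    wrap≋[]⇒∣ n f wrap≋[] = mod0⇒∣ (mod-trans (mod-sym (wrap≈ n (length f) f)) (≈⇒mod (x^ n −1) wrap≋[]))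

open Polynomials

module FieldPolynomials where
  open import Data.Nat as ℕ using (ℕ; zero; suc; _≤_; _<_; z≤n; s≤s)
  import Data.Nat.Properties as ℕ
  open import Data.List using (List; []; _∷_; length)
  open import Data.Product using (Σ; _×_; _,_; proj₁; proj₂)
  open import Data.Sum using (_⊎_; inj₁; inj₂)
  open import Data.Empty using (⊥-elim)
  open import Relation.Nullary using (¬_; yes; no)
  open import Relation.Binary.Definitions using (DecidableEquality; tri<; tri≈; tri>)
  open import Relation.Binary.PropositionalEquality as ≡ using (_≡_; _≢_; refl; cong; cong₂)
  open import Algebra.Bundles using (CommutativeRing)

  record Field : Set₁ where
    field
      commRing : CommRing
    open CommRing commRing
    field
      _≟_     : DecidableEquality Carrier
      0≢1     : 0# ≢ 1#
      inverse : ∀ x → x ≢ 0# → Σ Carrier λ y → x * y ≡ 1#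

  module PolynomialField (F : Field) where
    open Field F
    open CommRing commRing
    open CommutativeRing commutativeRing
      using (+-assoc; +-comm; +-identityˡ; +-identityʳ; -‿inverseʳ; *-assoc; *-comm; *-identityˡ; *-identityʳ; zeroˡ; zeroʳ)
    open Polynomial commRing public

    integral : ∀ a b → a * b ≡ 0# → a ≡ 0# ⊎ b ≡ 0#
    integral a b ab≡0 with a ≟ 0#
    ... | yes a≡0 = inj₁ a≡0
    ... | no  a≢0 with inverse a a≢0
    ...   | a⁻¹ , aa⁻¹≡1 = inj₂ (begin
      b               ≡⟨ *-identityˡ b ⟨
      1# * b          ≡⟨ cong (_* b) aa⁻¹≡1 ⟨
      a * a⁻¹ * b     ≡⟨ cong (_* b) (*-comm a a⁻¹) ⟩
      a⁻¹ * a * b     ≡⟨ *-assoc a⁻¹ a b ⟩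
      a⁻¹ * (a * b)   ≡⟨ cong (a⁻¹ *_) ab≡0 ⟩
      a⁻¹ * 0#        ≡⟨ zeroʳ a⁻¹ ⟩
      0#              ∎)
      where open ≡.≡-Reasoning

    record HasDegree (f : Poly) (m : ℕ) : Set where
      constructor hasDegree
      field
        leading≢0 : coeff f m ≢ 0#
        below     : DegBelow (suc m) f
    open HasDegree public

    HasDegree-resp-≋ : ∀ {m f g} → f ≋ g → HasDegree f m → HasDegree g m
    HasDegree-resp-≋ f≋g (hasDegree lc≢0 f<1+m) =
      hasDegree (λ lc≡0 → lc≢0 (≡.trans (coeff-≡ f≋g _) lc≡0)) (DegBelow-resp-≋ f≋g f<1+m)

    HasDegree⇒< : ∀ {f m k} → HasDegree f m → DegBelow k f → m < k
    HasDegree⇒< {m = m} {k} (hasDegree lc≢0 _) (degBelow f<k) with ℕ.<-cmp m k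
    ... | tri< m<k _ _ = m<k
    ... | tri≈ _ m≡k _ = ⊥-elim (lc≢0 (f<k m (ℕ.≤-reflexive (≡.sym m≡k))))
    ... | tri> _ _ k<m = ⊥-elim (lc≢0 (f<k m (ℕ.<⇒≤ k<m)))

    HasDegree-unique : ∀ {f m m′} → HasDegree f m → HasDegree f m′ → m ≡ m′
    HasDegree-unique f°m f°m′ = ℕ.≤-antisym (ℕ.≤-pred (HasDegree⇒< f°m (below f°m′)))
                                            (ℕ.≤-pred (HasDegree⇒< f°m′ (below f°m)))

    HasDegree⇒≉[] : ∀ {f m} → HasDegree f m → ¬ f ≋ []
    HasDegree⇒≉[] (hasDegree lc≢0 _) f≋[] = lc≢0 (coeff-≡ f≋[] _)

    zero-or-degree : ∀ f → f ≋ [] ⊎ Σ ℕ (HasDegree f)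
    zero-or-degree []      = inj₁ ≋-refl
    zero-or-degree (a ∷ f) with zero-or-degree f
    ... | inj₂ (m , hasDegree lc≢0 f<1+m) = inj₂ (suc m , hasDegree lc≢0 (DegBelow-∷ f<1+m))
    ... | inj₁ f≋[] with a ≟ 0#
    ...   | yes a≡0 = inj₁ (≋-trans (∷-cong a≡0 f≋[]) (≋-sym []≋0∷[]))
    ...   | no  a≢0 = inj₂ (0 , hasDegree a≢0 (DegBelow-∷ (≋[]⇒DegBelow f≋[])))

    ∷*ₚ≋scale : ∀ a {f} g → f ≋ [] → (a ∷ f) *ₚ g ≋ scale a g
    ∷*ₚ≋scale a g f≋[] = ≋-trans (+ₚ-congˡ (scale a g) (0∷-≋[] (*ₚ-zeroˡ g f≋[]))) (+ₚ-identityʳ (scale a g))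

    coeff-∷*ₚ : ∀ a f g i → coeff ((a ∷ f) *ₚ g) (suc i) ≡ a * coeff g (suc i) + coeff (f *ₚ g) i
    coeff-∷*ₚ a f g i =
      ≡.trans (coeff-+ₚ (scale a g) (0# ∷ f *ₚ g) (suc i)) (cong (_+ coeff (f *ₚ g) i) (coeff-scale a g (suc i)))

    *ₚ-leading : ∀ m l {f g} → DegBelow (suc m) f → DegBelow (suc l) g
               → DegBelow (suc (m ℕ.+ l)) (f *ₚ g) × coeff (f *ₚ g) (m ℕ.+ l) ≡ coeff f m * coeff g l
    *ₚ-leading m       l {[]}    _ _ = ≋[]⇒DegBelow ≋-refl , ≡.sym (zeroˡ _)
    *ₚ-leading zero    l {a ∷ f} {g} a∷f<1 g<1+l =
      DegBelow-resp-≋ (≋-sym af≋) (DegBelow-scale a g<1+l) , ≡.trans (coeff-≡ af≋ l) (coeff-scale a g l)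
      where
      af≋ = ∷*ₚ≋scale a g (DegBelow-0 (DegBelow-tail a∷f<1))
    *ₚ-leading (suc m) l {a ∷ f} {g} a∷f<2+m g<1+l@(degBelow g-0) = degBelow vanishes , leading
      where
      ih = *ₚ-leading m l (DegBelow-tail a∷f<2+m) g<1+l
      vanishes : ∀ i → suc (suc m ℕ.+ l) ≤ i → coeff ((a ∷ f) *ₚ g) i ≡ 0#
      vanishes (suc i) (s≤s m+l<i) = begin
        coeff ((a ∷ f) *ₚ g) (suc i)            ≡⟨ coeff-∷*ₚ a f g i ⟩
        a * coeff g (suc i) + coeff (f *ₚ g) i  ≡⟨ cong₂ _+_ (cong (a *_) (g-0 (suc i) (s≤s l≤i))) (coeff-0 (proj₁ ih) i m+l<i) ⟩
        a * 0# + 0#                             ≡⟨ ≡.trans (+-identityʳ _) (zeroʳ a) ⟩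
        0#                                      ∎
        where
        open ≡.≡-Reasoning
        l≤i = ℕ.≤-trans (ℕ.m≤n+m l m) (ℕ.<⇒≤ m+l<i)
      leading : coeff ((a ∷ f) *ₚ g) (suc m ℕ.+ l) ≡ coeff f m * coeff g l
      leading = begin
        coeff ((a ∷ f) *ₚ g) (suc (m ℕ.+ l))                    ≡⟨ coeff-∷*ₚ a f g (m ℕ.+ l) ⟩
        a * coeff g (suc (m ℕ.+ l)) + coeff (f *ₚ g) (m ℕ.+ l)  ≡⟨ cong (λ c → a * c + coeff (f *ₚ g) (m ℕ.+ l)) (g-0 _ (s≤s (ℕ.m≤n+m l m))) ⟩
        a * 0# + coeff (f *ₚ g) (m ℕ.+ l)                       ≡⟨ cong (_+ coeff (f *ₚ g) (m ℕ.+ l)) (zeroʳ a) ⟩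
        0# + coeff (f *ₚ g) (m ℕ.+ l)                           ≡⟨ +-identityˡ _ ⟩
        coeff (f *ₚ g) (m ℕ.+ l)                                ≡⟨ proj₂ ih ⟩
        coeff f m * coeff g l                                   ∎
        where open ≡.≡-Reasoning

    HasDegree-*ₚ : ∀ {f g m l} → HasDegree f m → HasDegree g l → HasDegree (f *ₚ g) (m ℕ.+ l)
    HasDegree-*ₚ {f} {g} {m} {l} (hasDegree f-lc≢0 f<1+m) (hasDegree g-lc≢0 g<1+l)
      with *ₚ-leading m l f<1+m g<1+l
    ... | fg<1+m+l , lc≡ = hasDegree lc≢0 fg<1+m+l
      where
      lc≢0 : coeff (f *ₚ g) (m ℕ.+ l) ≢ 0#
      lc≢0 lc≡0 with integral _ _ (≡.trans (≡.sym lc≡) lc≡0)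
      ... | inj₁ f-lc≡0 = f-lc≢0 f-lc≡0
      ... | inj₂ g-lc≡0 = g-lc≢0 g-lc≡0

    *ₚ-≋[] : ∀ f g → f *ₚ g ≋ [] → f ≋ [] ⊎ g ≋ []
    *ₚ-≋[] f g fg≋[] with zero-or-degree f | zero-or-degree g
    ... | inj₁ f≋[]      | _              = inj₁ f≋[]
    ... | _              | inj₁ g≋[]      = inj₂ g≋[]
    ... | inj₂ (_ , f°m) | inj₂ (_ , g°l) = ⊥-elim (HasDegree⇒≉[] (HasDegree-*ₚ f°m g°l) fg≋[])

    *ₚ-cancelˡ : ∀ h {f g} → ¬ h ≋ [] → h *ₚ f ≋ h *ₚ g → f ≋ g
    *ₚ-cancelˡ h {f} {g} h≉[] hf≋hg with *ₚ-≋[] h (f -ₚ g) h[f-g]≋[]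
      where
      h[f-g]≋[] : h *ₚ (f -ₚ g) ≋ []
      h[f-g]≋[] = ≋-trans (x[y-z]≈xy-xz h f g) (≋-trans (+ₚ-congʳ _ hf≋hg) (-ₚ-inverseʳ (h *ₚ g)))
    ... | inj₁ h≋[]   = ⊥-elim (h≉[] h≋[])
    ... | inj₂ f-g≋[] = x∙y⁻¹≈ε⇒x≈y f g f-g≋[]

    record Division (f d : Poly) (k : ℕ) : Set where
      constructor division
      field
        quo rem : Poly
        f≋quo*d+rem : f ≋ quo *ₚ d +ₚ rem
        rem<k       : DegBelow k rem

    divMod : ∀ {d k} → HasDegree d k → ∀ f → Division f d k
    divMod _ [] = division [] [] ≋-refl (≋[]⇒DegBelow ≋-refl)
    divMod {d} {k} d°k@(hasDegree lc≢0 (degBelow d-0)) (a ∷ f)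
      with divMod d°k f | inverse (coeff d k) lc≢0
    ... | division q r f≋qd+r (degBelow r-0) | lc⁻¹ , lc*lc⁻¹≡1 = division (s ∷ q) r′ a∷f≋ (degBelow r′-0)
      where
      t  = a ∷ r
      s  = coeff t k * lc⁻¹
      r′ = t -ₚ scale s d

      coeff-r′ : ∀ i → coeff r′ i ≡ coeff t i - s * coeff d i
      coeff-r′ i = ≡.trans (coeff-+ₚ t (-ₚ scale s d) i) (cong (coeff t i +_) (≡.trans (coeff--ₚ (scale s d) i) (cong -_ (coeff-scale s d i))))

      s*lc≡ : s * coeff d k ≡ coeff t k
      s*lc≡ = ≡.trans (*-assoc _ lc⁻¹ _) (≡.trans (cong (coeff t k *_) (≡.trans (*-comm lc⁻¹ _) lc*lc⁻¹≡1)) (*-identityʳ _))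

      r′-0 : ∀ i → k ≤ i → coeff r′ i ≡ 0#
      r′-0 i k≤i with ℕ.m≤n⇒m<n∨m≡n k≤i
      ... | inj₁ k<i  = ≡.trans (coeff-r′ i) (≡.trans (cong₂ (λ x y → x - s * y) (coeff-0 (DegBelow-∷ (degBelow r-0)) i k<i) (d-0 i k<i))
                          (≡.trans (cong (λ x → 0# - x) (zeroʳ s)) (-‿inverseʳ 0#)))
      ... | inj₂ refl = ≡.trans (coeff-r′ k) (≡.trans (cong (λ x → coeff t k - x) s*lc≡) (-‿inverseʳ _))

      a∷f≋ : a ∷ f ≋ (s ∷ q) *ₚ d +ₚ r′
      a∷f≋ = ≋-sym (begin
        (scale s d +ₚ (0# ∷ q *ₚ d)) +ₚ (t -ₚ scale s d)   ≈⟨ +ₚ-congʳ _ (+ₚ-comm (scale s d) _) ⟩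
        ((0# ∷ q *ₚ d) +ₚ scale s d) +ₚ (t -ₚ scale s d)   ≈⟨ +ₚ-assoc (0# ∷ q *ₚ d) (scale s d) _ ⟩
        (0# ∷ q *ₚ d) +ₚ (scale s d +ₚ (t -ₚ scale s d))   ≈⟨ +ₚ-congˡ (0# ∷ q *ₚ d) (+ₚ-leftComm (scale s d) t _) ⟩
        (0# ∷ q *ₚ d) +ₚ (t +ₚ (scale s d -ₚ scale s d))   ≈⟨ +ₚ-congˡ (0# ∷ q *ₚ d) (+ₚ-congˡ t (-ₚ-inverseʳ (scale s d))) ⟩
        (0# ∷ q *ₚ d) +ₚ (t +ₚ [])                         ≈⟨ +ₚ-congˡ (0# ∷ q *ₚ d) (+ₚ-identityʳ t) ⟩
        (0# + a) ∷ (q *ₚ d +ₚ r)                           ≈⟨ ∷-cong (+-identityˡ a) (≋-sym f≋qd+r) ⟩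
        a ∷ f                                              ∎)
        where open ≋-Reasoning

    ∣∧DegBelow⇒≋[] : ∀ {M k f} → HasDegree M k → M ∣ f → DegBelow k f → f ≋ []
    ∣∧DegBelow⇒≋[] {M} {k} {f} M°k (s , sM≋f) (degBelow f-0) with zero-or-degree s
    ... | inj₁ s≋[]      = ≋-trans (≋-sym sM≋f) (*ₚ-zeroˡ M s≋[])
    ... | inj₂ (m , s°m) = ⊥-elim (leading≢0 (HasDegree-*ₚ s°m M°k) (≡.trans (coeff-≡ sM≋f (m ℕ.+ k)) (f-0 _ (ℕ.m≤n+m k m))))

    record Bezout (a b : Poly) : Set where
      constructor bezout
      field
        gcd u v : Poly
        gcd≋    : gcd ≋ u *ₚ a +ₚ v *ₚ b
        gcd∣a   : gcd ∣ a
        gcd∣b   : gcd ∣ b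

    private
      bezout-zero : ∀ a {b} → b ≋ [] → Bezout a b
      bezout-zero a b≋[] = bezout a 1ₚ []
        (≋-sym (≋-trans (+ₚ-identityʳ (1ₚ *ₚ a)) (*ₚ-identityˡ a))) ∣ʳ-refl (∣ʳ-respʳ-≈ (≋-sym b≋[]) (a ∣0))

      bezout-step : ∀ {a b q r} → a ≋ q *ₚ b +ₚ r → Bezout b r → Bezout a b
      bezout-step {a} {b} {q} {r} a≋qb+r (bezout h u v h≋ub+vr h∣b h∣r) =
        bezout h v (u -ₚ v *ₚ q) h≋ (∣ʳ-respʳ-≈ (≋-sym a≋qb+r) (∣-+ (x∣ʳy⇒x∣ʳzy q h∣b) h∣r)) h∣b
        where
        r≋a-qb : r ≋ a -ₚ q *ₚ b
        r≋a-qb = ≋-sym (begin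
          a -ₚ q *ₚ b                 ≈⟨ +ₚ-congʳ _ a≋qb+r ⟩
          (q *ₚ b +ₚ r) -ₚ q *ₚ b     ≈⟨ +ₚ-congʳ _ (+ₚ-comm (q *ₚ b) r) ⟩
          (r +ₚ q *ₚ b) -ₚ q *ₚ b     ≈⟨ +ₚ-assoc r (q *ₚ b) _ ⟩
          r +ₚ (q *ₚ b -ₚ q *ₚ b)     ≈⟨ +ₚ-congˡ r (-ₚ-inverseʳ (q *ₚ b)) ⟩
          r +ₚ []                     ≈⟨ +ₚ-identityʳ r ⟩
          r                           ∎)
          where open ≋-Reasoning
        h≋ : h ≋ v *ₚ a +ₚ (u -ₚ v *ₚ q) *ₚ b
        h≋ = begin
          h                                         ≈⟨ h≋ub+vr ⟩
          u *ₚ b +ₚ v *ₚ r                          ≈⟨ +ₚ-congˡ (u *ₚ b) (*ₚ-congˡ v r≋a-qb) ⟩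
          u *ₚ b +ₚ v *ₚ (a -ₚ q *ₚ b)              ≈⟨ +ₚ-congˡ (u *ₚ b) (x[y-z]≈xy-xz v a (q *ₚ b)) ⟩
          u *ₚ b +ₚ (v *ₚ a -ₚ v *ₚ (q *ₚ b))       ≈⟨ +ₚ-leftComm (u *ₚ b) (v *ₚ a) _ ⟩
          v *ₚ a +ₚ (u *ₚ b -ₚ v *ₚ (q *ₚ b))       ≈⟨ +ₚ-congˡ (v *ₚ a) (+ₚ-congˡ (u *ₚ b) (-ₚ-cong (≋-sym (*ₚ-assoc v q b)))) ⟩
          v *ₚ a +ₚ (u *ₚ b -ₚ (v *ₚ q) *ₚ b)       ≈⟨ +ₚ-congˡ (v *ₚ a) (+ₚ-congˡ (u *ₚ b) (-‿distribˡ-* (v *ₚ q) b)) ⟩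
          v *ₚ a +ₚ (u *ₚ b +ₚ (-ₚ (v *ₚ q)) *ₚ b)  ≈⟨ +ₚ-congˡ (v *ₚ a) (≋-sym (*ₚ-distribʳ b u (-ₚ (v *ₚ q)))) ⟩
          v *ₚ a +ₚ (u -ₚ v *ₚ q) *ₚ b              ∎
          where open ≋-Reasoning

      bezout-fuel : ∀ n a {b} → DegBelow n b → Bezout a b
      bezout-fuel zero    a b<0 = bezout-zero a (DegBelow-0 b<0)
      bezout-fuel (suc n) a {b} b<1+n with zero-or-degree b
      ... | inj₁ b≋[]      = bezout-zero a b≋[]
      ... | inj₂ (m , b°m) with divMod b°m a
      ...   | division q r a≋qb+r r<m =
        bezout-step {q = q} a≋qb+r (bezout-fuel n b (DegBelow-mono (ℕ.≤-pred (HasDegree⇒< b°m b<1+n)) r<m))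

    bezoutOf : ∀ a b → Bezout a b
    bezoutOf a b = bezout-fuel (length b) a (DegBelow-length b)

    record Irreducible (P : Poly) : Set where
      field
        deg            : ℕ
        deg-spec       : HasDegree P deg
        1≤deg          : 1 ≤ deg
        trivial-factor : ∀ X Y → X *ₚ Y ≋ P → DegBelow 1 X ⊎ DegBelow 1 Y
    open Irreducible public

    DegBelow-1 : ∀ {h} → DegBelow 1 h → h ≋ constant (coeff h 0)
    DegBelow-1 h<1 = mk≋ λ { zero → refl ; (suc i) → coeff-0 h<1 (suc i) (s≤s z≤n) }

    constant∣1 : ∀ {h} → DegBelow 1 h → ¬ h ≋ [] → h ∣ 1ₚ
    constant∣1 {h} h<1 h≉[] with coeff h 0 ≟ 0#
    ... | yes h₀≡0 = ⊥-elim (h≉[] (≋-trans (DegBelow-1 h<1) (≋-trans (∷-cong h₀≡0 ≋-refl) (≋-sym []≋0∷[]))))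
    ... | no  h₀≢0 with inverse (coeff h 0) h₀≢0
    ...   | c , h₀c≡1 = constant c , (begin
      constant c *ₚ h                ≈⟨ ∷*ₚ≋scale c h ≋-refl ⟩
      scale c h                      ≈⟨ scale-cong c (DegBelow-1 h<1) ⟩
      constant (c * coeff h 0)       ≈⟨ ∷-cong (≡.trans (*-comm c _) h₀c≡1) ≋-refl ⟩
      1ₚ                             ∎)
      where open ≋-Reasoning

    1ₚ-degree : HasDegree 1ₚ 0
    1ₚ-degree = hasDegree (λ 1≡0 → 0≢1 (≡.sym 1≡0)) (DegBelow-length 1ₚ)

    HasDegree⇒∤1 : ∀ {M k} → HasDegree M k → 1 ≤ k → ¬ M ∣ 1ₚ
    HasDegree⇒∤1 {M} {k} M°k 1≤k (s , sM≋1) with zero-or-degree s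
    ... | inj₁ s≋[]      = HasDegree⇒≉[] 1ₚ-degree (≋-trans (≋-sym sM≋1) (*ₚ-zeroˡ M s≋[]))
    ... | inj₂ (m , s°m) = ℕ.<⇒≢ (ℕ.≤-trans 1≤k (ℕ.m≤n+m k m))
      (≡.sym (HasDegree-unique (HasDegree-resp-≋ sM≋1 (HasDegree-*ₚ s°m M°k)) 1ₚ-degree))

    irreducible⇒prime : ∀ {P} → Irreducible P → ∀ f g → P ∣ f *ₚ g → P ∣ f ⊎ P ∣ g
    irreducible⇒prime {P} P-irr f g P∣fg with bezoutOf P f
    ... | bezout h u v h≋uP+vf (s , sh≋P) h∣f with trivial-factor P-irr s h sh≋P
    ...   | inj₁ s<1 = inj₁ (∣ʳ-trans P∣h h∣f)
      where
      P∣h : P ∣ h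
      P∣h with constant∣1 s<1 (λ s≋[] → HasDegree⇒≉[] (deg-spec P-irr) (≋-trans (≋-sym sh≋P) (*ₚ-zeroˡ h s≋[])))
      ... | c , cs≋1 = c , (begin
        c *ₚ P           ≈⟨ *ₚ-congˡ c (≋-sym sh≋P) ⟩
        c *ₚ (s *ₚ h)    ≈⟨ *ₚ-assoc c s h ⟨
        (c *ₚ s) *ₚ h    ≈⟨ *ₚ-congʳ h cs≋1 ⟩
        1ₚ *ₚ h          ≈⟨ *ₚ-identityˡ h ⟩
        h                ∎)
        where open ≋-Reasoning
    ...   | inj₂ h<1 = inj₂ (mod0⇒∣ g≈0)
      where
      lift : ∀ {x y} → x ≋ y → x ≈[ P ] y
      lift = ≈⇒mod P
      g≈0 : g ≈[ P ] []
      g≈0 with constant∣1 h<1 (λ h≋[] → HasDegree⇒≉[] (deg-spec P-irr) (≋-trans (≋-sym sh≋P) (≋-trans (*ₚ-congˡ s h≋[]) (*ₚ-zeroʳ s))))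
      ... | c , ch≋1 = begin
        g                                ≈⟨ lift (≋-sym (*ₚ-identityˡ g)) ⟩
        1ₚ *ₚ g                          ≈⟨ lift (*ₚ-congʳ g (≋-sym ch≋1)) ⟩
        (c *ₚ h) *ₚ g                    ≈⟨ lift (*ₚ-congʳ g (*ₚ-congˡ c h≋uP+vf)) ⟩
        (c *ₚ (u *ₚ P +ₚ v *ₚ f)) *ₚ g   ≈⟨ *-congʳ-mod g (*-congˡ-mod c (+-cong-mod (∣⇒mod0 (x∣ʳyx P u)) (mod-refl {v *ₚ f} P))) ⟩
        (c *ₚ (v *ₚ f)) *ₚ g             ≈⟨ lift (*ₚ-assoc c (v *ₚ f) g) ⟩
        c *ₚ ((v *ₚ f) *ₚ g)             ≈⟨ lift (*ₚ-congˡ c (*ₚ-assoc v f g)) ⟩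
        c *ₚ (v *ₚ (f *ₚ g))             ≈⟨ *-congˡ-mod c (*-congˡ-mod v (∣⇒mod0 P∣fg)) ⟩
        c *ₚ (v *ₚ [])                   ≈⟨ lift (*ₚ-congˡ c (*ₚ-zeroʳ v)) ⟩
        c *ₚ []                          ≈⟨ lift (*ₚ-zeroʳ c) ⟩
        []                               ∎
        where open ≈[]-Reasoning P

    Irreducible⇒∤1 : ∀ {P} → Irreducible P → ¬ P ∣ 1ₚ
    Irreducible⇒∤1 P-irr = HasDegree⇒∤1 (deg-spec P-irr) (1≤deg P-irr)

    prime∣^⇒∣ : ∀ {P} → Irreducible P → ∀ m {f} → P ∣ f ^ m → P ∣ f
    prime∣^⇒∣ P-irr zero    P∣1 = ⊥-elim (Irreducible⇒∤1 P-irr P∣1)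
    prime∣^⇒∣ P-irr (suc m) {f} P∣f^1+m with irreducible⇒prime P-irr f (f ^ m) P∣f^1+m
    ... | inj₁ P∣f   = P∣f
    ... | inj₂ P∣f^m = prime∣^⇒∣ P-irr m P∣f^m

    prime∣∏x^i−1 : ∀ {P} → Irreducible P → ∀ m → P ∣ ∏x^i−1 m → Σ ℕ λ j → 1 ≤ j × j ≤ m × P ∣ x^ j −1
    prime∣∏x^i−1 P-irr zero    P∣1 = ⊥-elim (Irreducible⇒∤1 P-irr P∣1)
    prime∣∏x^i−1 P-irr (suc m) P∣∏ with irreducible⇒prime P-irr (x^ suc m −1) (∏x^i−1 m) P∣∏
    ... | inj₁ P∣x^1+m−1 = suc m , s≤s z≤n , ℕ.≤-refl , P∣x^1+m−1
    ... | inj₂ P∣∏′ with prime∣∏x^i−1 P-irr m P∣∏′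
    ...   | j , 1≤j , j≤m , P∣x^j−1 = j , 1≤j , ℕ.m≤n⇒m≤1+n j≤m , P∣x^j−1

    x^-degree : ∀ j → HasDegree (x^ j) j
    x^-degree zero    = 1ₚ-degree
    x^-degree (suc j) = hasDegree (leading≢0 (x^-degree j)) (DegBelow-∷ (below (x^-degree j)))

    x^−1-degree : ∀ j → HasDegree (x^ suc j −1) (suc j)
    x^−1-degree j = hasDegree lc≢0 (DegBelow-+ₚ (below (x^-degree (suc j))) (DegBelow-mono (s≤s z≤n) (DegBelow-length (-ₚ 1ₚ))))
      where
      lc≢0 : coeff (x^ suc j −1) (suc j) ≢ 0#
      lc≢0 lc≡0 = leading≢0 (x^-degree (suc j))
        (≡.trans (≡.sym (+-identityʳ _)) (≡.trans (≡.sym (coeff-+ₚ (x^ suc j) (-ₚ 1ₚ) (suc j))) lc≡0))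

    ≈[x^n−1]⇒≋ : ∀ {n f g} → 1 ≤ n → DegBelow n f → DegBelow n g → f ≈[ x^ n −1 ] g → f ≋ g
    ≈[x^n−1]⇒≋ {suc n} {f} {g} _ f<n g<n (mod x^n−1∣f-g) =
      x∙y⁻¹≈ε⇒x≈y f g (∣∧DegBelow⇒≋[] (x^−1-degree n) x^n−1∣f-g (DegBelow-+ₚ f<n (DegBelow--ₚ g<n)))

    ≈[x^n−1]⇒≡ : ∀ {n u v} → 1 ≤ n → length u ≡ n → length v ≡ n → u ≈[ x^ n −1 ] v → u ≡ v
    ≈[x^n−1]⇒≡ {n} {u} {v} 1≤n |u|≡n |v|≡n u≈v = ≋∧length⇒≡ (≈[x^n−1]⇒≋ 1≤n (bound |u|≡n) (bound |v|≡n) u≈v) (≡.trans |u|≡n (≡.sym |v|≡n))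
      where
      bound : ∀ {w} → length w ≡ n → DegBelow n w
      bound {w} |w|≡n = ≡.subst (λ k → DegBelow k w) |w|≡n (DegBelow-length w)

    ∣⇒wrap≋[] : ∀ {n} f → 1 ≤ n → x^ n −1 ∣ f → wrap n (length f) f ≋ []
    ∣⇒wrap≋[] {n} f 1≤n x^n−1∣f = ≈[x^n−1]⇒≋ 1≤n (DegBelow-wrap n (length f) f 1≤n ℕ.≤-refl) (≋[]⇒DegBelow ≋-refl)
      (mod-trans (wrap≈ n (length f) f) (∣⇒mod0 x^n−1∣f))

open FieldPolynomials

module FiniteFields where
  open import Data.Nat as ℕ using (ℕ; zero; suc; _∸_; s≤s; z≤n)
  import Data.Nat.Properties as ℕ
  open import Data.Fin as Fin using (Fin)
  open import Data.List using (List; []; _∷_; _++_; [_]; map; length; reverse; take; drop)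
  import Data.List.Properties as List
  open import Data.Product using (Σ; _×_; _,_)
  open import Data.Sum using (_⊎_; inj₁; inj₂)
  open import Data.Unit using (⊤; tt)
  open import Data.Empty using (⊥-elim)
  open import Data.Bool using (true; false; if_then_else_)
  open import Relation.Nullary using (¬_; yes; no)
  open import Relation.Binary.PropositionalEquality as ≡ using (_≡_; _≢_; refl; cong; subst; subst₂)
  open import Defs

  finiteField : ∀ {q} → FiniteField q → Field
  finiteField F = record
    { commRing = record { isCommutativeRing = isCommutativeRing }
    ; _≟_ = Fin._≟_ ; 0≢1 = 0≢1 ; inverse = inverse }
    where open FiniteField F

  module FiniteFieldPolynomials {q} (F : FiniteField q) where
    open PolynomialField (finiteField F) public
    open FiniteField F using (0#; 1#; _+_)
    private module D = FF F

    +p≡+ₚ : ∀ f g → f D.+p g ≡ f +ₚ g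
    +p≡+ₚ []      g       = refl
    +p≡+ₚ (a ∷ f) []      = refl
    +p≡+ₚ (a ∷ f) (b ∷ g) = cong (a + b ∷_) (+p≡+ₚ f g)

    *p≡*ₚ : ∀ f g → f D.*p g ≡ f *ₚ g
    *p≡*ₚ []      g = refl
    *p≡*ₚ (a ∷ f) g = ≡.trans (+p≡+ₚ (scale a g) (0# ∷ f D.*p g)) (cong (λ h → scale a g +ₚ (0# ∷ h)) (*p≡*ₚ f g))

    xpowMinus1≡ : ∀ j → D.xpowMinus1 j ≡ x^ j −1
    xpowMinus1≡ j = +p≡+ₚ (x^ j) (-ₚ 1ₚ)

    wrap≡ : ∀ n m f → D.wrap n m f ≡ wrap n m f
    wrap≡ n zero    f = refl
    wrap≡ n (suc m) f = ≡.trans (+p≡+ₚ (take n f) (D.wrap n m (drop n f))) (cong (take n f +ₚ_) (wrap≡ n m (drop n f)))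

    cmul≡ : ∀ n a b → D.cmul n a b ≡ toWord n (wrap n (length (a *ₚ b)) (a *ₚ b))
    cmul≡ n a b = ≡.trans (cong (λ h → toWord n (D.wrap n (length h) h)) (*p≡*ₚ a b))
                          (cong (toWord n) (wrap≡ n (length (a *ₚ b)) (a *ₚ b)))

    Trimmed : Poly → Set
    Trimmed []          = ⊤
    Trimmed (a ∷ [])    = a ≢ 0#
    Trimmed (a ∷ b ∷ f) = Trimmed (b ∷ f)

    private
      Trimmed-tail : ∀ {a} f → Trimmed (a ∷ f) → Trimmed f
      Trimmed-tail []      _       = tt
      Trimmed-tail (b ∷ f) trimmed = trimmed

      Trimmed-∷⇒≉[] : ∀ a f → Trimmed (a ∷ f) → ¬ a ∷ f ≋ []
      Trimmed-∷⇒≉[] a []      a≢0     a∷[]≋[] = a≢0 (coeff-≡ a∷[]≋[] 0)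
      Trimmed-∷⇒≉[] a (b ∷ f) trimmed a∷f≋[] = Trimmed-∷⇒≉[] b f trimmed (DegBelow-0 (DegBelow-tail (≋[]⇒DegBelow a∷f≋[])))

    Trimmed-≋⇒≡ : ∀ {f g} → Trimmed f → Trimmed g → f ≋ g → f ≡ g
    Trimmed-≋⇒≡ {[]}    {[]}    _  _  _   = refl
    Trimmed-≋⇒≡ {[]}    {b ∷ g} _  tg f≋g = ⊥-elim (Trimmed-∷⇒≉[] b g tg (≋-sym f≋g))
    Trimmed-≋⇒≡ {a ∷ f} {[]}    tf _  f≋g = ⊥-elim (Trimmed-∷⇒≉[] a f tf f≋g)
    Trimmed-≋⇒≡ {a ∷ f} {b ∷ g} tf tg f≋g with ∷-injective f≋g
    ... | a≡b , f≋g′ = ≡.cong₂ _∷_ a≡b (Trimmed-≋⇒≡ (Trimmed-tail f tf) (Trimmed-tail g tg) f≋g′)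

    private
      Trimmed-degree : ∀ a f → Trimmed (a ∷ f) → HasDegree (a ∷ f) (length f)
      Trimmed-degree a []      a≢0     = hasDegree a≢0 (DegBelow-length (a ∷ []))
      Trimmed-degree a (b ∷ f) trimmed with Trimmed-degree b f trimmed
      ... | hasDegree lc≢0 b∷f<1+|f| = hasDegree lc≢0 (DegBelow-∷ b∷f<1+|f|)

      consTrimmed : Fin q → Poly → Poly
      consTrimmed a []      = if D.isZero a then [] else a ∷ []
      consTrimmed a (b ∷ f) = a ∷ b ∷ f

      snocTrimmed : Fin q → Poly → Poly
      snocTrimmed a []      = D.dropZeros [ a ]
      snocTrimmed a (b ∷ f) = (b ∷ f) ++ [ a ]

      dropZeros-++ : ∀ f a → D.dropZeros (f ++ [ a ]) ≡ snocTrimmed a (D.dropZeros f)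
      dropZeros-++ []      a = refl
      dropZeros-++ (b ∷ f) a with D.isZero b
      ... | true  = dropZeros-++ f a
      ... | false = refl

      reverse-snocTrimmed : ∀ a f → reverse (snocTrimmed a f) ≡ consTrimmed a (reverse f)
      reverse-snocTrimmed a [] with D.isZero a
      ... | true  = refl
      ... | false = refl
      reverse-snocTrimmed a (b ∷ f) with reverse (b ∷ f) in rev≡
      ... | []     = ⊥-elim (ℕ.1+n≢0 (≡.trans (≡.sym (List.length-reverse (b ∷ f))) (cong length rev≡)))
      ... | c ∷ cs = ≡.trans (List.reverse-++ (b ∷ f) [ a ]) (cong (a ∷_) rev≡)

      normalize-∷ : ∀ a f → D.normalize (a ∷ f) ≡ consTrimmed a (D.normalize f)
      normalize-∷ a f = ≡.trans (cong (reverse ∘′ D.dropZeros) (List.unfold-reverse a f))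
        (≡.trans (cong reverse (dropZeros-++ (reverse f) a)) (reverse-snocTrimmed a (D.dropZeros (reverse f))))
        where open import Function using (_∘′_)

      consTrimmed-≋ : ∀ a f → consTrimmed a f ≋ a ∷ f
      consTrimmed-≋ a []      with a Fin.≟ 0#
      ... | yes a≡0 = ≋-trans []≋0∷[] (∷-cong (≡.sym a≡0) ≋-refl)
      ... | no  _   = ≋-refl
      consTrimmed-≋ a (b ∷ f) = ≋-refl

      consTrimmed-Trimmed : ∀ a f → Trimmed f → Trimmed (consTrimmed a f)
      consTrimmed-Trimmed a []      _ with a Fin.≟ 0#
      ... | yes _   = tt
      ... | no  a≢0 = a≢0
      consTrimmed-Trimmed a (b ∷ f) trimmed = trimmed

    normalize-≋ : ∀ f → D.normalize f ≋ f
    normalize-≋ []      = ≋-refl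
    normalize-≋ (a ∷ f) = ≋-trans (≡⇒≋ (normalize-∷ a f)) (≋-trans (consTrimmed-≋ a (D.normalize f)) (∷-cong refl (normalize-≋ f)))

    normalize-Trimmed : ∀ f → Trimmed (D.normalize f)
    normalize-Trimmed []      = tt
    normalize-Trimmed (a ∷ f) = subst Trimmed (≡.sym (normalize-∷ a f)) (consTrimmed-Trimmed a (D.normalize f) (normalize-Trimmed f))

    ≋⇒≈p : ∀ {f g} → f ≋ g → D._≈p_ f g
    ≋⇒≈p {f} {g} f≋g = Trimmed-≋⇒≡ (normalize-Trimmed f) (normalize-Trimmed g)
      (≋-trans (normalize-≋ f) (≋-trans f≋g (≋-sym (normalize-≋ g))))

    ≈p⇒≋ : ∀ {f g} → D._≈p_ f g → f ≋ g
    ≈p⇒≋ {f} {g} f≈g = ≋-trans (≋-sym (normalize-≋ f)) (≋-trans (≡⇒≋ f≈g) (normalize-≋ g))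

    deg≡ : ∀ {f m} → HasDegree f m → D.deg f ≡ m
    deg≡ {f} f°m with D.normalize f | normalize-Trimmed f | normalize-≋ f
    ... | []     | _       | []≋f  = ⊥-elim (HasDegree⇒≉[] f°m (≋-sym []≋f))
    ... | b ∷ bs | trimmed | nf≋f = HasDegree-unique (HasDegree-resp-≋ nf≋f (Trimmed-degree b bs trimmed)) f°m

    ≋[]⇒deg≡0 : ∀ {f} → f ≋ [] → D.deg f ≡ 0
    ≋[]⇒deg≡0 {f} f≋[] = cong (λ nf → length nf ∸ 1) (Trimmed-≋⇒≡ (normalize-Trimmed f) tt (≋-trans (normalize-≋ f) f≋[]))

    deg≡0⇒DegBelow1 : ∀ f → D.deg f ≡ 0 → DegBelow 1 f
    deg≡0⇒DegBelow1 f deg≡0 with zero-or-degree f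
    ... | inj₁ f≋[]      = ≋[]⇒DegBelow f≋[]
    ... | inj₂ (m , f°m) = DegBelow-mono (s≤s (ℕ.≤-reflexive (≡.trans (≡.sym (deg≡ f°m)) deg≡0))) (below f°m)

    ∣p⇒∣ : ∀ {f h} → D._∣p_ f h → f ∣ h
    ∣p⇒∣ {f} (a , af≈h) = a , ≋-trans (≡⇒≋ (≡.sym (*p≡*ₚ a f))) (≈p⇒≋ af≈h)

    ∣⇒∣p : ∀ {f h} → f ∣ h → D._∣p_ f h
    ∣⇒∣p {f} (a , af≋h) = a , ≋⇒≈p (≋-trans (≡⇒≋ (*p≡*ₚ a f)) af≋h)

    irreducible : ∀ {f} → D.Irreducible f → Irreducible f
    irreducible {f} (1≤deg , factors) with zero-or-degree f
    ... | inj₁ f≋[]      = ⊥-elim (ℕ.n≮n 0 (subst (1 ℕ.≤_) (≋[]⇒deg≡0 f≋[]) 1≤deg))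
    ... | inj₂ (m , f°m) = record
      { deg = m ; deg-spec = f°m ; 1≤deg = subst (1 ℕ.≤_) (deg≡ f°m) 1≤deg
      ; trivial-factor = λ X Y XY≋f → Data.Sum.map (deg≡0⇒DegBelow1 X) (deg≡0⇒DegBelow1 Y)
          (factors X Y (≋⇒≈p (≋-trans (≡⇒≋ (*p≡*ₚ X Y)) XY≋f))) }

    ∣p-x^−1⇒∣ : ∀ {h n} → D._∣p_ h (D.xpowMinus1 n) → h ∣ x^ n −1
    ∣p-x^−1⇒∣ {n = n} h∣x^n−1 = subst (_ ∣_) (xpowMinus1≡ n) (∣p⇒∣ h∣x^n−1)

    ∤p-x^−1⇒∤ : ∀ {h n} → ¬ D._∣p_ h (D.xpowMinus1 n) → ¬ h ∣ x^ n −1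
    ∤p-x^−1⇒∤ {n = n} h∤x^n−1 h∣x^n−1 = h∤x^n−1 (∣⇒∣p (subst (_ ∣_) (≡.sym (xpowMinus1≡ n)) h∣x^n−1))

    ≈p-x^−1⇒≋ : ∀ {g h n} → D._≈p_ (g D.*p h) (D.xpowMinus1 n) → g *ₚ h ≋ x^ n −1
    ≈p-x^−1⇒≋ {g} {h} {n} gh≈x^n−1 = subst₂ _≋_ (*p≡*ₚ g h) (xpowMinus1≡ n) (≈p⇒≋ gh≈x^n−1)

    deg≡⇒HasDegree : ∀ {h k} → Irreducible h → D.deg h ≡ k → HasDegree h k
    deg≡⇒HasDegree h-irr deg≡k = subst (HasDegree _) (≡.trans (≡.sym (deg≡ (deg-spec h-irr))) deg≡k) (deg-spec h-irr)

open FiniteFields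

module WordStatistics where
  open import Level using (0ℓ)
  open import Data.Nat as ℕ using (ℕ; zero; suc; _+_; _*_; _∸_; _≤_)
  import Data.Nat.Properties as ℕ
  open import Data.Nat.Solver using (module +-*-Solver)
  open import Data.Fin as Fin using (Fin)
  open import Data.List using (List; []; _∷_; _++_; [_]; length; replicate; filterᵇ)
  import Data.List.Properties as List
  open import Data.Bool using (Bool; true; false; if_then_else_; T?)
  open import Data.Product using (Σ; _,_)
  open import Data.Sum using (_⊎_; inj₁; inj₂)
  open import Data.Empty using (⊥-elim)
  open import Function using (_∘_)
  open import Relation.Nullary using (⌊_⌋; yes; no)
  open import Relation.Nullary.Decidable using (dec-true; dec-false; isYes≗does)
  open import Relation.Binary using (Rel; IsStrictTotalOrder; tri<; tri≈; tri>)
  open import Relation.Binary.PropositionalEquality using (_≡_; _≢_; refl; sym; trans; cong; cong₂; module ≡-Reasoning)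
  open import Defs

  indicator : Bool → ℕ
  indicator b = if b then 1 else 0

  module Statistics {q} (F : FiniteField q) {_<F_ : Rel (Fin q) 0ℓ} (O : IsStrictTotalOrder _≡_ _<F_) where
    open FiniteField F using (0#; 1#)
    open FF F using (wt)
    open FF.Stats F O
    open +-*-Solver

    count : (Fin q → Bool) → List (Fin q) → ℕ
    count p u = length (filterᵇ p u)

    count-∷ : ∀ p a u → count p (a ∷ u) ≡ indicator (p a) + count p u
    count-∷ p a u with p a
    ... | true  = refl
    ... | false = refl

    count-∷ʳ : ∀ p u b → count p (u ++ [ b ]) ≡ count p u + indicator (p b)
    count-∷ʳ p []      b with p b
    ... | true  = refl
    ... | false = refl
    count-∷ʳ p (x ∷ u) b with p x
    ... | true  = cong suc (count-∷ʳ p u b)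
    ... | false = count-∷ʳ p u b

    isOne : Fin q → Bool
    isOne a = ⌊ a Fin.≟ 1# ⌋

    >b-irrefl : ∀ x → (x >b x) ≡ false
    >b-irrefl x with IsStrictTotalOrder.compare O x x
    ... | tri< _ x≢x _ = ⊥-elim (x≢x refl)
    ... | tri≈ _ _ _   = refl
    ... | tri> _ x≢x _ = ⊥-elim (x≢x refl)

    lastExceeds : List (Fin q) → Fin q → ℕ
    lastExceeds []          a = 0
    lastExceeds (x ∷ [])    a = indicator (x >b a)
    lastExceeds (x ∷ y ∷ u) a = lastExceeds (y ∷ u) a

    lastExceeds-∷ʳ : ∀ u a b → lastExceeds (u ++ [ a ]) b ≡ indicator (a >b b)
    lastExceeds-∷ʳ []          a b = refl
    lastExceeds-∷ʳ (x ∷ [])    a b = refl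
    lastExceeds-∷ʳ (x ∷ y ∷ u) a b = lastExceeds-∷ʳ (y ∷ u) a b

    des-∷ʳ : ∀ u a → des (u ++ [ a ]) ≡ des u + lastExceeds u a
    des-∷ʳ []          a = refl
    des-∷ʳ (x ∷ [])    a = ℕ.+-identityʳ _
    des-∷ʳ (x ∷ y ∷ u) a = trans (cong (indicator (x >b y) +_) (des-∷ʳ (y ∷ u) a))
                                 (sym (ℕ.+-assoc (indicator (x >b y)) (des (y ∷ u)) (lastExceeds (y ∷ u) a)))

    majFrom-suc : ∀ i u → majFrom (suc i) u ≡ majFrom i u + des u
    majFrom-suc i []          = refl
    majFrom-suc i (x ∷ [])    = refl
    majFrom-suc i (x ∷ y ∷ u) = begin
      (if x >b y then suc i else 0) + majFrom (suc (suc i)) (y ∷ u)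
        ≡⟨ cong₂ _+_ (split (x >b y)) (majFrom-suc (suc i) (y ∷ u)) ⟩
      ((if x >b y then i else 0) + indicator (x >b y)) + (majFrom (suc i) (y ∷ u) + des (y ∷ u))
        ≡⟨ solve 4 (λ a b c d → (a :+ b) :+ (c :+ d) := (a :+ c) :+ (b :+ d)) refl
                 (if x >b y then i else 0) (indicator (x >b y)) (majFrom (suc i) (y ∷ u)) (des (y ∷ u)) ⟩
      ((if x >b y then i else 0) + majFrom (suc i) (y ∷ u)) + (indicator (x >b y) + des (y ∷ u)) ∎
      where
      open ≡-Reasoning
      split : ∀ b → (if b then suc i else 0) ≡ (if b then i else 0) + indicator b
      split true  = ℕ.+-comm 1 i
      split false = refl

    majFrom-∷ʳ : ∀ i x u a → majFrom i (x ∷ u ++ [ a ]) ≡ majFrom i (x ∷ u) + lastExceeds (x ∷ u) a * (i + length u)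
    majFrom-∷ʳ i x []      a with x >b a
    ... | true  = solve 1 (λ i → i :+ con 0 := con 0 :+ con 1 :* (i :+ con 0)) refl i
    ... | false = refl
    majFrom-∷ʳ i x (y ∷ u) a = begin
      d + majFrom (suc i) (y ∷ u ++ [ a ])
        ≡⟨ cong (d +_) (majFrom-∷ʳ (suc i) y u a) ⟩
      d + (majFrom (suc i) (y ∷ u) + lastExceeds (y ∷ u) a * (suc i + length u))
        ≡⟨ solve 5 (λ d m l i n → d :+ (m :+ l :* ((con 1 :+ i) :+ n)) := (d :+ m) :+ l :* (i :+ (con 1 :+ n))) refl
                 d (majFrom (suc i) (y ∷ u)) (lastExceeds (y ∷ u) a) i (length u) ⟩
      (d + majFrom (suc i) (y ∷ u)) + lastExceeds (y ∷ u) a * (i + suc (length u)) ∎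
      where
      open ≡-Reasoning
      d = if x >b y then i else 0

    maj-shift : ∀ v → Σ ℕ λ t → maj (shift v) + cdes v ≡ maj v + length v * t
    maj-shift []          = 0 , refl
    maj-shift (a ∷ [])    = lastExceeds (a ∷ []) a , trans (des-∷ʳ (a ∷ []) a) (sym (ℕ.+-identityʳ _))
    maj-shift (a ∷ x ∷ u) = L , (begin
      maj (x ∷ u ++ [ a ]) + des (a ∷ x ∷ u ++ [ a ])
        ≡⟨ cong₂ _+_ (majFrom-∷ʳ 1 x u a) (des-∷ʳ (a ∷ x ∷ u) a) ⟩
      (maj (x ∷ u) + L * (1 + length u)) + ((c + des (x ∷ u)) + L)
        ≡⟨ solve 5 (λ m L l c d → (m :+ L :* (con 1 :+ l)) :+ ((c :+ d) :+ L) := (c :+ (m :+ d)) :+ (con 2 :+ l) :* L) refl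
                 (maj (x ∷ u)) L (length u) c (des (x ∷ u)) ⟩
      (c + (maj (x ∷ u) + des (x ∷ u))) + length (a ∷ x ∷ u) * L
        ≡⟨ cong (λ m → (c + m) + length (a ∷ x ∷ u) * L) (sym (majFrom-suc 1 (x ∷ u))) ⟩
      maj (a ∷ x ∷ u) + length (a ∷ x ∷ u) * L ∎)
      where
      open ≡-Reasoning
      L = lastExceeds (x ∷ u) a
      c = indicator (a >b x)

    cdes-shift : ∀ v → cdes (shift v) ≡ cdes v
    cdes-shift []          = refl
    cdes-shift (a ∷ [])    = refl
    cdes-shift (a ∷ x ∷ u) = begin
      des ((x ∷ u ++ [ a ]) ++ [ x ])                           ≡⟨ des-∷ʳ (x ∷ u ++ [ a ]) x ⟩
      des (x ∷ u ++ [ a ]) + lastExceeds (x ∷ u ++ [ a ]) x     ≡⟨ cong₂ _+_ (des-∷ʳ (x ∷ u) a) (lastExceeds-∷ʳ (x ∷ u) a x) ⟩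
      (des (x ∷ u) + lastExceeds (x ∷ u) a) + indicator (a >b x)
        ≡⟨ solve 3 (λ d l c → (d :+ l) :+ c := (c :+ d) :+ l) refl (des (x ∷ u)) (lastExceeds (x ∷ u) a) (indicator (a >b x)) ⟩
      (indicator (a >b x) + des (x ∷ u)) + lastExceeds (x ∷ u) a ≡⟨ des-∷ʳ (a ∷ x ∷ u) a ⟨
      des (a ∷ x ∷ u ++ [ a ])                                  ∎
      where open ≡-Reasoning

    cdes-shiftPow : ∀ j v → cdes (shiftPow j v) ≡ cdes v
    cdes-shiftPow zero    v = refl
    cdes-shiftPow (suc j) v = trans (cdes-shift (shiftPow j v)) (cdes-shiftPow j v)

    majFrom-replicate : ∀ i n a → majFrom i (replicate n a) ≡ 0
    majFrom-replicate i zero          a = refl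
    majFrom-replicate i (suc zero)    a = refl
    majFrom-replicate i (suc (suc n)) a =
      cong₂ _+_ (cong (λ b → if b then i else 0) (>b-irrefl a)) (majFrom-replicate (suc i) (suc n) a)

    inv-∷ʳ : ∀ u b → inv (u ++ [ b ]) ≡ inv u + count (_>b b) u
    inv-∷ʳ []      b = refl
    inv-∷ʳ (x ∷ u) b = begin
      count (x >b_) (u ++ [ b ]) + inv (u ++ [ b ])
        ≡⟨ cong₂ _+_ (count-∷ʳ (x >b_) u b) (inv-∷ʳ u b) ⟩
      (count (x >b_) u + indicator (x >b b)) + (inv u + count (_>b b) u)
        ≡⟨ solve 4 (λ a b c d → (a :+ b) :+ (c :+ d) := (a :+ c) :+ (b :+ d)) refl
                 (count (x >b_) u) (indicator (x >b b)) (inv u) (count (_>b b) u) ⟩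
      (count (x >b_) u + inv u) + (indicator (x >b b) + count (_>b b) u)
        ≡⟨ cong (count (x >b_) u + inv u +_) (count-∷ (_>b b) x u) ⟨
      (count (x >b_) u + inv u) + count (_>b b) (x ∷ u) ∎
      where open ≡-Reasoning

    inv-replicate : ∀ n a → inv (replicate n a) ≡ 0
    inv-replicate zero    a = refl
    inv-replicate (suc n) a = cong₂ _+_ (count-none n) (inv-replicate n a)
      where
      count-none : ∀ m → count (a >b_) (replicate m a) ≡ 0
      count-none zero    = refl
      count-none (suc m) = trans (count-∷ (a >b_) a (replicate m a)) (cong₂ _+_ (cong indicator (>b-irrefl a)) (count-none m))

    wt-shift : ∀ v → wt (shift v) ≡ wt v
    wt-shift []      = refl
    wt-shift (a ∷ u) = trans (count-∷ʳ isOne u a) (trans (ℕ.+-comm (wt u) _) (sym (count-∷ isOne a u)))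

    wt-shiftPow : ∀ j v → wt (shiftPow j v) ≡ wt v
    wt-shiftPow zero    v = refl
    wt-shiftPow (suc j) v = trans (wt-shift (shiftPow j v)) (wt-shiftPow j v)

    wt≤length : ∀ v → wt v ≤ length v
    wt≤length v = List.length-filter (T? ∘ isOne) v

    count-cong : ∀ {p p′} → (∀ x → p x ≡ p′ x) → ∀ u → count p u ≡ count p′ u
    count-cong p≗p′ []      = refl
    count-cong {p} {p′} p≗p′ (x ∷ u) =
      trans (count-∷ p x u) (trans (cong₂ _+_ (cong indicator (p≗p′ x)) (count-cong p≗p′ u)) (sym (count-∷ p′ x u)))

    count-false : ∀ {p} → (∀ x → p x ≡ false) → ∀ u → count p u ≡ 0
    count-false p≗false u = trans (count-cong p≗false u) (count-none u)
      where
      count-none : ∀ u → count (λ _ → false) u ≡ 0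
      count-none []      = refl
      count-none (_ ∷ u) = count-none u

    module Binary (binary : ∀ x → x ≡ 0# ⊎ x ≡ 1#) (0<1 : 0# <F 1#) where
      open IsStrictTotalOrder O using (compare)

      0≢1 : 0# ≢ 1#
      0≢1 = FiniteField.0≢1 F

      1>0 : (1# >b 0#) ≡ true
      1>0 with compare 1# 0#
      ... | tri< _ _ 0≮1 = ⊥-elim (0≮1 0<1)
      ... | tri≈ _ _ 0≮1 = ⊥-elim (0≮1 0<1)
      ... | tri> _ _ _   = refl

      0≯1 : (0# >b 1#) ≡ false
      0≯1 with compare 0# 1#
      ... | tri< _ _ _   = refl
      ... | tri≈ _ _ _   = refl
      ... | tri> 0≮1 _ _ = ⊥-elim (0≮1 0<1)

      ≯1 : ∀ x → (x >b 1#) ≡ false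
      ≯1 x with binary x
      ... | inj₁ refl = 0≯1
      ... | inj₂ refl = >b-irrefl 1#

      0≯ : ∀ x → (0# >b x) ≡ false
      0≯ x with binary x
      ... | inj₁ refl = >b-irrefl 0#
      ... | inj₂ refl = 0≯1

      >0≡isOne : ∀ x → (x >b 0#) ≡ ⌊ x Fin.≟ 1# ⌋
      >0≡isOne x with binary x | x Fin.≟ 1#
      ... | inj₁ refl | yes 0≡1 = ⊥-elim (0≢1 0≡1)
      ... | inj₁ refl | no  _   = >b-irrefl 0#
      ... | inj₂ refl | yes _   = 1>0
      ... | inj₂ refl | no  1≢1 = ⊥-elim (1≢1 refl)

      isOne+isZero≡1 : ∀ x → indicator ⌊ x Fin.≟ 1# ⌋ + indicator (1# >b x) ≡ 1
      isOne+isZero≡1 x with binary x | x Fin.≟ 1#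
      ... | inj₁ refl | yes 0≡1 = ⊥-elim (0≢1 0≡1)
      ... | inj₁ refl | no  _   = cong indicator 1>0
      ... | inj₂ refl | yes _   = cong (λ b → 1 + indicator b) (>b-irrefl 1#)
      ... | inj₂ refl | no  1≢1 = ⊥-elim (1≢1 refl)

      wt+zeros≡length : ∀ u → wt u + count (1# >b_) u ≡ length u
      wt+zeros≡length []      = refl
      wt+zeros≡length (x ∷ u) = begin
        wt (x ∷ u) + count (1# >b_) (x ∷ u)
          ≡⟨ cong₂ _+_ (count-∷ isOne x u) (count-∷ (1# >b_) x u) ⟩
        (indicator ⌊ x Fin.≟ 1# ⌋ + wt u) + (indicator (1# >b x) + count (1# >b_) u)
          ≡⟨ solve 4 (λ a b c d → (a :+ b) :+ (c :+ d) := (a :+ c) :+ (b :+ d)) refl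
                   (indicator ⌊ x Fin.≟ 1# ⌋) (wt u) (indicator (1# >b x)) (count (1# >b_) u) ⟩
        (indicator ⌊ x Fin.≟ 1# ⌋ + indicator (1# >b x)) + (wt u + count (1# >b_) u)
          ≡⟨ cong₂ _+_ (isOne+isZero≡1 x) (wt+zeros≡length u) ⟩
        suc (length u) ∎
        where open ≡-Reasoning

      inv-shift : ∀ v → Σ ℕ λ t → inv (shift v) + (length v ∸ wt v) ≡ inv v + length v * t
      inv-shift []      = 0 , refl
      inv-shift (a ∷ u) with binary a
      ... | inj₂ refl = 0 , (begin
        inv (u ++ [ 1# ]) + (suc (length u) ∸ wt (1# ∷ u))
          ≡⟨ cong₂ _+_ (inv-∷ʳ u 1#) (cong (suc (length u) ∸_) (count-∷ isOne 1# u)) ⟩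
        (inv u + count (_>b 1#) u) + (suc (length u) ∸ (indicator ⌊ 1# Fin.≟ 1# ⌋ + wt u))
          ≡⟨ cong₂ (λ c o → (inv u + c) + (suc (length u) ∸ (indicator o + wt u))) (count-false ≯1 u) (trans (isYes≗does (1# Fin.≟ 1#)) (dec-true (1# Fin.≟ 1#) refl)) ⟩
        (inv u + 0) + (length u ∸ wt u)
          ≡⟨ cong₂ _+_ (ℕ.+-identityʳ (inv u)) (cong (_∸ wt u) (sym (wt+zeros≡length u))) ⟩
        inv u + ((wt u + count (1# >b_) u) ∸ wt u)
          ≡⟨ cong (inv u +_) (ℕ.m+n∸m≡n (wt u) _) ⟩
        inv u + count (1# >b_) u
          ≡⟨ solve 2 (λ i z → i :+ z := (z :+ i) :+ con 0) refl (inv u) (count (1# >b_) u) ⟩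
        (count (1# >b_) u + inv u) + 0
          ≡⟨ cong (count (1# >b_) u + inv u +_) (ℕ.*-zeroʳ (suc (length u))) ⟨
        inv (1# ∷ u) + suc (length u) * 0 ∎)
        where open ≡-Reasoning
      ... | inj₁ refl = 1 , (begin
        inv (u ++ [ 0# ]) + (suc (length u) ∸ wt (0# ∷ u))
          ≡⟨ cong₂ _+_ (inv-∷ʳ u 0#) (cong (suc (length u) ∸_) (count-∷ isOne 0# u)) ⟩
        (inv u + count (_>b 0#) u) + (suc (length u) ∸ (indicator ⌊ 0# Fin.≟ 1# ⌋ + wt u))
          ≡⟨ cong₂ (λ c o → (inv u + c) + (suc (length u) ∸ (indicator o + wt u))) (count-cong >0≡isOne u) (trans (isYes≗does (0# Fin.≟ 1#)) (dec-false (0# Fin.≟ 1#) 0≢1)) ⟩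
        (inv u + wt u) + (suc (length u) ∸ wt u)
          ≡⟨ ℕ.+-assoc (inv u) (wt u) _ ⟩
        inv u + (wt u + (suc (length u) ∸ wt u))
          ≡⟨ cong (inv u +_) (ℕ.m+[n∸m]≡n (ℕ.m≤n⇒m≤1+n (wt≤length u))) ⟩
        inv u + suc (length u)
          ≡⟨ cong₂ _+_ (cong (_+ inv u) (count-false 0≯ u)) (ℕ.*-identityʳ _) ⟨
        inv (0# ∷ u) + suc (length u) * 1 ∎)
        where open ≡-Reasoning

open WordStatistics

module CyclicSievingCriterion where
  open import Level using (0ℓ)
  open import Data.Nat as ℕ using (ℕ; zero; suc; _≤_; _<_; z≤n; s≤s; _%_; _/_)
  import Data.Nat.Properties as ℕ
  open import Data.Nat.DivMod using (m%n<n; m≡m%n+[m/n]*n; m<n⇒m%n≡m)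
  open import Data.Nat.Divisibility using (_∣_; divides; ∣⇒≤; m%n≡0⇒n∣m)
  open import Data.Nat.GCD using (gcd; gcd[m,n]∣m; gcd[m,n]∣n)
  open import Data.Nat.Coprimality using (gcd≡1⇒coprime; coprime-divisor)
  open import Data.Integer using (ℤ; +_)
  open import Data.Integer.DivMod using (n%ℕd<d)
  open import Data.Fin as Fin using (Fin)
  open import Data.List using (List; []; _∷_; map; length; applyUpTo; filter; filterᵇ; _∷ʳ_)
  import Data.List.Properties as List
  open import Data.List.Relation.Unary.All as All using (All)
  open import Data.List.Relation.Binary.Permutation.Propositional using (_↭_; ↭-sym; ↭⇒↭ₛ′)
  open import Data.List.Relation.Binary.Permutation.Propositional.Properties using (filter-↭; ↭-length; map⁺; ∷↭∷ʳ)
  import Data.List.Relation.Binary.Permutation.Setoid.Properties as SetoidPermutation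
  open import Data.List.Membership.Propositional using (_∈_)
  open import Data.List.Membership.Propositional.Properties using (∈-applyUpTo⁻)
  open import Data.Bool using (Bool; T; T?)
  open import Data.Product using (Σ; _×_; _,_)
  open import Data.Sum using (_⊎_; inj₁; inj₂; [_,_]′)
  open import Data.Nat.Solver using (module +-*-Solver)
  open import Data.Empty using (⊥-elim)
  open import Function using (_∘_)
  open import Function.Bundles using (_⇔_; mk⇔)
  open import Relation.Nullary using (¬_; yes; no; ⌊_⌋)
  open import Relation.Nullary.Decidable using (fromWitness; toWitness)
  open import Relation.Binary.PropositionalEquality as ≡ using (_≡_; _≢_)
  open import Algebra.Bundles using (CommutativeRing)
  open import Defs

  module RingSums (R : CommutativeRing 0ℓ 0ℓ) where
    open CommutativeRing R
    open import Algebra.Properties.Semiring.Exp semiring public using (_^_; ^-homo-*; ^-assocʳ; ^-congˡ)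
    open import Algebra.Definitions.RawMonoid +-rawMonoid public using () renaming (_×_ to _·_)
    open import Relation.Binary.Reasoning.Setoid setoid

    ∑ : List Carrier → Carrier
    ∑ = sumR R

    powR≡^ : ∀ x m → powR R x m ≡ x ^ m
    powR≡^ x zero    = ≡.refl
    powR≡^ x (suc m) = ≡.cong (x *_) (powR≡^ x m)

    natR≡· : ∀ m → natR R m ≡ m · 1#
    natR≡· zero    = ≡.refl
    natR≡· (suc m) = ≡.cong (_+_ 1#) (natR≡· m)

    1^n≈1 : ∀ n → 1# ^ n ≈ 1#
    1^n≈1 zero    = refl
    1^n≈1 (suc n) = trans (*-identityˡ _) (1^n≈1 n)

    ∑-↭ : ∀ {xs ys} → xs ↭ ys → ∑ xs ≈ ∑ ys
    ∑-↭ xs↭ys = SetoidPermutation.foldr-commMonoid setoid +-isCommutativeMonoid (↭⇒↭ₛ′ isEquivalence xs↭ys)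

    *-distribˡ-∑ : ∀ c xs → c * ∑ xs ≈ ∑ (map (c *_) xs)
    *-distribˡ-∑ c []       = zeroʳ c
    *-distribˡ-∑ c (x ∷ xs) = trans (distribˡ c x (∑ xs)) (+-congˡ (*-distribˡ-∑ c xs))

    ∑-applyUpTo-cong : ∀ {f g} n → (∀ j → f j ≈ g j) → ∑ (applyUpTo f n) ≈ ∑ (applyUpTo g n)
    ∑-applyUpTo-cong zero    f≈g = refl
    ∑-applyUpTo-cong (suc n) f≈g = +-cong (f≈g 0) (∑-applyUpTo-cong n (f≈g ∘ suc))

    ∑-applyUpTo-const : ∀ a n → ∑ (applyUpTo (λ _ → a) n) ≈ n · a
    ∑-applyUpTo-const a zero    = refl
    ∑-applyUpTo-const a (suc n) = +-congˡ (∑-applyUpTo-const a n)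

    ∑-map-cong : ∀ {A : Set} {f g : A → Carrier} xs → (∀ x → f x ≈ g x) → ∑ (map f xs) ≈ ∑ (map g xs)
    ∑-map-cong []       f≈g = refl
    ∑-map-cong (x ∷ xs) f≈g = +-cong (f≈g x) (∑-map-cong xs f≈g)

    ∑-ones : ∀ {A : Set} (f : A → Carrier) xs → (∀ x → f x ≈ 1#) → ∑ (map f xs) ≈ length xs · 1#
    ∑-ones f []       _    = refl
    ∑-ones f (x ∷ xs) fx≈1 = +-cong (fx≈1 x) (∑-ones f xs fx≈1)

  applyUpTo-rotate : ∀ {A : Set} (f : ℕ → A) n → f (suc n) ≡ f 0 → applyUpTo (f ∘ suc) (suc n) ↭ applyUpTo f (suc n)
  applyUpTo-rotate f n f[1+n]≡f0 = ≡.subst (_↭ applyUpTo f (suc n)) rotated (↭-sym (∷↭∷ʳ (f 0) (applyUpTo (f ∘ suc) n)))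
    where
    rotated : applyUpTo (f ∘ suc) n ∷ʳ f 0 ≡ applyUpTo (f ∘ suc) (suc n)
    rotated = ≡.trans (≡.cong (applyUpTo (f ∘ suc) n ∷ʳ_) (≡.sym f[1+n]≡f0)) (List.applyUpTo-∷ʳ (f ∘ suc) n)

  module CyclicSieving {q n′ : ℕ} (z w : List (Fin q)) where

    N : ℕ
    N = suc n′

    orbit : ℕ → List (Fin q)
    orbit j = shiftPow j w

    orbits : List (List (Fin q))
    orbits = z ∷ applyUpTo orbit N

    module _ (X : List (List (Fin q))) (X↭orbits : X ↭ orbits)
             (z-fixed : ∀ m → shiftPow m z ≡ z)
             (orbit-free : ∀ j m → 1 ≤ m → m < N → j < N → shiftPow m (orbit j) ≢ orbit j)
             (orbit-periodic : orbit N ≡ w)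
             (stat : List (Fin q) → ℕ) (c : ℕ) (stat-z : stat z ≡ 0)
             (stat-shift : ∀ j → Σ ℕ λ t → stat (orbit (suc j)) ℕ.+ c ≡ stat (orbit j) ℕ.+ N ℕ.* t)
             where

      fixed? : ℤ → List (Fin q) → Bool
      fixed? d v = ⌊ List.≡-dec Fin._≟_ (shiftZ N d v) v ⌋

      fixedCount : ℤ → ℕ
      fixedCount d = length (filterᵇ (fixed? d) X)

      private
        fixedCount≡ : ∀ d → fixedCount d ≡ length (filterᵇ (fixed? d) orbits)
        fixedCount≡ d = ↭-length (filter-↭ (T? ∘ fixed? d) X↭orbits)

      fixedCount-identity : ∀ d → zmod d N ≡ 0 → fixedCount d ≡ suc N
      fixedCount-identity d d≡0 = ≡.trans (fixedCount≡ d) (≡.trans (≡.cong length (List.filter-all (T? ∘ fixed? d) all-fixed))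
                                                                   (≡.cong suc (List.length-applyUpTo orbit N)))
        where
        all-fixed : All (T ∘ fixed? d) orbits
        all-fixed = All.universal (λ v → fromWitness (≡.cong (λ m → shiftPow m v) d≡0)) orbits

      fixedCount-nonidentity : ∀ d m → zmod d N ≡ suc m → fixedCount d ≡ 1
      fixedCount-nonidentity d m d≡1+m = ≡.trans (fixedCount≡ d)
        (≡.trans (≡.cong length (List.filter-accept (T? ∘ fixed? d) (fromWitness (z-fixed (zmod d N)))))
                 (≡.cong (suc ∘ length) (List.filter-none (T? ∘ fixed? d) (All.tabulate orbit-not-fixed))))
        where
        1+m<N : suc m < N
        1+m<N = ≡.subst (_< N) d≡1+m (n%ℕd<d d N)
        orbit-not-fixed : ∀ {v} → v ∈ applyUpTo orbit N → ¬ T (fixed? d v)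
        orbit-not-fixed v∈ with ∈-applyUpTo⁻ orbit v∈
        ... | j , j<N , ≡.refl = λ fixed → orbit-free j (suc m) (s≤s z≤n) 1+m<N j<N
                                    (≡.subst (λ k → shiftPow k (orbit j) ≡ orbit j) d≡1+m (toWitness fixed))

      module _ (D : RootData N) where
        open RootData D
        open CommutativeRing 𝕂
        open RingSums 𝕂
        open import Relation.Binary.Reasoning.Setoid setoid
        open import Algebra.Properties.Semiring.Mult semiring using (×-assoc-*; ×-congʳ)
        open import Algebra.Properties.Ring ring using (+-cancelˡ; -1*x≈-x; x∙y⁻¹≈ε⇒x≈y)

        orbitSum : Carrier → Carrier
        orbitSum u = ∑ (applyUpTo (λ j → u ^ stat (orbit j)) N)

        generatingFunction : ∀ u → ∑ (map (λ v → u ^ stat v) X) ≈ 1# + orbitSum u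
        generatingFunction u = begin
          ∑ (map (λ v → u ^ stat v) X)                                ≈⟨ ∑-↭ (map⁺ (λ v → u ^ stat v) X↭orbits) ⟩
          u ^ stat z + ∑ (map (λ v → u ^ stat v) (applyUpTo orbit N))  ≡⟨ ≡.cong₂ _+_ (≡.cong (u ^_) stat-z)
                                                                           (≡.cong ∑ (List.map-applyUpTo orbit (λ v → u ^ stat v) N)) ⟩
          1# + orbitSum u                                             ∎

        module _ {u} (u^N≈1 : u ^ N ≈ 1#) where

          u^c-step : ∀ j → u ^ c * u ^ stat (orbit (suc j)) ≈ u ^ stat (orbit j)
          u^c-step j with stat-shift j
          ... | t , s[1+j]+c≡s[j]+Nt = begin
            u ^ c * u ^ stat (orbit (suc j))        ≈⟨ *-comm _ _ ⟩
            u ^ stat (orbit (suc j)) * u ^ c        ≈⟨ ^-homo-* u (stat (orbit (suc j))) c ⟨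
            u ^ (stat (orbit (suc j)) ℕ.+ c)        ≡⟨ ≡.cong (u ^_) s[1+j]+c≡s[j]+Nt ⟩
            u ^ (stat (orbit j) ℕ.+ N ℕ.* t)        ≈⟨ ^-homo-* u (stat (orbit j)) (N ℕ.* t) ⟩
            u ^ stat (orbit j) * u ^ (N ℕ.* t)      ≈⟨ *-congˡ (^-assocʳ u N t) ⟨
            u ^ stat (orbit j) * (u ^ N) ^ t        ≈⟨ *-congˡ (trans (^-congˡ t u^N≈1) (1^n≈1 t)) ⟩
            u ^ stat (orbit j) * 1#                 ≈⟨ *-identityʳ _ ⟩
            u ^ stat (orbit j)                      ∎

          orbitSum-invariant : u ^ c * orbitSum u ≈ orbitSum u
          orbitSum-invariant = begin
            u ^ c * orbitSum u                                              ≈⟨ *-congˡ (∑-↭ (↭-sym (applyUpTo-rotate f n′ (≡.cong (λ v → u ^ stat v) orbit-periodic)))) ⟩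
            u ^ c * ∑ (applyUpTo (f ∘ suc) N)                               ≈⟨ *-distribˡ-∑ (u ^ c) (applyUpTo (f ∘ suc) N) ⟩
            ∑ (map (u ^ c *_) (applyUpTo (f ∘ suc) N))                      ≡⟨ ≡.cong ∑ (List.map-applyUpTo (f ∘ suc) (u ^ c *_) N) ⟩
            ∑ (applyUpTo (λ j → u ^ c * f (suc j)) N)                       ≈⟨ ∑-applyUpTo-cong N u^c-step ⟩
            orbitSum u                                                      ∎
            where
            f : ℕ → Carrier
            f j = u ^ stat (orbit j)

          orbitSum-vanishes : ¬ u ^ c ≈ 1# → orbitSum u ≈ 0#
          orbitSum-vanishes u^c≉1 with domain (u ^ c - 1#) (orbitSum u) [u^c-1]S≈0
            where
            [u^c-1]S≈0 : (u ^ c - 1#) * orbitSum u ≈ 0#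
            [u^c-1]S≈0 = begin
              (u ^ c - 1#) * orbitSum u                 ≈⟨ distribʳ (orbitSum u) (u ^ c) (- 1#) ⟩
              u ^ c * orbitSum u + - 1# * orbitSum u    ≈⟨ +-cong orbitSum-invariant (-1*x≈-x (orbitSum u)) ⟩
              orbitSum u - orbitSum u                   ≈⟨ -‿inverseʳ (orbitSum u) ⟩
              0#                                        ∎
          ... | inj₁ u^c-1≈0 = ⊥-elim (u^c≉1 (x∙y⁻¹≈ε⇒x≈y (u ^ c) 1# u^c-1≈0))
          ... | inj₂ S≈0     = S≈0

          orbitSum-constant : u ^ c ≈ 1# → orbitSum u ≈ N · u ^ stat w
          orbitSum-constant u^c≈1 = trans (∑-applyUpTo-cong N f≈f0) (∑-applyUpTo-const (u ^ stat w) N)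
            where
            f≈f0 : ∀ j → u ^ stat (orbit j) ≈ u ^ stat w
            f≈f0 zero    = refl
            f≈f0 (suc j) = trans (trans (sym (*-identityˡ _)) (trans (*-congʳ (sym u^c≈1)) (u^c-step j))) (f≈f0 j)

        ζ^N≈1 : ζ ^ N ≈ 1#
        ζ^N≈1 = trans (reflexive (≡.sym (powR≡^ ζ N))) root

        [ζ^m]^N≈1 : ∀ m → (ζ ^ m) ^ N ≈ 1#
        [ζ^m]^N≈1 m = begin
          (ζ ^ m) ^ N     ≈⟨ ^-assocʳ ζ m N ⟩
          ζ ^ (m ℕ.* N)   ≡⟨ ≡.cong (ζ ^_) (ℕ.*-comm m N) ⟩
          ζ ^ (N ℕ.* m)   ≈⟨ ^-assocʳ ζ N m ⟨
          (ζ ^ N) ^ m     ≈⟨ trans (^-congˡ m ζ^N≈1) (1^n≈1 m) ⟩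
          1#              ∎

        ζ-order : ∀ t → ζ ^ t ≈ 1# → N ∣ t
        ζ-order t ζ^t≈1 with t % N in t%N≡r
        ... | zero  = m%n≡0⇒n∣m t N t%N≡r
        ... | suc r = ⊥-elim (isPrimitiveRoot (suc r) (s≤s z≤n) (≡.subst (_< N) t%N≡r (m%n<n t N))
                        (trans (reflexive (powR≡^ ζ (suc r))) ζ^[1+r]≈1))
          where
          ζ^[1+r]≈1 : ζ ^ suc r ≈ 1#
          ζ^[1+r]≈1 = begin
            ζ ^ suc r                            ≈⟨ *-identityʳ _ ⟨
            ζ ^ suc r * 1#                       ≈⟨ *-congˡ (trans (^-congˡ (t / N) ζ^N≈1) (1^n≈1 (t / N))) ⟨
            ζ ^ suc r * (ζ ^ N) ^ (t / N)        ≈⟨ *-congˡ (^-assocʳ ζ N (t / N)) ⟩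
            ζ ^ suc r * ζ ^ (N ℕ.* (t / N))      ≈⟨ ^-homo-* ζ (suc r) (N ℕ.* (t / N)) ⟨
            ζ ^ (suc r ℕ.+ N ℕ.* (t / N))        ≡⟨ ≡.cong (ζ ^_) (≡.sym (≡.trans (m≡m%n+[m/n]*n t N) (≡.cong₂ ℕ._+_ t%N≡r (ℕ.*-comm (t / N) N)))) ⟩
            ζ ^ t                                ≈⟨ ζ^t≈1 ⟩
            1#                                   ∎

        eigenvalueSum≈ : ∀ d → sumR 𝕂 (map (λ v → powR 𝕂 (powR 𝕂 ζ (zmod d N)) (stat v)) X) ≈ 1# + orbitSum (ζ ^ zmod d N)
        eigenvalueSum≈ d = trans (∑-map-cong X (λ v → reflexive (≡.trans (powR≡^ _ (stat v)) (≡.cong (_^ stat v) (powR≡^ ζ (zmod d N))))))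
                                 (generatingFunction (ζ ^ zmod d N))

        coprime⇒sieving : gcd N c ≡ 1 → ∀ d → natR 𝕂 (fixedCount d) ≈ sumR 𝕂 (map (λ v → powR 𝕂 (powR 𝕂 ζ (zmod d N)) (stat v)) X)
        coprime⇒sieving gcd≡1 d = at (zmod d N) ≡.refl
          where
          at : ∀ m → zmod d N ≡ m → natR 𝕂 (fixedCount d) ≈ sumR 𝕂 (map (λ v → powR 𝕂 (powR 𝕂 ζ (zmod d N)) (stat v)) X)
          at zero    d≡0 = begin
            natR 𝕂 (fixedCount d)                                   ≡⟨ ≡.trans (≡.cong (natR 𝕂) (fixedCount-identity d d≡0)) (natR≡· (suc N)) ⟩
            suc N · 1#                                              ≡⟨ ≡.cong (_· 1#) (≡.trans (≡.cong suc (≡.sym (List.length-applyUpTo orbit N))) (≡.sym (↭-length X↭orbits))) ⟩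
            length X · 1#                                           ≈⟨ ∑-ones (λ v → 1# ^ stat v) X (1^n≈1 ∘ stat) ⟨
            ∑ (map (λ v → (ζ ^ 0) ^ stat v) X)                       ≡⟨ ≡.cong (λ m → ∑ (map (λ v → (ζ ^ m) ^ stat v) X)) (≡.sym d≡0) ⟩
            ∑ (map (λ v → (ζ ^ zmod d N) ^ stat v) X)                ≈⟨ ∑-map-cong X (λ v → reflexive (≡.sym (≡.trans (powR≡^ _ (stat v)) (≡.cong (_^ stat v) (powR≡^ ζ (zmod d N)))))) ⟩
            sumR 𝕂 (map (λ v → powR 𝕂 (powR 𝕂 ζ (zmod d N)) (stat v)) X) ∎
          at (suc m) d≡1+m = begin
            natR 𝕂 (fixedCount d)              ≡⟨ ≡.cong (natR 𝕂) (fixedCount-nonidentity d m d≡1+m) ⟩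
            1# + 0#                            ≈⟨ +-congˡ (orbitSum-vanishes ([ζ^m]^N≈1 (suc m)) u^c≉1) ⟨
            1# + orbitSum (ζ ^ suc m)          ≡⟨ ≡.cong (λ k → 1# + orbitSum (ζ ^ k)) (≡.sym d≡1+m) ⟩
            1# + orbitSum (ζ ^ zmod d N)       ≈⟨ eigenvalueSum≈ d ⟨
            sumR 𝕂 (map (λ v → powR 𝕂 (powR 𝕂 ζ (zmod d N)) (stat v)) X) ∎
            where
            1+m<N : suc m < N
            1+m<N = ≡.subst (_< N) d≡1+m (n%ℕd<d d N)
            u^c≉1 : ¬ (ζ ^ suc m) ^ c ≈ 1#
            u^c≉1 u^c≈1 = ℕ.<⇒≱ 1+m<N (∣⇒≤ (coprime-divisor {N} {c} (gcd≡1⇒coprime {N} {c} gcd≡1)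
              (≡.subst (N ∣_) (ℕ.*-comm (suc m) c) (ζ-order (suc m ℕ.* c) (trans (sym (^-assocʳ ζ (suc m) c)) u^c≈1)))))

        non-coprime⇒¬sieving : gcd N c ≢ 1
          → ¬ (∀ d → natR 𝕂 (fixedCount d) ≈ sumR 𝕂 (map (λ v → powR 𝕂 (powR 𝕂 ζ (zmod d N)) (stat v)) X))
        non-coprime⇒¬sieving gcd≢1 sieving with gcd[m,n]∣m N c | gcd[m,n]∣n N c
        ... | divides m N≡m*g | divides k c≡k*g = [ N·1≉0 , u^s≉0 ]′ (domain (N · 1#) (u ^ stat w) N·u^s≈0)
          where
          g = gcd N c
          m≢0 : m ≢ 0
          m≢0 m≡0 = ℕ.1+n≢0 (≡.trans N≡m*g (≡.cong (ℕ._* g) m≡0))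
          m<N : m < N
          m<N = ≡.subst (_< N) (ℕ.*-identityʳ m) (≡.subst (m ℕ.* 1 <_) (≡.sym N≡m*g) (ℕ.*-monoʳ-< m ⦃ ℕ.≢-nonZero m≢0 ⦄ 1<g))
            where
            1<g : 1 < g
            1<g with g
            ... | zero        = ⊥-elim (ℕ.1+n≢0 (≡.trans N≡m*g (ℕ.*-zeroʳ m)))
            ... | suc zero    = ⊥-elim (gcd≢1 ≡.refl)
            ... | suc (suc _) = s≤s (s≤s z≤n)
          u = ζ ^ m
          u^c≈1 : u ^ c ≈ 1#
          u^c≈1 = begin
            (ζ ^ m) ^ c     ≈⟨ ^-assocʳ ζ m c ⟩
            ζ ^ (m ℕ.* c)   ≡⟨ ≡.cong (ζ ^_) m*c≡N*k ⟩
            ζ ^ (N ℕ.* k)   ≈⟨ ^-assocʳ ζ N k ⟨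
            (ζ ^ N) ^ k     ≈⟨ trans (^-congˡ k ζ^N≈1) (1^n≈1 k) ⟩
            1#              ∎
            where
            m*c≡N*k : m ℕ.* c ≡ N ℕ.* k
            m*c≡N*k = ≡.trans (≡.cong (m ℕ.*_) c≡k*g) (≡.trans (solve 3 (λ m k g → m :* (k :* g) := k :* (m :* g)) ≡.refl m k g)
                        (≡.trans (≡.cong (k ℕ.*_) (≡.sym N≡m*g)) (ℕ.*-comm k N)))
              where open +-*-Solver
          zmod≡m : zmod (+ m) N ≡ m
          zmod≡m = m<n⇒m%n≡m m<N
          1+S≈1+0 : 1# + orbitSum u ≈ 1# + 0#
          1+S≈1+0 = begin
            1# + orbitSum u                                                    ≡⟨ ≡.cong (λ i → 1# + orbitSum (ζ ^ i)) (≡.sym zmod≡m) ⟩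
            1# + orbitSum (ζ ^ zmod (+ m) N)                                   ≈⟨ eigenvalueSum≈ (+ m) ⟨
            sumR 𝕂 (map (λ v → powR 𝕂 (powR 𝕂 ζ (zmod (+ m) N)) (stat v)) X)  ≈⟨ sieving (+ m) ⟨
            natR 𝕂 (fixedCount (+ m))                                          ≡⟨ ≡.cong (natR 𝕂) (fixedCount-nonidentity (+ m) (ℕ.pred m)
                                                                                    (≡.trans zmod≡m (≡.sym (ℕ.suc-pred m ⦃ ℕ.≢-nonZero m≢0 ⦄)))) ⟩
            1# + 0#                                                            ∎
          N·u^s≈0 : (N · 1#) * u ^ stat w ≈ 0#
          N·u^s≈0 = begin
            (N · 1#) * u ^ stat w     ≈⟨ ×-assoc-* N 1# (u ^ stat w) ⟩
            N · (1# * u ^ stat w)     ≈⟨ ×-congʳ N (*-identityˡ _) ⟩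
            N · u ^ stat w            ≈⟨ orbitSum-constant ([ζ^m]^N≈1 m) u^c≈1 ⟨
            orbitSum u                ≈⟨ +-cancelˡ 1# (orbitSum u) 0# 1+S≈1+0 ⟩
            0#                        ∎
          N·1≉0 : ¬ N · 1# ≈ 0#
          N·1≉0 N·1≈0 = char0 N ℕ.1+n≢0 (trans (reflexive (natR≡· N)) N·1≈0)
          u^s≉0 : ¬ u ^ stat w ≈ 0#
          u^s≉0 u^s≈0 = char0 1 ℕ.1+n≢0 (trans (+-identityʳ 1#) (begin
            1#                     ≈⟨ 1^n≈1 (stat w) ⟨
            1# ^ stat w            ≈⟨ ^-congˡ (stat w) ([ζ^m]^N≈1 m) ⟨
            (u ^ N) ^ stat w       ≈⟨ ^-assocʳ u N (stat w) ⟩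
            u ^ (N ℕ.* stat w)     ≡⟨ ≡.cong (u ^_) (ℕ.*-comm N (stat w)) ⟩
            u ^ (stat w ℕ.* N)     ≈⟨ ^-assocʳ u (stat w) N ⟨
            (u ^ stat w) ^ N       ≈⟨ ^-congˡ N u^s≈0 ⟩
            0# ^ N                 ≈⟨ zeroˡ _ ⟩
            0#                     ∎))

      csp⇔coprime : ¬ ¬ RootData N → CSP N X stat ⇔ (gcd N c ≡ 1)
      csp⇔coprime root-exists = mk⇔ to (λ gcd≡1 D → coprime⇒sieving D gcd≡1)
        where
        to : CSP N X stat → gcd N c ≡ 1
        to csp with gcd N c ℕ.≟ 1
        ... | yes gcd≡1 = gcd≡1
        ... | no  gcd≢1 = ⊥-elim (root-exists (λ D → non-coprime⇒¬sieving D gcd≢1 (csp D)))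

open CyclicSievingCriterion

module RootsOfUnity where
  open import Level using (0ℓ)
  open import Data.Nat as ℕ using (ℕ; zero; suc; _≤_; _<_; z≤n; s≤s)
  import Data.Nat.Properties as ℕ
  open import Data.Integer as ℤ using (ℤ; +_; -[1+_])
  import Data.Integer.Properties as ℤ
  open import Data.Sign as Sign using (Sign)
  open import Data.List using (List; []; _∷_; map; length; take; drop)
  import Data.List.Properties as List
  open import Data.Product using (Σ; _×_; _,_)
  open import Data.Sum using (_⊎_; inj₁; inj₂)
  import Data.Sum
  open import Data.Empty using (⊥-elim)
  open import Relation.Nullary using (¬_; Dec; yes; no)
  open import Relation.Nullary.Negation using (¬¬-Monad; ¬¬-map)
  open import Relation.Nullary.Decidable using (¬¬-excluded-middle)
  open import Effect.Monad using (RawMonad)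
  open import Data.Nat.Induction using (<-rec)
  open import Relation.Binary.PropositionalEquality as ≡ using (_≡_; _≢_; refl; cong; cong₂; sym; trans)
  open import Algebra.Bundles using (CommutativeRing)
  open import Defs using (RootData; powR; natR)
  open import Data.Rational as ℚ using (ℚ; 0ℚ; 1ℚ)
  import Data.Rational.Properties as ℚ

  module IntegerImage (R : CommRing) where
    open CommRing R
    open CommutativeRing commutativeRing using (+-assoc; +-comm; +-identityˡ; +-identityʳ; -‿inverseʳ;
      *-identityˡ; zeroˡ; distribʳ; ring; +-commutativeSemigroup)
    open import Algebra.Properties.Ring ring using (-0#≈0#; -‿+-comm; -‿involutive; -‿distribˡ-*; -‿distribʳ-*)
    open import Algebra.Properties.CommutativeSemigroup +-commutativeSemigroup using (interchange)
    open ≡.≡-Reasoning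

    fromℕ : ℕ → Carrier
    fromℕ zero    = 0#
    fromℕ (suc n) = 1# + fromℕ n

    fromℤ : ℤ → Carrier
    fromℤ (+ n)    = fromℕ n
    fromℤ -[1+ n ] = - fromℕ (suc n)

    fromℕ-+ : ∀ m n → fromℕ (m ℕ.+ n) ≡ fromℕ m + fromℕ n
    fromℕ-+ zero    n = sym (+-identityˡ _)
    fromℕ-+ (suc m) n = trans (cong (_+_ 1#) (fromℕ-+ m n)) (sym (+-assoc _ _ _))

    fromℕ-* : ∀ m n → fromℕ (m ℕ.* n) ≡ fromℕ m * fromℕ n
    fromℕ-* zero    n = sym (zeroˡ _)
    fromℕ-* (suc m) n = begin
      fromℕ (n ℕ.+ m ℕ.* n)          ≡⟨ fromℕ-+ n (m ℕ.* n) ⟩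
      fromℕ n + fromℕ (m ℕ.* n)      ≡⟨ cong₂ _+_ (sym (*-identityˡ _)) (fromℕ-* m n) ⟩
      1# * fromℕ n + fromℕ m * fromℕ n ≡⟨ sym (distribʳ _ _ _) ⟩
      (1# + fromℕ m) * fromℕ n       ∎

    fromℤ-⊖ : ∀ m n → fromℤ (m ℤ.⊖ n) ≡ fromℕ m - fromℕ n
    fromℤ-⊖ m       zero    = sym (trans (cong (_+_ (fromℕ m)) -0#≈0#) (+-identityʳ _))
    fromℤ-⊖ zero    (suc n) = sym (+-identityˡ _)
    fromℤ-⊖ (suc m) (suc n) = begin
      fromℤ (suc m ℤ.⊖ suc n)                  ≡⟨ cong fromℤ (ℤ.[1+m]⊖[1+n]≡m⊖n m n) ⟩
      fromℤ (m ℤ.⊖ n)                          ≡⟨ fromℤ-⊖ m n ⟩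
      fromℕ m - fromℕ n                        ≡⟨ +-identityˡ _ ⟨
      0# + (fromℕ m - fromℕ n)                 ≡⟨ cong (_+ (fromℕ m - fromℕ n)) (-‿inverseʳ 1#) ⟨
      (1# - 1#) + (fromℕ m - fromℕ n)          ≡⟨ interchange 1# (- 1#) (fromℕ m) (- fromℕ n) ⟩
      (1# + fromℕ m) + (- 1# - fromℕ n)        ≡⟨ cong (_+_ (1# + fromℕ m)) (-‿+-comm 1# (fromℕ n)) ⟩
      (1# + fromℕ m) - (1# + fromℕ n)          ∎

    fromℤ-+ : ∀ i j → fromℤ (i ℤ.+ j) ≡ fromℤ i + fromℤ j
    fromℤ-+ (+ m)    (+ n)    = fromℕ-+ m n
    fromℤ-+ (+ m)    -[1+ n ] = fromℤ-⊖ m (suc n)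
    fromℤ-+ -[1+ m ] (+ n)    = trans (fromℤ-⊖ n (suc m)) (+-comm _ _)
    fromℤ-+ -[1+ m ] -[1+ n ] = begin
      - fromℕ (suc (suc (m ℕ.+ n)))           ≡⟨ cong (λ k → - (1# + k)) (fromℕ-+ (suc m) n) ⟩
      - (1# + (fromℕ (suc m) + fromℕ n))      ≡⟨ cong -_ (trans (sym (+-assoc 1# _ _)) (cong (_+ fromℕ n) (+-comm 1# _))) ⟩
      - ((fromℕ (suc m) + 1#) + fromℕ n)      ≡⟨ cong -_ (+-assoc _ 1# _) ⟩
      - (fromℕ (suc m) + fromℕ (suc n))       ≡⟨ -‿+-comm _ _ ⟨
      - fromℕ (suc m) - fromℕ (suc n)         ∎

    private
      signed : Sign → Carrier → Carrier
      signed Sign.+ a = a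
      signed Sign.- a = - a

      fromℤ-◃ : ∀ s n → fromℤ (s ℤ.◃ n) ≡ signed s (fromℕ n)
      fromℤ-◃ Sign.+ zero    = refl
      fromℤ-◃ Sign.- zero    = sym -0#≈0#
      fromℤ-◃ Sign.+ (suc n) = refl
      fromℤ-◃ Sign.- (suc n) = refl

      fromℤ-signed : ∀ i → fromℤ i ≡ signed (ℤ.sign i) (fromℕ ℤ.∣ i ∣)
      fromℤ-signed (+ n)    = refl
      fromℤ-signed -[1+ n ] = refl

      signed-* : ∀ s t a b → signed (s Sign.* t) (a * b) ≡ signed s a * signed t b
      signed-* Sign.+ Sign.+ a b = refl
      signed-* Sign.+ Sign.- a b = -‿distribʳ-* a b
      signed-* Sign.- Sign.+ a b = -‿distribˡ-* a b
      signed-* Sign.- Sign.- a b = trans (sym (-‿involutive (a * b)))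
                                         (trans (cong -_ (-‿distribˡ-* a b)) (-‿distribʳ-* (- a) b))

    fromℤ-* : ∀ i j → fromℤ (i ℤ.* j) ≡ fromℤ i * fromℤ j
    fromℤ-* i j = begin
      fromℤ (ℤ.sign i Sign.* ℤ.sign j ℤ.◃ ℤ.∣ i ∣ ℕ.* ℤ.∣ j ∣)                       ≡⟨ fromℤ-◃ _ (ℤ.∣ i ∣ ℕ.* ℤ.∣ j ∣) ⟩
      signed (ℤ.sign i Sign.* ℤ.sign j) (fromℕ (ℤ.∣ i ∣ ℕ.* ℤ.∣ j ∣))                 ≡⟨ cong (signed (ℤ.sign i Sign.* ℤ.sign j)) (fromℕ-* ℤ.∣ i ∣ ℤ.∣ j ∣) ⟩
      signed (ℤ.sign i Sign.* ℤ.sign j) (fromℕ ℤ.∣ i ∣ * fromℕ ℤ.∣ j ∣)             ≡⟨ signed-* (ℤ.sign i) (ℤ.sign j) _ _ ⟩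
      signed (ℤ.sign i) (fromℕ ℤ.∣ i ∣) * signed (ℤ.sign j) (fromℕ ℤ.∣ j ∣)         ≡⟨ cong₂ _*_ (fromℤ-signed i) (fromℤ-signed j) ⟨
      fromℤ i * fromℤ j                                                          ∎

    fromℤ-neg : ∀ i → fromℤ (ℤ.- i) ≡ - fromℤ i
    fromℤ-neg (+ zero)  = sym -0#≈0#
    fromℤ-neg (+ suc n) = refl
    fromℤ-neg -[1+ n ]  = sym (-‿involutive _)

    fromℤ-1 : fromℤ (+ 1) ≡ 1#
    fromℤ-1 = +-identityʳ 1#

  record RingHom (R S : CommRing) : Set where
    private
      module R = CommRing R
      module S = CommRing S
    field
      ⟦_⟧   : R.Carrier → S.Carrier
      ⟦+⟧   : ∀ a b → ⟦ a R.+ b ⟧ ≡ ⟦ a ⟧ S.+ ⟦ b ⟧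
      ⟦*⟧   : ∀ a b → ⟦ a R.* b ⟧ ≡ ⟦ a ⟧ S.* ⟦ b ⟧
      ⟦-⟧   : ∀ a → ⟦ R.- a ⟧ ≡ S.- ⟦ a ⟧
      ⟦0⟧   : ⟦ R.0# ⟧ ≡ S.0#
      ⟦1⟧   : ⟦ R.1# ⟧ ≡ S.1#

  ℤ-commRing : CommRing
  ℤ-commRing = record { isCommutativeRing = ℤ.+-*-isCommutativeRing }

  fromℤ-hom : ∀ R → RingHom ℤ-commRing R
  fromℤ-hom R = record
    { ⟦_⟧ = fromℤ ; ⟦+⟧ = fromℤ-+ ; ⟦*⟧ = fromℤ-* ; ⟦-⟧ = fromℤ-neg ; ⟦0⟧ = refl ; ⟦1⟧ = fromℤ-1 }
    where open IntegerImage R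

  module MapPolynomial {R S : CommRing} (φ : RingHom R S) where
    open RingHom φ
    private
      module P = Polynomial R
      module Q = Polynomial S

    ⟦_⟧ₚ : P.Poly → Q.Poly
    ⟦_⟧ₚ = map ⟦_⟧

    ⟦+ₚ⟧ : ∀ f g → ⟦ f P.+ₚ g ⟧ₚ ≡ ⟦ f ⟧ₚ Q.+ₚ ⟦ g ⟧ₚ
    ⟦+ₚ⟧ []      g       = refl
    ⟦+ₚ⟧ (a ∷ f) []      = refl
    ⟦+ₚ⟧ (a ∷ f) (b ∷ g) = cong₂ _∷_ (⟦+⟧ a b) (⟦+ₚ⟧ f g)

    ⟦scale⟧ : ∀ a g → ⟦ P.scale a g ⟧ₚ ≡ Q.scale ⟦ a ⟧ ⟦ g ⟧ₚ
    ⟦scale⟧ a []      = refl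
    ⟦scale⟧ a (b ∷ g) = cong₂ _∷_ (⟦*⟧ a b) (⟦scale⟧ a g)

    ⟦*ₚ⟧ : ∀ f g → ⟦ f P.*ₚ g ⟧ₚ ≡ ⟦ f ⟧ₚ Q.*ₚ ⟦ g ⟧ₚ
    ⟦*ₚ⟧ []      g = refl
    ⟦*ₚ⟧ (a ∷ f) g = trans (⟦+ₚ⟧ (P.scale a g) _) (cong₂ Q._+ₚ_ (⟦scale⟧ a g) (cong₂ _∷_ ⟦0⟧ (⟦*ₚ⟧ f g)))

    ⟦-ₚ⟧ : ∀ f → ⟦ P.-ₚ f ⟧ₚ ≡ Q.-ₚ ⟦ f ⟧ₚ
    ⟦-ₚ⟧ []      = refl
    ⟦-ₚ⟧ (a ∷ f) = cong₂ _∷_ (⟦-⟧ a) (⟦-ₚ⟧ f)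

    ⟦1ₚ⟧ : ⟦ P.1ₚ ⟧ₚ ≡ Q.1ₚ
    ⟦1ₚ⟧ = cong (_∷ []) ⟦1⟧

    ⟦x^⟧ : ∀ j → ⟦ P.x^ j ⟧ₚ ≡ Q.x^ j
    ⟦x^⟧ zero    = ⟦1ₚ⟧
    ⟦x^⟧ (suc j) = cong₂ _∷_ ⟦0⟧ (⟦x^⟧ j)

    ⟦x^−1⟧ : ∀ j → ⟦ P.x^ j −1 ⟧ₚ ≡ Q.x^ j −1
    ⟦x^−1⟧ j = trans (⟦+ₚ⟧ (P.x^ j) (P.-ₚ P.1ₚ)) (cong₂ Q._+ₚ_ (⟦x^⟧ j) (trans (⟦-ₚ⟧ P.1ₚ) (cong Q.-ₚ_ ⟦1ₚ⟧)))

    ⟦∏x^i−1⟧ : ∀ m → ⟦ P.∏x^i−1 m ⟧ₚ ≡ Q.∏x^i−1 m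
    ⟦∏x^i−1⟧ zero    = ⟦1ₚ⟧
    ⟦∏x^i−1⟧ (suc m) = trans (⟦*ₚ⟧ (P.x^ suc m −1) (P.∏x^i−1 m)) (cong₂ Q._*ₚ_ (⟦x^−1⟧ (suc m)) (⟦∏x^i−1⟧ m))

    ⟦^⟧ : ∀ f m → ⟦ f P.^ m ⟧ₚ ≡ ⟦ f ⟧ₚ Q.^ m
    ⟦^⟧ f zero    = ⟦1ₚ⟧
    ⟦^⟧ f (suc m) = trans (⟦*ₚ⟧ f (f P.^ m)) (cong (⟦ f ⟧ₚ Q.*ₚ_) (⟦^⟧ f m))

    ⟦wrap⟧ : ∀ n m f → ⟦ P.wrap n m f ⟧ₚ ≡ Q.wrap n m ⟦ f ⟧ₚ
    ⟦wrap⟧ n zero    f = refl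
    ⟦wrap⟧ n (suc m) f = trans (⟦+ₚ⟧ (take n f) (P.wrap n m (drop n f)))
      (cong₂ Q._+ₚ_ (sym (List.take-map {f = ⟦_⟧} n f)) (trans (⟦wrap⟧ n m (drop n f)) (cong (Q.wrap n m) (sym (List.drop-map {f = ⟦_⟧} n f)))))

    coeff-⟦⟧ₚ : ∀ f i → Q.coeff ⟦ f ⟧ₚ i ≡ ⟦ P.coeff f i ⟧
    coeff-⟦⟧ₚ []      i       = sym ⟦0⟧
    coeff-⟦⟧ₚ (a ∷ f) zero    = refl
    coeff-⟦⟧ₚ (a ∷ f) (suc i) = coeff-⟦⟧ₚ f i

  ℚ-field : Field
  ℚ-field = record
    { commRing = record { isCommutativeRing = ℚ.+-*-isCommutativeRing }
    ; _≟_ = ℚ._≟_ ; 0≢1 = λ () ; inverse = λ x x≢0 → ℚ.1/_ x ⦃ ℚ.≢-nonZero x≢0 ⦄ , ℚ.*-inverseʳ x ⦃ ℚ.≢-nonZero x≢0 ⦄ }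

  private
    module ℚℤ = IntegerImage (Field.commRing ℚ-field)

    0<fromℕ[1+n] : ∀ n → 0ℚ ℚ.< ℚℤ.fromℕ (suc n)
    0≤fromℕ : ∀ n → 0ℚ ℚ.≤ ℚℤ.fromℕ n
    0≤fromℕ zero    = ℚ.≤-refl
    0≤fromℕ (suc n) = ℚ.<⇒≤ (0<fromℕ[1+n] n)
    0<fromℕ[1+n] n = ≡.subst (ℚ._< ℚℤ.fromℕ (suc n)) (ℚ.+-identityˡ 0ℚ) (ℚ.+-mono-<-≤ (ℚ.positive⁻¹ 1ℚ) (0≤fromℕ n))

    fromℕ[1+n]≢0 : ∀ n → ℚℤ.fromℕ (suc n) ≢ 0ℚ
    fromℕ[1+n]≢0 n eq = ℚ.<-irrefl (sym eq) (0<fromℕ[1+n] n)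

  fromℤ-ℚ-injective : ∀ z → IntegerImage.fromℤ (Field.commRing ℚ-field) z ≡ 0ℚ → z ≡ + 0
  fromℤ-ℚ-injective (+ zero)  _  = refl
  fromℤ-ℚ-injective (+ suc n) eq = ⊥-elim (fromℕ[1+n]≢0 n eq)
  fromℤ-ℚ-injective -[1+ n ]  eq = ⊥-elim (fromℕ[1+n]≢0 n (ℚ.neg-injective eq))

  module _ (S : CommRing) where
    private
      module Z = Polynomial ℤ-commRing
      module Q = PolynomialField ℚ-field
      module P = Polynomial S
      module ⟦Q⟧ = MapPolynomial (fromℤ-hom (Field.commRing ℚ-field))
      module ⟦S⟧ = MapPolynomial (fromℤ-hom S)

    ∣x^n−1-transfer : ∀ {n} h → 1 ≤ n → (Q.x^ n −1) Q.∣ ⟦Q⟧.⟦ h ⟧ₚ → (P.x^ n −1) P.∣ ⟦S⟧.⟦ h ⟧ₚ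
    ∣x^n−1-transfer {n} h 1≤n x^n−1∣h = P.wrap≋[]⇒∣ n ⟦S⟧.⟦ h ⟧ₚ (P.mk≋ wrapS-0)
      where
      wrapZ : Z.Poly
      wrapZ = Z.wrap n (length h) h

      ⟦wrap⟧ : ∀ {R} (φ : RingHom ℤ-commRing R) → Polynomial.wrap R n (length (map (RingHom.⟦_⟧ φ) h)) (map (RingHom.⟦_⟧ φ) h)
                                                  ≡ MapPolynomial.⟦_⟧ₚ φ wrapZ
      ⟦wrap⟧ φ = trans (cong (λ l → Polynomial.wrap _ n l (map (RingHom.⟦_⟧ φ) h)) (List.length-map _ h))
                       (sym (MapPolynomial.⟦wrap⟧ φ n (length h) h))

      wrapZ-0 : ∀ i → Z.coeff wrapZ i ≡ + 0
      wrapZ-0 i = fromℤ-ℚ-injective _ (trans (sym (⟦Q⟧.coeff-⟦⟧ₚ wrapZ i))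
        (trans (cong (λ f → Q.coeff f i) (sym (⟦wrap⟧ (fromℤ-hom (Field.commRing ℚ-field)))))
               (Q.coeff-≡ (Q.∣⇒wrap≋[] ⟦Q⟧.⟦ h ⟧ₚ 1≤n x^n−1∣h) i)))

      wrapS-0 : ∀ i → P.coeff (P.wrap n (length ⟦S⟧.⟦ h ⟧ₚ) ⟦S⟧.⟦ h ⟧ₚ) i ≡ P.coeff [] i
      wrapS-0 i = trans (cong (λ f → P.coeff f i) (⟦wrap⟧ (fromℤ-hom S)))
        (trans (⟦S⟧.coeff-⟦⟧ₚ wrapZ i) (cong (IntegerImage.fromℤ S) (wrapZ-0 i)))

  module CyclotomicFactor (n′ : ℕ) where
    open PolynomialField ℚ-field
    open Field ℚ-field using (inverse)
    open RawMonad (¬¬-Monad {0ℓ})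

    N : ℕ
    N = suc n′

    record IrreducibleFactor : Set where
      field
        P         : Poly
        P-irr     : Irreducible P
        P∣x^N−1   : P ∣ x^ N −1
        P∤∏x^i−1  : ¬ P ∣ ∏x^i−1 n′

    private
      E : Poly
      E = ∏x^i−1 n′

      Factorization : Poly → Set
      Factorization D = Σ Poly λ X → Σ Poly λ Y → X *ₚ Y ≋ D × ¬ DegBelow 1 X × ¬ DegBelow 1 Y

      constant-or-positive-degree : ∀ X → DegBelow 1 X ⊎ Σ ℕ λ a → HasDegree X a × 1 ≤ a
      constant-or-positive-degree X with zero-or-degree X
      ... | inj₁ X≋[]            = inj₁ (≋[]⇒DegBelow X≋[])
      ... | inj₂ (zero  , X°0)   = inj₁ (below X°0)
      ... | inj₂ (suc a , X°1+a) = inj₂ (suc a , X°1+a , s≤s z≤n)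

      positive-degree : ∀ X → ¬ DegBelow 1 X → Σ ℕ λ a → HasDegree X a × 1 ≤ a
      positive-degree X X≮1 with constant-or-positive-degree X
      ... | inj₁ X<1 = ⊥-elim (X≮1 X<1)
      ... | inj₂ deg = deg

      unfactorable⇒irreducible : ∀ {D m} → HasDegree D m → 1 ≤ m → ¬ Factorization D → Irreducible D
      unfactorable⇒irreducible {D} {m} D°m 1≤m unfactorable = record
        { deg = m ; deg-spec = D°m ; 1≤deg = 1≤m ; trivial-factor = trivial }
        where
        trivial : ∀ X Y → X *ₚ Y ≋ D → DegBelow 1 X ⊎ DegBelow 1 Y
        trivial X Y XY≋D with constant-or-positive-degree X | constant-or-positive-degree Y
        ... | inj₁ X<1 | _        = inj₁ X<1
        ... | inj₂ _   | inj₁ Y<1 = inj₂ Y<1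
        ... | inj₂ (_ , X°a , 1≤a) | inj₂ (_ , Y°b , 1≤b) = ⊥-elim (unfactorable (X , Y , XY≋D ,
              (λ X<1 → ℕ.<⇒≱ (HasDegree⇒< X°a X<1) 1≤a) , (λ Y<1 → ℕ.<⇒≱ (HasDegree⇒< Y°b Y<1) 1≤b)))

    -- Descent on the degree: a factor D of x^N − 1 with D ∤ E^(deg D) has an irreducible factor P ∤ E,
    -- since a factorization D = XY with X ∣ E^(deg X) and Y ∣ E^(deg Y) would give D ∣ E^(deg D).
    descent : ∀ m {D} → HasDegree D m → 1 ≤ m → D ∣ x^ N −1 → ¬ D ∣ E ^ m → ¬ ¬ IrreducibleFactor
    descent = <-rec _ step
      where
      step : ∀ m → (∀ {a} → a < m → ∀ {D} → HasDegree D a → 1 ≤ a → D ∣ x^ N −1 → ¬ D ∣ E ^ a → ¬ ¬ IrreducibleFactor)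
           → ∀ {D} → HasDegree D m → 1 ≤ m → D ∣ x^ N −1 → ¬ D ∣ E ^ m → ¬ ¬ IrreducibleFactor
      step m rec {D} D°m 1≤m D∣x^N−1 D∤E^m = ¬¬-excluded-middle >>= byFactorization
        where
        ∣E⇒∣E^ : ∀ k → 1 ≤ k → D ∣ E → D ∣ E ^ k
        ∣E⇒∣E^ (suc k) _ D∣E = x∣y⇒x∣yz (E ^ k) D∣E

        split : ∀ X Y → X *ₚ Y ≋ D → Σ ℕ (λ a → HasDegree X a × 1 ≤ a) → Σ ℕ (λ b → HasDegree Y b × 1 ≤ b)
              → ¬ ¬ IrreducibleFactor

        byFactorization : Dec (Factorization D) → ¬ ¬ IrreducibleFactor
        byFactorization (no unfactorable) = pure record
          { P = D ; P-irr = unfactorable⇒irreducible D°m 1≤m unfactorable ; P∣x^N−1 = D∣x^N−1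
          ; P∤∏x^i−1 = λ D∣E → D∤E^m (∣E⇒∣E^ m 1≤m D∣E) }
        byFactorization (yes (X , Y , XY≋D , X≮1 , Y≮1)) = split X Y XY≋D (positive-degree X X≮1) (positive-degree Y Y≮1)

        split X Y XY≋D (a , X°a , 1≤a) (b , Y°b , 1≤b) = ¬¬-excluded-middle >>= byX
          where
          a+b≡m : a ℕ.+ b ≡ m
          a+b≡m = HasDegree-unique (HasDegree-resp-≋ XY≋D (HasDegree-*ₚ X°a Y°b)) D°m
          a<m : a < m
          a<m = ≡.subst (a <_) a+b≡m (≡.subst (_≤ a ℕ.+ b) (ℕ.+-comm a 1) (ℕ.+-monoʳ-≤ a 1≤b))
          b<m : b < m
          b<m = ≡.subst (b <_) (trans (ℕ.+-comm b a) a+b≡m) (≡.subst (_≤ b ℕ.+ a) (ℕ.+-comm b 1) (ℕ.+-monoʳ-≤ b 1≤a))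
          X∣D : X ∣ D
          X∣D = Y , ≋-trans (*ₚ-comm Y X) XY≋D
          Y∣D : Y ∣ D
          Y∣D = X , XY≋D
          E^a*E^b≋E^m : E ^ a *ₚ E ^ b ≋ E ^ m
          E^a*E^b≋E^m = ≋-trans (≋-sym (^-homo-* E a b)) (≡⇒≋ (cong (E ^_) a+b≡m))
          byY : Dec (Y ∣ E ^ b) → X ∣ E ^ a → ¬ ¬ IrreducibleFactor
          byY (no Y∤E^b)  _      = rec b<m Y°b 1≤b (∣ʳ-trans Y∣D D∣x^N−1) Y∤E^b
          byY (yes Y∣E^b) X∣E^a = ⊥-elim (D∤E^m (∣ʳ-respˡ-≈ XY≋D (∣ʳ-respʳ-≈ E^a*E^b≋E^m (∣-*-∣ X∣E^a Y∣E^b))))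
          byX : Dec (X ∣ E ^ a) → ¬ ¬ IrreducibleFactor
          byX (no X∤E^a)  = rec a<m X°a 1≤a (∣ʳ-trans X∣D D∣x^N−1) X∤E^a
          byX (yes X∣E^a) = ¬¬-excluded-middle >>= λ Y∣E^b? → byY Y∣E^b? X∣E^a

    irreducibleFactor : ¬ x^ N −1 ∣ E ^ N → ¬ ¬ IrreducibleFactor
    irreducibleFactor = descent N (x^−1-degree n′) (s≤s z≤n) ∣ʳ-refl

    -- ℚ[x]/(P) is a characteristic-zero domain in which x is a primitive N-th root of unity.
    rootData : IrreducibleFactor → RootData N
    rootData factor = record
      { 𝕂 = 𝕂 ; ζ = x^ 1 ; domain = domain ; char0 = char0 ; root = root ; isPrimitiveRoot = x-primitive }
      where
      open IrreducibleFactor factor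
      𝕂 : CommutativeRing 0ℓ 0ℓ
      𝕂 = quotientRing P

      powR-x : ∀ j → powR 𝕂 (x^ 1) j ≋ x^ j
      powR-x zero    = ≋-refl
      powR-x (suc j) = ≋-trans (*ₚ-congˡ (x^ 1) (powR-x j)) (x^-+ 1 j)

      natR-constant : ∀ m → natR 𝕂 m ≋ constant (IntegerImage.fromℕ (Field.commRing ℚ-field) m)
      natR-constant zero    = []≋0∷[]
      natR-constant (suc m) = +ₚ-congˡ 1ₚ (natR-constant m)

      domain : ∀ f g → f *ₚ g ≈[ P ] [] → f ≈[ P ] [] ⊎ g ≈[ P ] []
      domain f g fg≈0 = Data.Sum.map ∣⇒mod0 ∣⇒mod0 (irreducible⇒prime P-irr f g (mod0⇒∣ fg≈0))

      char0 : ∀ m → m ≢ 0 → ¬ natR 𝕂 m ≈[ P ] []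
      char0 zero    0≢0 _   = 0≢0 refl
      char0 (suc m) _   m≈0 = P∤unit (inverse m′ (fromℕ[1+n]≢0 m)) (∣ʳ-respʳ-≈ (natR-constant (suc m)) (mod0⇒∣ m≈0))
        where
        m′ : ℚ
        m′ = IntegerImage.fromℕ (Field.commRing ℚ-field) (suc m)
        P∤unit : Σ ℚ (λ c → m′ ℚ.* c ≡ 1ℚ) → ¬ P ∣ constant m′
        P∤unit (c , m′c≡1) P∣m′ = Irreducible⇒∤1 P-irr (∣ʳ-respʳ-≈ c*m′≋1 (x∣ʳy⇒x∣ʳzy (constant c) P∣m′))
          where
          c*m′≋1 : constant c *ₚ constant m′ ≋ 1ₚ
          c*m′≋1 = ≋-trans (∷*ₚ≋scale c (constant m′) ≋-refl) (∷-cong (trans (ℚ.*-comm c m′) m′c≡1) ≋-refl)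

      root : powR 𝕂 (x^ 1) N ≈[ P ] 1ₚ
      root = mod-trans (≈⇒mod P (powR-x N)) (mod-divisor P∣x^N−1 (x^n≈1 N))

      x-primitive : ∀ j → 1 ≤ j → j < N → ¬ powR 𝕂 (x^ 1) j ≈[ P ] 1ₚ
      x-primitive j 1≤j j<N x^j≈1 = P∤∏x^i−1 (∣ʳ-trans (divides (mod-trans (mod-sym (≈⇒mod P (powR-x j))) x^j≈1))
                                                    (x^j−1∣∏x^i−1 1≤j (ℕ.≤-pred j<N)))

  -- A field with an irreducible polynomial dividing x^N − 1 but no x^j − 1 (0 < j < N) shows, after
  -- transfer along ℤ, that x^N − 1 ∤ (∏_{j<N} (x^j − 1))^N over ℚ; hence ℚ has such a factor too.
  rootData-exists : ∀ (F : Field) {n′ h} → let open PolynomialField F in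
                    Irreducible h → h ∣ x^ suc n′ −1 → (∀ j → 1 ≤ j → j < suc n′ → ¬ h ∣ x^ j −1) → ¬ ¬ RootData (suc n′)
  rootData-exists F {n′} {h} h-irr h∣x^N−1 h-order =
    ¬¬-map rootData (irreducibleFactor ℚ-divisible)
    where
    open CyclotomicFactor n′
    module K = PolynomialField F
    module Q = PolynomialField ℚ-field
    module Z = Polynomial ℤ-commRing
    E^N : Z.Poly
    E^N = Z.∏x^i−1 n′ Z.^ N
    ⟦E^N⟧ : ∀ S → MapPolynomial.⟦_⟧ₚ (fromℤ-hom S) E^N ≡ Polynomial._^_ S (Polynomial.∏x^i−1 S n′) N
    ⟦E^N⟧ S = trans (MapPolynomial.⟦^⟧ (fromℤ-hom S) (Z.∏x^i−1 n′) N) (cong (λ f → Polynomial._^_ S f N) (MapPolynomial.⟦∏x^i−1⟧ (fromℤ-hom S) n′))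
    ℚ-divisible : ¬ (Q.x^ N −1) Q.∣ (Q.∏x^i−1 n′ Q.^ N)
    ℚ-divisible x^N−1∣E^N = no-small-order (K.prime∣∏x^i−1 h-irr n′ (K.prime∣^⇒∣ h-irr N (K.∣ʳ-trans h∣x^N−1 F-divisible)))
      where
      F-divisible : (K.x^ N −1) K.∣ (K.∏x^i−1 n′ K.^ N)
      F-divisible = ≡.subst ((K.x^ N −1) K.∣_) (⟦E^N⟧ (Field.commRing F))
        (∣x^n−1-transfer (Field.commRing F) E^N (s≤s z≤n) (≡.subst ((Q.x^ N −1) Q.∣_) (sym (⟦E^N⟧ (Field.commRing ℚ-field))) x^N−1∣E^N))
      no-small-order : ¬ Σ ℕ (λ j → 1 ≤ j × j ≤ n′ × h K.∣ (K.x^ j −1))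
      no-small-order (j , 1≤j , j≤n′ , h∣x^j−1) = h-order j 1≤j (s≤s j≤n′) h∣x^j−1

open RootsOfUnity

module DualHammingCodes where
  open import Level using (0ℓ)
  open import Data.Nat as ℕ using (ℕ; zero; suc; _+_; _*_; _≤_; _<_; _∸_; z≤n; s≤s)
  import Data.Nat.Properties as ℕ
  open import Data.Nat.GCD using (gcd; gcd[m,n]∣m; gcd[m,n]∣n; gcd-greatest)
  open import Data.Nat.Divisibility as ℕ using (∣-antisym; ∣m+n∣m⇒∣n)
  open import Data.Fin as Fin using (Fin)
  open import Data.List using (List; []; _∷_; length; replicate; applyUpTo)
  import Data.List.Properties as List
  open import Data.List.Membership.Propositional using (_∈_; find; lose)
  open import Data.List.Membership.Propositional.Properties using (∈-applyUpTo⁺; ∈-applyUpTo⁻; ∈-filter⁺; ∈-filter⁻)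
  open import Data.List.Relation.Unary.Any using (here; there)
  open import Data.List.Relation.Unary.Any.Properties using (any⁺; any⁻)
  open import Data.List.Relation.Unary.All as All using (All; _∷_)
  open import Data.List.Relation.Unary.AllPairs using (_∷_)
  open import Data.List.Relation.Unary.Unique.Propositional using (Unique)
  import Data.List.Relation.Unary.Unique.Propositional.Properties as Unique
  open import Data.List.Relation.Binary.Permutation.Propositional using (_↭_)
  open import Data.Bool using (Bool; T; T?)
  open import Data.Product using (Σ; _×_; _,_; proj₂)
  open import Data.Sum using (_⊎_; inj₁; inj₂; [_,_]′)
  open import Data.Empty using (⊥; ⊥-elim)
  open import Function using (_∘_)
  open import Function.Bundles using (_⇔_)
  open import Relation.Nullary using (¬_; ⌊_⌋)
  open import Relation.Nullary.Decidable using (toWitness; fromWitness)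
  open import Relation.Binary using (Rel; IsStrictTotalOrder)
  open import Relation.Binary.PropositionalEquality as ≡ using (_≡_; _≢_; refl; sym; trans; cong; subst; subst₂)
  open import Defs

  gcd[n,n∸c]≡gcd[n,c] : ∀ n c → c ≤ n → gcd n (n ∸ c) ≡ gcd n c
  gcd[n,n∸c]≡gcd[n,c] n c c≤n = ∣-antisym (gcd-greatest (gcd[m,n]∣m n (n ∸ c)) d∣c) (gcd-greatest (gcd[m,n]∣m n c) d∣n∸c)
    where
    d∣c : gcd n (n ∸ c) ℕ.∣ c
    d∣c = ∣m+n∣m⇒∣n (subst (gcd n (n ∸ c) ℕ.∣_) (sym (ℕ.m∸n+n≡m c≤n)) (gcd[m,n]∣m n (n ∸ c))) (gcd[m,n]∣n n (n ∸ c))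
    d∣n∸c : gcd n c ℕ.∣ n ∸ c
    d∣n∸c = ∣m+n∣m⇒∣n (subst (gcd n c ℕ.∣_) (sym (ℕ.m+[n∸m]≡n c≤n)) (gcd[m,n]∣m n c)) (gcd[m,n]∣n n c)

  Fin2-binary : ∀ {q} → q ≡ 2 → (a b : Fin q) → a ≢ b → ∀ x → x ≡ a ⊎ x ≡ b
  Fin2-binary refl Fin.zero           Fin.zero           a≢b _                  = ⊥-elim (a≢b refl)
  Fin2-binary refl Fin.zero           (Fin.suc Fin.zero) _   Fin.zero           = inj₁ refl
  Fin2-binary refl Fin.zero           (Fin.suc Fin.zero) _   (Fin.suc Fin.zero) = inj₂ refl
  Fin2-binary refl (Fin.suc Fin.zero) Fin.zero           _   Fin.zero           = inj₂ refl
  Fin2-binary refl (Fin.suc Fin.zero) Fin.zero           _   (Fin.suc Fin.zero) = inj₁ refl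
  Fin2-binary refl (Fin.suc Fin.zero) (Fin.suc Fin.zero) a≢b _                  = ⊥-elim (a≢b refl)

  2≤q : ∀ {q} → FiniteField q → 2 ≤ q
  2≤q {zero}        F with FiniteField.0# F
  ... | ()
  2≤q {suc zero}    F = ⊥-elim (FiniteField.0≢1 F (Fin1-unique _ _))
    where
    Fin1-unique : (a b : Fin 1) → a ≡ b
    Fin1-unique Fin.zero Fin.zero = refl
  2≤q {suc (suc q)} F = s≤s (s≤s z≤n)

  2≤q^k : ∀ {q} → FiniteField q → ∀ {k} → 1 ≤ k → 2 ≤ q ℕ.^ k
  2≤q^k {q} F {suc k} _ = ℕ.≤-trans (2≤q F) (ℕ.≤-trans (ℕ.≤-reflexive (sym (ℕ.*-identityʳ q))) (ℕ.*-monoʳ-≤ q (ℕ.m^n>0 q ⦃ ℕ.>-nonZero (ℕ.≤-trans (s≤s z≤n) (2≤q F)) ⦄ k)))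

  module _ {q : ℕ} (F : FiniteField q) where
    open FiniteFieldPolynomials F
    open FiniteField F using (0#; 1#; 0≢1)

    module DualHammingCode {k n′ : ℕ} (1≤k : 1 ≤ k) (q^k≡ : q ℕ.^ k ≡ suc (suc n′)) {h g : List (Fin q)} (h°k : HasDegree h k)
      (h∣x^N−1 : h ∣ x^ suc n′ −1) (h-order : ∀ j → 1 ≤ j → j < suc n′ → ¬ h ∣ x^ j −1)
      (gh≋x^N−1 : g *ₚ h ≋ x^ suc n′ −1)
      where

      N : ℕ
      N = suc n′

      x^N≈1 : x^ N ≈[ h ] 1ₚ
      x^N≈1 = mod-divisor h∣x^N−1 (x^n≈1 N)

      h∣x*⇒h∣ : ∀ f → h ∣ x^ 1 *ₚ f → h ∣ f
      h∣x*⇒h∣ f h∣xf = mod0⇒∣ (begin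
        f                            ≈⟨ lift (≋-sym (*ₚ-identityˡ f)) ⟩
        1ₚ *ₚ f                      ≈⟨ *-congʳ-mod f (mod-sym x^N≈1) ⟩
        x^ N *ₚ f                    ≈⟨ lift (*ₚ-congʳ f (≋-sym (≋-trans (x^-+ n′ 1) (≡⇒≋ (cong x^_ (ℕ.+-comm n′ 1)))))) ⟩
        (x^ n′ *ₚ x^ 1) *ₚ f         ≈⟨ lift (*ₚ-assoc (x^ n′) (x^ 1) f) ⟩
        x^ n′ *ₚ (x^ 1 *ₚ f)         ≈⟨ *-congˡ-mod (x^ n′) (∣⇒mod0 h∣xf) ⟩
        x^ n′ *ₚ []                  ≈⟨ lift (*ₚ-zeroʳ (x^ n′)) ⟩
        []                           ∎)
        where
        lift : ∀ {a b} → a ≋ b → a ≈[ h ] b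
        lift = ≈⇒mod h
        open ≈[]-Reasoning h

      h∣x^*⇒h∣ : ∀ a f → h ∣ x^ a *ₚ f → h ∣ f
      h∣x^*⇒h∣ zero    f h∣f   = ∣ʳ-respʳ-≈ (*ₚ-identityˡ f) h∣f
      h∣x^*⇒h∣ (suc a) f h∣x^f = h∣x^*⇒h∣ a f (h∣x*⇒h∣ (x^ a *ₚ f)
        (∣ʳ-respʳ-≈ (≋-trans (*ₚ-congʳ f (≋-sym (x^-+ 1 a))) (*ₚ-assoc (x^ 1) (x^ a) f)) h∣x^f))

      h∤x^ : ∀ a → ¬ h ∣ x^ a
      h∤x^ a h∣x^a = HasDegree⇒∤1 h°k 1≤k (h∣x^*⇒h∣ a 1ₚ (∣ʳ-respʳ-≈ (≋-sym (*ₚ-identityʳ (x^ a))) h∣x^a))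

      x^-order : ∀ t m → x^ m *ₚ x^ t ≈[ h ] x^ t → h ∣ x^ m −1
      x^-order t m (mod h∣x^mx^t-x^t) = h∣x^*⇒h∣ t (x^ m −1) (∣ʳ-respʳ-≈ factor h∣x^mx^t-x^t)
        where
        factor : x^ m *ₚ x^ t -ₚ x^ t ≋ x^ t *ₚ (x^ m −1)
        factor = ≋-sym (≋-trans (x[y-z]≈xy-xz (x^ t) (x^ m) 1ₚ) (+ₚ-cong (*ₚ-comm (x^ t) (x^ m)) (-ₚ-cong (*ₚ-identityʳ (x^ t)))))

      g≉[] : ¬ g ≋ []
      g≉[] g≋[] = HasDegree⇒≉[] (x^−1-degree n′) (≋-trans (≋-sym gh≋x^N−1) (*ₚ-zeroˡ h g≋[]))

      private
        *ₚ-distribʳ--ₚ : ∀ a b → (a -ₚ b) *ₚ g ≋ a *ₚ g -ₚ b *ₚ g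
        *ₚ-distribʳ--ₚ a b = ≋-trans (*ₚ-distribʳ g a (-ₚ b)) (+ₚ-congˡ (a *ₚ g) (≋-sym (-‿distribˡ-* b g)))

        *[x^N−1]≋ : ∀ s → s *ₚ (x^ N −1) ≋ (s *ₚ h) *ₚ g
        *[x^N−1]≋ s = ≋-trans (*ₚ-congˡ s (≋-trans (≋-sym gh≋x^N−1) (*ₚ-comm g h))) (≋-sym (*ₚ-assoc s h g))

      *g-mod : ∀ {a b} → a ≈[ h ] b → a *ₚ g ≈[ x^ N −1 ] b *ₚ g
      *g-mod {a} {b} (mod (s , sh≋a-b)) = mod (s , ≋-trans (*[x^N−1]≋ s) (≋-trans (*ₚ-congʳ g sh≋a-b) (*ₚ-distribʳ--ₚ a b)))

      *g-cancel : ∀ {a b} → a *ₚ g ≈[ x^ N −1 ] b *ₚ g → a ≈[ h ] b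
      *g-cancel {a} {b} (mod (s , s[x^N−1]≋ag-bg)) = mod (s , *ₚ-cancelˡ g g≉[] (begin
        g *ₚ (s *ₚ h)      ≈⟨ *ₚ-comm g (s *ₚ h) ⟩
        (s *ₚ h) *ₚ g      ≈⟨ *[x^N−1]≋ s ⟨
        s *ₚ (x^ N −1)     ≈⟨ s[x^N−1]≋ag-bg ⟩
        a *ₚ g -ₚ b *ₚ g   ≈⟨ *ₚ-distribʳ--ₚ a b ⟨
        (a -ₚ b) *ₚ g      ≈⟨ *ₚ-comm (a -ₚ b) g ⟩
        g *ₚ (a -ₚ b)      ∎))
        where open ≋-Reasoning

      residue : Poly → List (Fin q)
      residue a = toWord k (Division.rem (divMod h°k a))

      residue≈ : ∀ a → a ≈[ h ] residue a
      residue≈ a = begin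
        a                    ≈⟨ ≈⇒mod h f≋quo*d+rem ⟩
        quo *ₚ h +ₚ rem      ≈⟨ +-cong-mod (∣⇒mod0 (x∣ʳyx h quo)) (mod-refl {rem} h) ⟩
        rem                  ≈⟨ ≈⇒mod h (≋-sym (toWord-≋ k rem rem<k)) ⟩
        residue a            ∎
        where
        open Division (divMod h°k a)
        open ≈[]-Reasoning h

      private
        zeroResidue : List (Fin q)
        zeroResidue = replicate k 0#

        residue≡⇒≈ : ∀ {a b} → residue a ≡ residue b → a ≈[ h ] b
        residue≡⇒≈ {a} {b} eq = mod-trans (residue≈ a) (subst (λ r → r ≈[ h ] b) (≡.sym eq) (mod-sym (residue≈ b)))

        residue≡0⇒∣ : ∀ {a} → residue a ≡ zeroResidue → h ∣ a
        residue≡0⇒∣ {a} eq = mod0⇒∣ (mod-trans (residue≈ a) (≈⇒mod h (≋-trans (≡⇒≋ eq) (replicate-0≋[] k))))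

        powerResidues : List (List (Fin q))
        powerResidues = zeroResidue ∷ applyUpTo (residue ∘ x^_) N

        powerResidues-unique : Unique powerResidues
        powerResidues-unique = All.tabulate zero∉ ∷ Unique.applyUpTo⁺₁ (residue ∘ x^_) N distinct
          where
          zero∉ : ∀ {v} → v ∈ applyUpTo (residue ∘ x^_) N → zeroResidue ≢ v
          zero∉ v∈ 0≡v with ∈-applyUpTo⁻ (residue ∘ x^_) v∈
          ... | e , _ , refl = h∤x^ e (residue≡0⇒∣ (≡.sym 0≡v))
          distinct : ∀ {i j} → i < j → j < N → residue (x^ i) ≢ residue (x^ j)
          distinct {i} {j} i<j j<N eq = h-order (j ∸ i) (ℕ.m<n⇒0<n∸m i<j) (ℕ.≤-<-trans (ℕ.m∸n≤m j i) j<N)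
            (x^-order i (j ∸ i) (mod-trans (≈⇒mod h (≋-trans (x^-+ (j ∸ i) i) (≡⇒≋ (cong x^_ (ℕ.m∸n+n≡m (ℕ.<⇒≤ i<j))))))
                                           (mod-sym (residue≡⇒≈ eq))))

        powerResidues-words : All (_∈ allWords q k) powerResidues
        powerResidues-words = ∈-allWords q k (List.length-replicate k)
          ∷ All.tabulate (λ v∈ → case (∈-applyUpTo⁻ (residue ∘ x^_) v∈))
          where
          case : ∀ {v} → Σ ℕ (λ e → e < N × v ≡ residue (x^ e)) → v ∈ allWords q k
          case (e , _ , refl) = ∈-allWords q k (length-toWord k (Division.rem (divMod h°k (x^ e))))

        enough-powerResidues : length (allWords q k) ≤ length powerResidues
        enough-powerResidues = ℕ.≤-reflexive (≡.trans (length-allWords q k) (≡.trans q^k≡ (cong suc (≡.sym (List.length-applyUpTo (residue ∘ x^_) N)))))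

      zero-or-power : ∀ a → h ∣ a ⊎ Σ ℕ λ e → e < N × a ≈[ h ] x^ e
      zero-or-power a = classify (pigeonhole (List.≡-dec Fin._≟_) powerResidues-unique powerResidues-words
                                    enough-powerResidues (∈-allWords q k (length-toWord k (Division.rem (divMod h°k a)))))
        where
        classify : residue a ∈ powerResidues → h ∣ a ⊎ Σ ℕ λ e → e < N × a ≈[ h ] x^ e
        classify (here eq)  = inj₁ (residue≡0⇒∣ eq)
        classify (there r∈) with ∈-applyUpTo⁻ (residue ∘ x^_) r∈
        ... | e , e<N , eq = inj₂ (e , e<N , residue≡⇒≈ eq)

      g<N : DegBelow N g
      g<N with zero-or-degree g
      ... | inj₁ g≋[]      = ⊥-elim (g≉[] g≋[])
      ... | inj₂ (m , g°m) = DegBelow-mono 1+m≤N (below g°m)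
        where
        m+k≡N : m ℕ.+ k ≡ N
        m+k≡N = HasDegree-unique (HasDegree-resp-≋ gh≋x^N−1 (HasDegree-*ₚ g°m h°k)) (x^−1-degree n′)
        1+m≤N : suc m ≤ N
        1+m≤N = subst (suc m ≤_) m+k≡N (subst (_≤ m ℕ.+ k) (ℕ.+-comm m 1) (ℕ.+-monoʳ-≤ m 1≤k))

      w : List (Fin q)
      w = toWord N g

      w≋g : w ≋ g
      w≋g = toWord-≋ N g g<N

      orbit : ℕ → List (Fin q)
      orbit j = shiftPow j w

      length-orbit : ∀ j → length (orbit j) ≡ N
      length-orbit j = ≡.trans (length-shiftPow j w) (length-toWord N g)

      orbit≈x^*g : ∀ j → j ≤ N → orbit j ≈[ x^ N −1 ] x^ (N ∸ j) *ₚ g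
      orbit≈x^*g j j≤N = begin
        orbit j                              ≈⟨ lift (≋-sym (*ₚ-identityˡ (orbit j))) ⟩
        1ₚ *ₚ orbit j                        ≈⟨ *-congʳ-mod (orbit j) (mod-sym (x^n≈1 N)) ⟩
        x^ N *ₚ orbit j                      ≈⟨ lift (*ₚ-congʳ (orbit j) (≋-sym (≋-trans (x^-+ (N ∸ j) j) (≡⇒≋ (cong x^_ (ℕ.m∸n+n≡m j≤N)))))) ⟩
        (x^ (N ∸ j) *ₚ x^ j) *ₚ orbit j      ≈⟨ lift (*ₚ-assoc (x^ (N ∸ j)) (x^ j) (orbit j)) ⟩
        x^ (N ∸ j) *ₚ (x^ j *ₚ orbit j)      ≈⟨ *-congˡ-mod (x^ (N ∸ j)) (subst (λ n → x^ j *ₚ orbit j ≈[ x^ n −1 ] w) (length-toWord N g) (shiftPow≈ j w)) ⟩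
        x^ (N ∸ j) *ₚ w                      ≈⟨ lift (*ₚ-congˡ (x^ (N ∸ j)) w≋g) ⟩
        x^ (N ∸ j) *ₚ g                      ∎
        where
        lift : ∀ {a b} → a ≋ b → a ≈[ x^ N −1 ] b
        lift = ≈⇒mod (x^ N −1)
        open ≈[]-Reasoning (x^ N −1)

      orbit-of : ∀ e → e < N → Σ ℕ λ j → j < N × orbit j ≈[ x^ N −1 ] x^ e *ₚ g
      orbit-of zero    _   = 0 , s≤s z≤n , ≈⇒mod (x^ N −1) (≋-trans w≋g (≋-sym (*ₚ-identityˡ g)))
      orbit-of (suc e) 1+e<N = N ∸ suc e , ℕ.∸-monoʳ-< (s≤s z≤n) (ℕ.<⇒≤ 1+e<N) ,
        subst (λ t → orbit (N ∸ suc e) ≈[ x^ N −1 ] x^ t *ₚ g) (ℕ.m∸[m∸n]≡n (ℕ.<⇒≤ 1+e<N)) (orbit≈x^*g (N ∸ suc e) (ℕ.m∸n≤m N (suc e)))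

      orbit-aperiodic : ∀ j m → 1 ≤ m → m < N → j < N → shiftPow m (orbit j) ≢ orbit j
      orbit-aperiodic j m 1≤m m<N j<N fixed = h-order m 1≤m m<N (x^-order t m (*g-cancel (begin
        (x^ m *ₚ x^ t) *ₚ g      ≈⟨ ≈⇒mod (x^ N −1) (*ₚ-assoc (x^ m) (x^ t) g) ⟩
        x^ m *ₚ (x^ t *ₚ g)      ≈⟨ *-congˡ-mod (x^ m) (mod-sym orbit≈) ⟩
        x^ m *ₚ orbit j          ≈⟨ subst (λ n → x^ m *ₚ orbit j ≈[ x^ n −1 ] orbit j) (length-orbit j) x^m*orbit≈ ⟩
        orbit j                  ≈⟨ orbit≈ ⟩
        x^ t *ₚ g                ∎)))
        where
        t = N ∸ j
        orbit≈ = orbit≈x^*g j (ℕ.<⇒≤ j<N)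
        x^m*orbit≈ : x^ m *ₚ orbit j ≈[ x^ length (orbit j) −1 ] orbit j
        x^m*orbit≈ = subst (λ v → x^ m *ₚ v ≈[ x^ length (orbit j) −1 ] orbit j) fixed (shiftPow≈ m (orbit j))
        open ≈[]-Reasoning (x^ N −1)

      orbit-injective : ∀ {i j} → i < j → j < N → orbit i ≢ orbit j
      orbit-injective {i} {j} i<j j<N orbit-i≡orbit-j = orbit-aperiodic i (j ∸ i) (ℕ.m<n⇒0<n∸m i<j)
        (ℕ.≤-<-trans (ℕ.m∸n≤m j i) j<N) (ℕ.<-trans i<j j<N)
        (≡.trans (shiftPow-+ (j ∸ i) i w) (≡.trans (cong (λ n → shiftPow n w) (ℕ.m∸n+n≡m (ℕ.<⇒≤ i<j))) (≡.sym orbit-i≡orbit-j)))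

      zeroCodeword : List (Fin q)
      zeroCodeword = replicate N 0#

      orbit≢zeroCodeword : ∀ j → j < N → orbit j ≢ zeroCodeword
      orbit≢zeroCodeword j j<N orbit≡0 = h∤x^ (N ∸ j) (mod0⇒∣ (*g-cancel (begin
        x^ (N ∸ j) *ₚ g    ≈⟨ mod-sym (orbit≈x^*g j (ℕ.<⇒≤ j<N)) ⟩
        orbit j            ≈⟨ ≈⇒mod (x^ N −1) (≋-trans (≡⇒≋ orbit≡0) (replicate-0≋[] N)) ⟩
        []                 ∎)))
        where open ≈[]-Reasoning (x^ N −1)

      orbits : List (List (Fin q))
      orbits = zeroCodeword ∷ applyUpTo orbit N

      orbits-unique : Unique orbits
      orbits-unique = All.tabulate zero∉ ∷ Unique.applyUpTo⁺₁ orbit N orbit-injective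
        where
        zero∉ : ∀ {v} → v ∈ applyUpTo orbit N → zeroCodeword ≢ v
        zero∉ v∈ 0≡v with ∈-applyUpTo⁻ orbit v∈
        ... | j , j<N , refl = orbit≢zeroCodeword j j<N (≡.sym 0≡v)

      private
        module D = FF F

        code : List (List (Fin q))
        code = D.code N w

        reduce : Poly → List (Fin q)
        reduce f = toWord N (wrap N (length f) f)

        length-reduce : ∀ f → length (reduce f) ≡ N
        length-reduce f = length-toWord N (wrap N (length f) f)

        reduce≈ : ∀ f → reduce f ≈[ x^ N −1 ] f
        reduce≈ f = mod-trans (≈⇒mod (x^ N −1) (toWord-≋ N _ (DegBelow-wrap N (length f) f (s≤s z≤n) ℕ.≤-refl)))
                              (wrap≈ N (length f) f)

        cmul≈ : ∀ a → D.cmul N a w ≈[ x^ N −1 ] a *ₚ g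
        cmul≈ a = subst (_≈[ x^ N −1 ] a *ₚ g) (≡.sym (cmul≡ N a w))
          (mod-trans (reduce≈ (a *ₚ w)) (≈⇒mod (x^ N −1) (*ₚ-congˡ a w≋g)))

        length-cmul : ∀ a → length (D.cmul N a w) ≡ N
        length-cmul a = ≡.trans (cong length (cmul≡ N a w)) (length-reduce (a *ₚ w))

        cmul≡ᶜ : ∀ a {v} → length v ≡ N → a *ₚ g ≈[ x^ N −1 ] v → D.cmul N a w ≡ v
        cmul≡ᶜ a |v|≡N ag≈v = ≈[x^n−1]⇒≡ (s≤s z≤n) (length-cmul a) |v|≡N (mod-trans (cmul≈ a) ag≈v)

        generates : List (Fin q) → List (Fin q) → Bool
        generates v a = ⌊ List.≡-dec Fin._≟_ (D.cmul N a w) v ⌋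

        cmul∈code : ∀ a → length a ≡ N → D.cmul N a w ∈ code
        cmul∈code a |a|≡N = ∈-filter⁺ (T? ∘ D.inIdeal N w) (∈-allWords q N {D.cmul N a w} (length-cmul a))
          (any⁺ (generates (D.cmul N a w)) (lose {P = T ∘ generates (D.cmul N a w)} (∈-allWords q N {a} |a|≡N) a-generates))
          where
          a-generates : T (generates (D.cmul N a w) a)
          a-generates = fromWitness refl

        orbits⊆code : ∀ {v} → v ∈ orbits → v ∈ code
        orbits⊆code (here refl) = subst (_∈ code) (cmul≡ᶜ zeroCodeword (List.length-replicate N) zero≈)
            (cmul∈code zeroCodeword (List.length-replicate N))
          where
          zero≈ : zeroCodeword *ₚ g ≈[ x^ N −1 ] zeroCodeword
          zero≈ = ≈⇒mod (x^ N −1) (≋-trans (*ₚ-zeroˡ g (replicate-0≋[] N)) (≋-sym (replicate-0≋[] N)))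
        orbits⊆code (there v∈) with ∈-applyUpTo⁻ orbit v∈
        ... | j , j<N , refl = subst (_∈ code) (cmul≡ᶜ (reduce (x^ (N ∸ j))) (length-orbit j) a*g≈)
            (cmul∈code (reduce (x^ (N ∸ j))) (length-reduce (x^ (N ∸ j))))
          where
          a*g≈ : reduce (x^ (N ∸ j)) *ₚ g ≈[ x^ N −1 ] orbit j
          a*g≈ = mod-trans (*-congʳ-mod g (reduce≈ (x^ (N ∸ j)))) (mod-sym (orbit≈x^*g j (ℕ.<⇒≤ j<N)))

        cmul∈orbits : ∀ a → D.cmul N a w ∈ orbits
        cmul∈orbits a = [ multiple , power ]′ (zero-or-power a)
          where
          multiple : h ∣ a → D.cmul N a w ∈ orbits
          multiple h∣a = here (cmul≡ᶜ a (List.length-replicate N)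
            (mod-trans (*g-mod (∣⇒mod0 h∣a)) (≈⇒mod (x^ N −1) (≋-sym (replicate-0≋[] N)))))
          power : Σ ℕ (λ e → e < N × a ≈[ h ] x^ e) → D.cmul N a w ∈ orbits
          power (e , e<N , a≈x^e) = there (in-orbit (orbit-of e e<N))
            where
            in-orbit : Σ ℕ (λ j → j < N × orbit j ≈[ x^ N −1 ] x^ e *ₚ g) → D.cmul N a w ∈ applyUpTo orbit N
            in-orbit (j , j<N , orbit≈) = subst (_∈ applyUpTo orbit N)
              (≡.sym (cmul≡ᶜ a (length-orbit j) (mod-trans (*g-mod a≈x^e) (mod-sym orbit≈)))) (∈-applyUpTo⁺ orbit j<N)

        code⊆orbits : ∀ {v} → v ∈ code → v ∈ orbits
        code⊆orbits {v} v∈code with find (any⁻ (generates v) (allWords q N)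
                                           (proj₂ (∈-filter⁻ (T? ∘ D.inIdeal N w) {xs = allWords q N} v∈code)))
        ... | a , _ , a-generates-v = subst (_∈ orbits) (toWitness a-generates-v) (cmul∈orbits a)

      code↭orbits : D.code N w ↭ orbits
      code↭orbits = unique-⇔⇒↭ (Unique.filter⁺ (T? ∘ D.inIdeal N w) (allWords-unique q N)) orbits-unique
                               code⊆orbits orbits⊆code

    module DualHammingSieving {k n′ : ℕ} (1≤k : 1 ≤ k) (q^k≡ : q ℕ.^ k ≡ suc (suc n′)) {h g : List (Fin q)}
      (h-irr : Irreducible h) (h°k : HasDegree h k)
      (h∣x^N−1 : h ∣ x^ suc n′ −1) (h-order : ∀ j → 1 ≤ j → j < suc n′ → ¬ h ∣ x^ j −1)
      (gh≋x^N−1 : g *ₚ h ≋ x^ suc n′ −1)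
      where
      open DualHammingCode 1≤k q^k≡ {g = g} h°k h∣x^N−1 h-order gh≋x^N−1

      private
        orbit-periodic : orbit N ≡ w
        orbit-periodic = subst (λ n → shiftPow n w ≡ w) (length-toWord N g) (shiftPow-length w)

        root : ¬ ¬ RootData N
        root = rootData-exists (finiteField F) h-irr h∣x^N−1 h-order

        sieving : ∀ (stat : List (Fin q) → ℕ) c → stat zeroCodeword ≡ 0
                → (∀ j → Σ ℕ λ t → stat (orbit (suc j)) + c ≡ stat (orbit j) + N * t)
                → CSP N (FF.code F N w) stat ⇔ (gcd N c ≡ 1)
        sieving stat c stat-0 stat-shift = CyclicSieving.csp⇔coprime zeroCodeword w (FF.code F N w) code↭orbits
          (λ m → shiftPow-replicate m N 0#) orbit-aperiodic orbit-periodic stat c stat-0 stat-shift root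

      maj-sieving : ∀ {_<F_ : Rel (Fin q) 0ℓ} (O : IsStrictTotalOrder _≡_ _<F_)
                  → CSP N (FF.code F N w) (FF.Stats.maj F O) ⇔ (gcd N (FF.Stats.cdes F O w) ≡ 1)
      maj-sieving O = sieving maj (cdes w) (majFrom-replicate 1 N 0#) maj-step
        where
        open FF.Stats F O
        open Statistics F O
        maj-step : ∀ j → Σ ℕ λ t → maj (orbit (suc j)) + cdes w ≡ maj (orbit j) + N * t
        maj-step j = let t , eq = maj-shift (orbit j) in
          t , subst₂ (λ c n → maj (orbit (suc j)) + c ≡ maj (orbit j) + n * t) (cdes-shiftPow j w) (length-orbit j) eq

      inv-sieving : q ≡ 2 → ∀ {_<F_ : Rel (Fin q) 0ℓ} (O : IsStrictTotalOrder _≡_ _<F_) → 0# <F 1#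
                  → CSP N (FF.code F N w) (FF.Stats.inv F O) ⇔ (gcd N (FF.wt F w) ≡ 1)
      inv-sieving q≡2 O 0<1 = subst (λ d → CSP N (FF.code F N w) inv ⇔ (d ≡ 1)) (gcd[n,n∸c]≡gcd[n,c] N (wt w) wt≤N)
        (sieving inv (N ∸ wt w) (inv-replicate N 0#) inv-step)
        where
        open FF F using (wt)
        open FF.Stats F O
        open Statistics F O
        open Binary (Fin2-binary q≡2 0# 1# 0≢1) 0<1
        wt≤N : wt w ≤ N
        wt≤N = subst (wt w ≤_) (length-toWord N g) (wt≤length w)
        inv-step : ∀ j → Σ ℕ λ t → inv (orbit (suc j)) + (N ∸ wt w) ≡ inv (orbit j) + N * t
        inv-step j = let t , eq = inv-shift (orbit j) in
          t , subst₂ (λ c n → inv (orbit (suc j)) + (n ∸ c) ≡ inv (orbit j) + n * t) (wt-shiftPow j w) (length-orbit j) eq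

open DualHammingCodes

open import Defs
open import Level using (0ℓ)
open import Data.Nat using (ℕ; _^_; _∸_; _≤_)
open import Data.Nat.GCD using (gcd)
open import Data.Fin using (Fin)
open import Data.Product using (_×_; _,_)
open import Relation.Binary using (Rel; IsStrictTotalOrder)
open import Relation.Binary.PropositionalEquality using (_≡_; sym; trans; cong)
open import Function.Bundles using (_⇔_)
open import Data.Nat as ℕ using (zero; suc; _+_; _<_; s≤s; z≤n)
open import Relation.Nullary using (¬_)
import Data.Nat.Properties as ℕ
open import Data.Empty using (⊥-elim)

proposition4p4 : (q k : ℕ) → IsPrimePower q → 1 ≤ k → (F : FiniteField q)
    → (gperp g : FF.Poly F) → FF.Primitive F k gperp
    → FF._≈p_ F (FF._*p_ F g gperp) (FF.xpowMinus1 F (q ^ k ∸ 1))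
    → ((_<F_ : Rel (Fin q) 0ℓ) → (O : IsStrictTotalOrder _≡_ _<F_)
        → CSP (q ^ k ∸ 1) (FF.code F (q ^ k ∸ 1) (FF.toWord F (q ^ k ∸ 1) g)) (FF.Stats.maj F O)
          ⇔ (gcd (q ^ k ∸ 1) (FF.Stats.cdes F O (FF.toWord F (q ^ k ∸ 1) g)) ≡ 1))
    × (q ≡ 2 → (_<F_ : Rel (Fin q) 0ℓ) → (O : IsStrictTotalOrder _≡_ _<F_)
        → FiniteField.0# F <F FiniteField.1# F
        → CSP (q ^ k ∸ 1) (FF.code F (q ^ k ∸ 1) (FF.toWord F (q ^ k ∸ 1) g)) (FF.Stats.inv F O)
          ⇔ (gcd (q ^ k ∸ 1) (FF.wt F (FF.toWord F (q ^ k ∸ 1) g)) ≡ 1))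
proposition4p4 q k _ 1≤k F h g (deg≡k , h-irr , h∣x^N−1 , h-order) gh≈x^N−1 with q ^ k ∸ 1 in q^k∸1≡N
... | zero   = ⊥-elim (ℕ.<⇒≢ (ℕ.∸-monoˡ-< (2≤q^k F 1≤k) (s≤s z≤n)) (sym q^k∸1≡N))
... | suc n′ = (λ _ → maj-sieving) , (λ q≡2 _ → inv-sieving q≡2)
  where
  open FiniteFieldPolynomials F using (irreducible; deg≡⇒HasDegree; ∣p-x^−1⇒∣; ∤p-x^−1⇒∤; ≈p-x^−1⇒≋; _∣_; x^_−1)
  h-order′ : ∀ j → 1 ≤ j → j < suc n′ → ¬ h ∣ x^ j −1
  h-order′ j 1≤j j<N = ∤p-x^−1⇒∤ {n = j} (h-order j 1≤j j<N)
  q^k≡ : q ^ k ≡ suc (suc n′)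
  q^k≡ = trans (sym (ℕ.m∸n+n≡m (ℕ.≤-trans (s≤s z≤n) (2≤q^k F 1≤k)))) (trans (cong (_+ 1) q^k∸1≡N) (ℕ.+-comm (suc n′) 1))
  open DualHammingSieving F 1≤k q^k≡ {h} {g} (irreducible h-irr) (deg≡⇒HasDegree (irreducible h-irr) deg≡k)
    (∣p-x^−1⇒∣ {n = suc n′} h∣x^N−1) h-order′ (≈p-x^−1⇒≋ {g} {h} {suc n′} gh≈x^N−1)
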